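{- Let $M$ be a Motzkin path of length $n$ whose last step is a south-east step (i.e. $m_n=-1$), and let $M'$ be the Motzkin path of length $n+1$ obtained by inserting an east step (a $0$) immediately before the last step of $M$. Then for every positive integer $l$, \[ w_l(M')=(l+2n)\,w_l(M). \]
   Context: A Motzkin path of length $n$ is a sequence $(m_1,\dots,m_n)\in\{1,0,-1\}^n$ with nonnegative partial sums and total sum $0$. For a centred Catalan set $S$ (an $(n+1)$-subset of $\{ -n,\dots,n\}$ with $|S\cap\{ -i,\dots,i\}|\ge i+1$ for $0\le i\le n$), $\mathbf{M}(S)=(m_1,\dots,m_n)$ with $m_i=|\{ -i,i\}\cap S|-1$. An $(n,l)$-AS-trapezoid is an array of $n$ centred rows, the $i$-th row from the bottom having $l+2i-1$ entries from $\{ -1,0,1\}$, such that all row sums are $1$, the column sums of the central $l-1$ columns are $0$, the nonzero entries in every row and in every column alternate in sign, and in every column the first nonzero entry from the top is positive. Label the columns $-n+1,\dots,l+n-1$. $\mathcal{S}(A)$ is $\{0\}\cup\{c-1: c\le 0,\ \text{column } c\text{ has positive sum}\}\cup\{c-(l-1): c\ge1,\ \text{column } c\text{ has positive sum}\}$, and $\mathbf{M}(A)=\mathbf{M}(\mathcal{S}(A))$. For a Motzkin path $M$ of length $n$, $w_l(M)$ is the number of $(n,l)$-AS-trapezoids $A$ with $\mathbf{M}(A)=M$. -}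

module Defs where

open import Data.Bool using (T?; Bool; true; false; _∧_; if_then_else_; T)
open import Data.Nat as ℕ using (ℕ; zero; suc; _∸_)
open import Data.Integer as ℤ using (ℤ; +_; 0ℤ; 1ℤ; -1ℤ; _≤_)
open import Data.List using (List; []; _∷_; _++_; [_]; map; concatMap; filter; length;
  upTo; scanl; foldr; reverse; replicate; zip)
open import Data.Bool.ListAction using (all; any)
open import Data.List.Relation.Unary.All using (All)
open import Data.List.Properties using (≡-dec)
open import Data.Product using (_×_; _,_)
open import Data.Sum using (_⊎_)
open import Relation.Nullary using (¬?; _×-dec_)
open import Relation.Nullary.Decidable using (⌊_⌋)
open import Relation.Binary.PropositionalEquality using (_≡_)

sumℤ : List ℤ → ℤ
sumℤ = foldr ℤ._+_ 0ℤ

record IsMotzkin (M : List ℤ) : Set where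
  field
    steps    : All (λ x → x ≡ 1ℤ ⊎ x ≡ 0ℤ ⊎ x ≡ -1ℤ) M
    nonneg   : All (0ℤ ≤_) (scanl ℤ._+_ 0ℤ M)
    totalSum : sumℤ M ≡ 0ℤ

-- Candidate (n,l)-arrays: n rows, listed from the BOTTOM, the i-th row
-- (i = 1..n) being a list of l+2i-1 entries from {-1,0,1}.

vals : List ℤ
vals = -1ℤ ∷ 0ℤ ∷ 1ℤ ∷ []

wordsOf : ℕ → List (List ℤ)
wordsOf zero    = [] ∷ []
wordsOf (suc k) = concatMap (λ x → map (x ∷_) (wordsOf k)) vals

candidates : ℕ → ℕ → List (List (List ℤ))
candidates l zero    = [] ∷ []
candidates l (suc n) =
  concatMap (λ A → map (λ r → A ++ [ r ]) (wordsOf (l ℕ.+ 2 ℕ.* suc n ∸ 1)))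
            (candidates l n)

-- Centring: embed the rows into a rectangle of width l+2n-1, listed from
-- the TOP; row i (from the bottom) is padded by n-i zeros on each side.
-- Grid index j (0-based) corresponds to column label c = j - n + 1.
padTop : ℕ → List (List ℤ) → List (List ℤ)
padTop k []       = []
padTop k (r ∷ rs) = (replicate k 0ℤ ++ r ++ replicate k 0ℤ) ∷ padTop (suc k) rs

grid : List (List ℤ) → List (List ℤ)
grid A = padTop 0 (reverse A)

at : List ℤ → ℕ → ℤ
at []       _       = 0ℤ
at (x ∷ xs) zero    = x
at (x ∷ xs) (suc j) = at xs j

column : List (List ℤ) → ℕ → List ℤ
column A j = map (λ row → at row j) (grid A)

colIndices : ℕ → ℕ → List (ℕ × ℤ)
colIndices n l = map (λ j → j , ((+ j) ℤ.- (+ n)) ℤ.+ 1ℤ) (upTo (l ℕ.+ 2 ℕ.* n ∸ 1))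

nonzeros : List ℤ → List ℤ
nonzeros = filter (λ x → ¬? (x ℤ.≟ 0ℤ))

alternates : List ℤ → Bool
alternates []           = true
alternates (x ∷ [])     = true
alternates (x ∷ y ∷ ys) = ⌊ x ℤ.* y ℤ.<? 0ℤ ⌋ ∧ alternates (y ∷ ys)

firstPositive : List ℤ → Bool
firstPositive []      = true
firstPositive (x ∷ _) = ⌊ 0ℤ ℤ.<? x ⌋

isCentral : ℕ → ℤ → Bool
isCentral l c = ⌊ 1ℤ ℤ.≤? c ⌋ ∧ ⌊ c ℤ.≤? (+ l) ℤ.- 1ℤ ⌋

-- A is an (n,l)-AS-trapezoid (given A ∈ candidates l n)
isASTrapezoid : ℕ → ℕ → List (List ℤ) → Bool
isASTrapezoid n l A =
  all (λ r → ⌊ sumℤ r ℤ.≟ 1ℤ ⌋ ∧ alternates (nonzeros r)) A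
  ∧ all (λ { (j , c) → (if isCentral l c then ⌊ sumℤ (column A j) ℤ.≟ 0ℤ ⌋ else true)
                       ∧ alternates (nonzeros (column A j))
                       ∧ firstPositive (nonzeros (column A j)) })
        (colIndices n l)

shiftCol : ℕ → ℤ → ℤ
shiftCol l c = if ⌊ c ℤ.≤? 0ℤ ⌋ then c ℤ.- 1ℤ else c ℤ.- ((+ l) ℤ.- 1ℤ)

S-of : ℕ → ℕ → List (List ℤ) → List ℤ
S-of n l A =
  0ℤ ∷ map (λ { (j , c) → shiftCol l c })
           (filter (λ { (j , c) → 0ℤ ℤ.<? sumℤ (column A j) }) (colIndices n l))

memb : ℤ → List ℤ → Bool
memb x S = any (λ s → ⌊ s ℤ.≟ x ⌋) S

indicator : Bool → ℤ
indicator true  = 1ℤ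
indicator false = 0ℤ

M-of-set : ℕ → List ℤ → List ℤ
M-of-set n S =
  map (λ i → (indicator (memb (ℤ.- (+ i)) S) ℤ.+ indicator (memb (+ i) S)) ℤ.- 1ℤ)
      (map suc (upTo n))

M-of : ℕ → ℕ → List (List ℤ) → List ℤ
M-of n l A = M-of-set n (S-of n l A)

w : ℕ → List ℤ → ℕ
w l M = length (filter (λ A → T? (isASTrapezoid n l A) ×-dec ≡-dec ℤ._≟_ (M-of n l A) M)
                       (candidates l n))
  where n = length M

-- Fix the lowest n - 1 rows C of an array.  The top row of an AS-trapezoid has no
-- negative entry (each of its entries starts a column) and sums to 1, so it is a unit
-- vector δ_q; m_n = -1 keeps q off the two outer positions, and whether C topped by δ_q
-- is counted by w_l(M) only depends on C and q.  For M′ the two top rows r₁, r₂ over C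
-- are folded into the single row r₁ + r₂ (aligned over C), which must be δ_q plus one
-- unit in an outer position (m′_n = 0, m′_{n+1} = -1), and r₁ = δ_{t+1}.  Then
-- r₂ = δ_q + (outer unit) - δ_t is an alternating row for the left unit iff t ≤ q and
-- for the right unit iff q ≤ t, so every admissible q comes from
-- Σ_{t < k} ([t ≤ q] + [q ≤ t]) = k + 1 = l + 2n pairs, where k = l + 2n - 1 is the
-- width of the top row of an (n, l)-trapezoid.

module Submission where

open import Defs
open import Function using (_∘_; id)
open import Data.Nat as ℕ using (ℕ; zero; suc; _+_; _*_; _∸_; _≤_; _<_; z≤n; s≤s)
import Data.Nat.Properties as ℕP
open ℕP using (+-assoc; +-comm; +-identityʳ; *-zeroʳ; *-distribˡ-+)
open import Data.Nat.Tactic.RingSolver using () renaming (solve-∀ to solveℕ)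
open import Data.Integer as ℤ using (ℤ; 0ℤ; 1ℤ; -1ℤ; _⊖_)
import Data.Integer.Properties as ℤP
open import Data.Integer.Tactic.RingSolver using (solve-∀)
open import Data.List using (List; []; _∷_; _++_; map; concatMap; filter; length; upTo; applyUpTo; replicate; reverse; _∷ʳ_)
import Data.List.Properties as LP
open import Data.List.Relation.Unary.All as All using (All; []; _∷_)
open import Data.List.Relation.Unary.All.Properties using (++⁺)
open import Data.Bool using (Bool; true; false; _∧_; _∨_; _xor_; not; if_then_else_)
open import Data.Bool.ListAction using (all; any)
import Data.Bool.Properties as BP
open BP using (∧-assoc; ∧-zeroʳ; ∧-identityʳ)
open import Data.Sum as Sum using (_⊎_; inj₁; inj₂; [_,_]′)
open import Data.Product using (_×_; _,_; proj₁; proj₂; ∃)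
open import Data.Empty using (⊥; ⊥-elim)
open import Relation.Nullary using (yes; no; ¬_; does; contradiction)
open import Relation.Nullary.Decidable using (⌊_⌋; ⌊⌋-map′; isYes≗does)
open import Relation.Unary using (Decidable)
open import Relation.Binary.PropositionalEquality
open import Algebra.Solver.IdempotentCommutativeMonoid BP.∧-idempotentCommutativeMonoid as ∧-Solver using (solve; _⊜_; _⊕_)
open import Algebra.Bundles using (CommutativeMonoid)
open import Algebra.Properties.CommutativeSemigroup ℕP.+-commutativeSemigroup using () renaming (interchange to +-interchange)
open import Algebra.Properties.CommutativeSemigroup ℤP.+-commutativeSemigroup using () renaming (interchange to ℤ+-interchange)
open import Algebra.Properties.CommutativeSemigroup (CommutativeMonoid.commutativeSemigroup BP.∧-commutativeMonoid) using () renaming (interchange to ∧-interchange; x∙yz≈y∙xz to ∧-left-swap)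

cong₃ : ∀ {A B C D : Set} (f : A → B → C → D) {a a' b b' c c'} → a ≡ a' → b ≡ b' → c ≡ c' → f a b c ≡ f a' b' c'
cong₃ f refl refl refl = refl

cong₅ : ∀ {A : Set} (f : A → A → A → A → A → A) {a a' b b' c c' d d' e e'} →
        a ≡ a' → b ≡ b' → c ≡ c' → d ≡ d' → e ≡ e' → f a b c d e ≡ f a' b' c' d' e'
cong₅ f refl refl refl refl refl = refl

-- Finite sums

𝟙 : Bool → ℕ
𝟙 true = 1
𝟙 false = 0

𝟙-∧ : ∀ a b → 𝟙 (a ∧ b) ≡ 𝟙 a * 𝟙 b
𝟙-∧ true true = refl
𝟙-∧ true false = refl
𝟙-∧ false b = refl

𝟙-split : ∀ a b → 𝟙 a ≡ 𝟙 (a ∧ b) + 𝟙 (a ∧ not b)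
𝟙-split true true = refl
𝟙-split true false = refl
𝟙-split false b = refl

sumOver : {A : Set} → List A → (A → ℕ) → ℕ
sumOver [] f = 0
sumOver (x ∷ xs) f = f x + sumOver xs f

module _ {A : Set} where
  sumOver-++ : ∀ (xs ys : List A) f → sumOver (xs ++ ys) f ≡ sumOver xs f + sumOver ys f
  sumOver-++ [] ys f = refl
  sumOver-++ (x ∷ xs) ys f = trans (cong (f x +_) (sumOver-++ xs ys f)) (sym (+-assoc (f x) _ _))

  sumOver-cong : ∀ (xs : List A) {f g} → (∀ x → f x ≡ g x) → sumOver xs f ≡ sumOver xs g
  sumOver-cong [] eq = refl
  sumOver-cong (x ∷ xs) eq = cong₂ _+_ (eq x) (sumOver-cong xs eq)

  sumOver-zero : ∀ (xs : List A) {f} → (∀ x → f x ≡ 0) → sumOver xs f ≡ 0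
  sumOver-zero [] eq = refl
  sumOver-zero (x ∷ xs) eq = cong₂ _+_ (eq x) (sumOver-zero xs eq)

  sumOver-+ : ∀ (xs : List A) f g → sumOver xs (λ x → f x + g x) ≡ sumOver xs f + sumOver xs g
  sumOver-+ [] f g = refl
  sumOver-+ (x ∷ xs) f g = trans (cong (f x + g x +_) (sumOver-+ xs f g)) (+-interchange (f x) (g x) _ _)

  sumOver-* : ∀ (xs : List A) c f → sumOver xs (λ x → c * f x) ≡ c * sumOver xs f
  sumOver-* [] c f = sym (*-zeroʳ c)
  sumOver-* (x ∷ xs) c f = trans (cong (c * f x +_) (sumOver-* xs c f)) (sym (*-distribˡ-+ c (f x) _))

module _ {A B : Set} where
  sumOver-map : ∀ (g : A → B) (xs : List A) f → sumOver (map g xs) f ≡ sumOver xs (f ∘ g)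
  sumOver-map g [] f = refl
  sumOver-map g (x ∷ xs) f = cong (f (g x) +_) (sumOver-map g xs f)

  sumOver-concatMap : ∀ (g : A → List B) (xs : List A) f → sumOver (concatMap g xs) f ≡ sumOver xs (λ x → sumOver (g x) f)
  sumOver-concatMap g [] f = refl
  sumOver-concatMap g (x ∷ xs) f = trans (sumOver-++ (g x) (concatMap g xs) f) (cong (sumOver (g x) f +_) (sumOver-concatMap g xs f))

sumBelow : ℕ → (ℕ → ℕ) → ℕ
sumBelow zero g = 0
sumBelow (suc k) g = g 0 + sumBelow k (λ q → g (suc q))

sumBelow-cong : ∀ k {f g} → (∀ q → q < k → f q ≡ g q) → sumBelow k f ≡ sumBelow k g
sumBelow-cong zero eq = refl
sumBelow-cong (suc k) eq = cong₂ _+_ (eq 0 (s≤s z≤n)) (sumBelow-cong k (λ q q<k → eq (suc q) (s≤s q<k)))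

sumBelow-zero : ∀ k {f} → (∀ q → q < k → f q ≡ 0) → sumBelow k f ≡ 0
sumBelow-zero k {f} eq = trans (sumBelow-cong k eq) (z k)
  where
  z : ∀ k → sumBelow k (λ _ → 0) ≡ 0
  z zero = refl
  z (suc k) = z k

sumBelow-+ : ∀ k f g → sumBelow k (λ x → f x + g x) ≡ sumBelow k f + sumBelow k g
sumBelow-+ zero f g = refl
sumBelow-+ (suc k) f g = trans (cong (f 0 + g 0 +_) (sumBelow-+ k _ _)) (+-interchange (f 0) (g 0) _ _)

sumBelow-* : ∀ k c f → sumBelow k (λ x → c * f x) ≡ c * sumBelow k f
sumBelow-* zero c f = sym (*-zeroʳ c)
sumBelow-* (suc k) c f = trans (cong (c * f 0 +_) (sumBelow-* k c _)) (sym (*-distribˡ-+ c (f 0) _))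

sumBelow-*ʳ : ∀ n c f → sumBelow n (λ x → f x * c) ≡ sumBelow n f * c
sumBelow-*ʳ n c f = trans (sumBelow-cong n (λ x _ → ℕP.*-comm (f x) c)) (trans (sumBelow-* n c f) (ℕP.*-comm c _))

sumBelow-last : ∀ k g → sumBelow (suc k) g ≡ sumBelow k g + g k
sumBelow-last zero g = +-comm (g 0) 0
sumBelow-last (suc k) g = trans (cong (g 0 +_) (sumBelow-last k (λ q → g (suc q)))) (sym (+-assoc (g 0) _ _))

sumOver-sumBelow-swap : ∀ {A : Set} (xs : List A) k (f : A → ℕ → ℕ) →
            sumOver xs (λ x → sumBelow k (f x)) ≡ sumBelow k (λ q → sumOver xs (λ x → f x q))
sumOver-sumBelow-swap xs zero f = sumOver-zero xs (λ _ → refl)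
sumOver-sumBelow-swap xs (suc k) f = trans (sumOver-+ xs (λ x → f x 0) (λ x → sumBelow k (λ q → f x (suc q))))
                               (cong (sumOver xs (λ x → f x 0) +_) (sumOver-sumBelow-swap xs k (λ x q → f x (suc q))))

sumBelow-swap : ∀ a b (f : ℕ → ℕ → ℕ) → sumBelow a (λ x → sumBelow b (f x)) ≡ sumBelow b (λ y → sumBelow a (λ x → f x y))
sumBelow-swap zero b f = sym (sumBelow-zero b (λ _ _ → refl))
sumBelow-swap (suc a) b f = trans (cong (sumBelow b (f 0) +_) (sumBelow-swap a b (λ x → f (suc x))))
                            (sym (sumBelow-+ b (f 0) (λ y → sumBelow a (λ x → f (suc x) y))))

sumOver-wordsOf : ∀ k f → sumOver (wordsOf (suc k)) f ≡ sumOver vals (λ x → sumOver (wordsOf k) (λ r → f (x ∷ r)))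
sumOver-wordsOf k f = trans (sumOver-concatMap (λ x → map (x ∷_) (wordsOf k)) vals f)
                    (sumOver-cong vals (λ x → sumOver-map (x ∷_) (wordsOf k) f))

-- Words and unit vectors

spike : ℕ → ℤ → ℕ → ℤ
spike t c j = if t ℕ.≡ᵇ j then c else 0ℤ

δ : ℕ → ℕ → ℤ
δ q = spike q 1ℤ

tabulateℕ : ℕ → (ℕ → ℤ) → List ℤ
tabulateℕ k g = applyUpTo g k

isEntry : ℤ → Bool
isEntry (ℤ.+ 0) = true
isEntry (ℤ.+ 1) = true
isEntry ℤ.-[1+ 0 ] = true
isEntry _ = false

AllZero : List ℤ → Set
AllZero = All (_≡ 0ℤ)

data IsUnitVector : List ℤ → Set where
  unit-here : ∀ {zs} → AllZero zs → IsUnitVector (1ℤ ∷ zs)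
  unit-there : ∀ {r} → IsUnitVector r → IsUnitVector (0ℤ ∷ r)

IsWord : ℕ → List ℤ → Set
IsWord k r = length r ≡ k × All (λ x → isEntry x ≡ true) r

wordsOf-IsWord : ∀ k → All (IsWord k) (wordsOf k)
wordsOf-IsWord zero = (refl , []) ∷ []
wordsOf-IsWord (suc k) = ++⁺ (mp -1ℤ refl) (++⁺ (mp 0ℤ refl) (++⁺ (mp 1ℤ refl) []))
  where
  mp : ∀ x → isEntry x ≡ true → All (IsWord (suc k)) (map (x ∷_) (wordsOf k))
  mp x v = go (wordsOf-IsWord k)
    where
    go : ∀ {xs} → All (IsWord k) xs → All (IsWord (suc k)) (map (x ∷_) xs)
    go [] = []
    go ((l , a) ∷ ps) = (cong suc l , v ∷ a) ∷ go ps

sumOver-zero-onAll : ∀ {A : Set} {P : A → Set} {xs : List A} (f : A → ℕ) → All P xs → (∀ x → P x → f x ≡ 0) → sumOver xs f ≡ 0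
sumOver-zero-onAll f [] h = refl
sumOver-zero-onAll f (p ∷ ps) h = cong₂ _+_ (h _ p) (sumOver-zero-onAll f ps h)

sumOver-cong-onAll : ∀ {A : Set} {P : A → Set} {xs : List A} (f g : A → ℕ) → All P xs → (∀ x → P x → f x ≡ g x) → sumOver xs f ≡ sumOver xs g
sumOver-cong-onAll f g [] h = refl
sumOver-cong-onAll f g (p ∷ ps) h = cong₂ _+_ (h _ p) (sumOver-cong-onAll f g ps h)

IsWord-∷ : ∀ {k x r} → isEntry x ≡ true → IsWord k r → IsWord (suc k) (x ∷ r)
IsWord-∷ v (len , es) = cong suc len , v ∷ es

sumOver-wordsOf-atZero : ∀ k (f : List ℤ → ℕ) → (∀ r → IsWord k r → f r ≡ 0 ⊎ AllZero r) →
  sumOver (wordsOf k) f ≡ f (tabulateℕ k (λ _ → 0ℤ))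
sumOver-wordsOf-atZero zero f h = +-identityʳ (f [])
sumOver-wordsOf-atZero (suc k) f h = begin
    sumOver (wordsOf (suc k)) f
  ≡⟨ sumOver-wordsOf k f ⟩
    sumOver (wordsOf k) (λ r → f (-1ℤ ∷ r)) + (sumOver (wordsOf k) (λ r → f (0ℤ ∷ r)) + (sumOver (wordsOf k) (λ r → f (1ℤ ∷ r)) + 0))
  ≡⟨ cong₂ _+_ head-1 (cong₂ _+_ (sumOver-wordsOf-atZero k (λ r → f (0ℤ ∷ r)) head0) (cong (_+ 0) head1)) ⟩
    0 + (f (tabulateℕ (suc k) (λ _ → 0ℤ)) + (0 + 0))
  ≡⟨ +-identityʳ _ ⟩
    f (tabulateℕ (suc k) (λ _ → 0ℤ)) ∎
  where
  open ≡-Reasoning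
  head-1 : sumOver (wordsOf k) (λ r → f (-1ℤ ∷ r)) ≡ 0
  head-1 = sumOver-zero-onAll _ (wordsOf-IsWord k) λ r w →
    [ id , (λ { (() ∷ _) }) ]′ (h (-1ℤ ∷ r) (IsWord-∷ refl w))
  head1 : sumOver (wordsOf k) (λ r → f (1ℤ ∷ r)) ≡ 0
  head1 = sumOver-zero-onAll _ (wordsOf-IsWord k) λ r w →
    [ id , (λ { (() ∷ _) }) ]′ (h (1ℤ ∷ r) (IsWord-∷ refl w))
  head0 : ∀ r → IsWord k r → f (0ℤ ∷ r) ≡ 0 ⊎ AllZero r
  head0 r w = Sum.map₂ All.tail (h (0ℤ ∷ r) (IsWord-∷ refl w))

sumOver-wordsOf-atUnits : ∀ k (f : List ℤ → ℕ) → (∀ r → IsWord k r → f r ≡ 0 ⊎ IsUnitVector r) →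
  sumOver (wordsOf k) f ≡ sumBelow k (λ q → f (tabulateℕ k (δ q)))
sumOver-wordsOf-atUnits zero f h = [ trans (+-identityʳ _) , (λ ()) ]′ (h [] (refl , []))
sumOver-wordsOf-atUnits (suc k) f h = begin
    sumOver (wordsOf (suc k)) f
  ≡⟨ sumOver-wordsOf k f ⟩
    sumOver (wordsOf k) (λ r → f (-1ℤ ∷ r)) + (sumOver (wordsOf k) (λ r → f (0ℤ ∷ r)) + (sumOver (wordsOf k) (λ r → f (1ℤ ∷ r)) + 0))
  ≡⟨ cong₂ _+_ head-1 (cong₂ _+_ (sumOver-wordsOf-atUnits k (λ r → f (0ℤ ∷ r)) head0)
                                  (cong (_+ 0) (sumOver-wordsOf-atZero k (λ r → f (1ℤ ∷ r)) head1))) ⟩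
    0 + (sumBelow k (λ q → f (tabulateℕ (suc k) (δ (suc q)))) + (f (tabulateℕ (suc k) (δ 0)) + 0))
  ≡⟨ cong (sumBelow k (λ q → f (tabulateℕ (suc k) (δ (suc q)))) +_) (+-identityʳ _) ⟩
    sumBelow k (λ q → f (tabulateℕ (suc k) (δ (suc q)))) + f (tabulateℕ (suc k) (δ 0))
  ≡⟨ +-comm (sumBelow k (λ q → f (tabulateℕ (suc k) (δ (suc q))))) _ ⟩
    sumBelow (suc k) (λ q → f (tabulateℕ (suc k) (δ q))) ∎
  where
  open ≡-Reasoning
  head-1 : sumOver (wordsOf k) (λ r → f (-1ℤ ∷ r)) ≡ 0
  head-1 = sumOver-zero-onAll _ (wordsOf-IsWord k) λ r w →
    [ id , (λ ()) ]′ (h (-1ℤ ∷ r) (IsWord-∷ refl w))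
  head0 : ∀ r → IsWord k r → f (0ℤ ∷ r) ≡ 0 ⊎ IsUnitVector r
  head0 r w = Sum.map₂ (λ { (unit-there u) → u }) (h (0ℤ ∷ r) (IsWord-∷ refl w))
  head1 : ∀ r → IsWord k r → f (1ℤ ∷ r) ≡ 0 ⊎ AllZero r
  head1 r w = Sum.map₂ (λ { (unit-here z) → z }) (h (1ℤ ∷ r) (IsWord-∷ refl w))

addAt : ℕ → ℤ → List ℤ → List ℤ
addAt t c [] = []
addAt zero c (x ∷ xs) = (x ℤ.+ c) ∷ xs
addAt (suc t) c (x ∷ xs) = x ∷ addAt t c xs

Translatable : ℕ → ℤ → (List ℤ → ℕ) → List ℤ → Set
Translatable t c f r = f r ≡ 0 ⊎ (isEntry (at r t) ∧ isEntry (at r t ℤ.- c)) ≡ true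

sumOver-wordsOf-head-vanishes : ∀ k x c (f : List ℤ → ℕ) → (isEntry x ∧ isEntry (x ℤ.- c)) ≡ false →
  (∀ r → length r ≡ suc k → Translatable 0 c f r) → sumOver (wordsOf k) (λ r → f (x ∷ r)) ≡ 0
sumOver-wordsOf-head-vanishes k x c f x∉ h = sumOver-zero-onAll _ (wordsOf-IsWord k) λ r (len , _) →
  [ id , (λ x∈ → contradiction (trans (sym x∉) x∈) λ ()) ]′ (h (x ∷ r) (cong suc len))

sumOver-wordsOf-translate : ∀ k t c → c ≡ 1ℤ ⊎ c ≡ -1ℤ → (f : List ℤ → ℕ) →
  (∀ r → length r ≡ k → Translatable t c f r) →
  sumOver (wordsOf k) f ≡ sumOver (wordsOf k) (λ s → f (addAt t c s))
sumOver-wordsOf-translate zero t c c±1 f h = refl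
sumOver-wordsOf-translate (suc k) (suc t) c c±1 f h = begin
    sumOver (wordsOf (suc k)) f
  ≡⟨ sumOver-wordsOf k f ⟩
    sumOver vals (λ x → sumOver (wordsOf k) (λ r → f (x ∷ r)))
  ≡⟨ sumOver-cong vals (λ x → sumOver-wordsOf-translate k t c c±1 (λ r → f (x ∷ r)) (λ r len → h (x ∷ r) (cong suc len))) ⟩
    sumOver vals (λ x → sumOver (wordsOf k) (λ s → f (x ∷ addAt t c s)))
  ≡⟨ sumOver-wordsOf k (λ s → f (addAt (suc t) c s)) ⟨
    sumOver (wordsOf (suc k)) (λ s → f (addAt (suc t) c s)) ∎
  where open ≡-Reasoning
sumOver-wordsOf-translate (suc k) zero c (inj₁ refl) f h = begin
    sumOver (wordsOf (suc k)) f
  ≡⟨ sumOver-wordsOf k f ⟩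
    byHead -1ℤ + (byHead 0ℤ + (byHead 1ℤ + 0))
  ≡⟨ cong (_+ (byHead 0ℤ + (byHead 1ℤ + 0))) (sumOver-wordsOf-head-vanishes k -1ℤ 1ℤ f refl h) ⟩
    byHead 0ℤ + (byHead 1ℤ + 0)
  ≡⟨ cong (λ z → byHead 0ℤ + (byHead 1ℤ + z)) (trans (+-identityʳ _) (sumOver-wordsOf-head-vanishes k (ℤ.+ 2) 1ℤ f refl h)) ⟨
    byHead 0ℤ + (byHead 1ℤ + (byHead (ℤ.+ 2) + 0))
  ≡⟨ sumOver-wordsOf k (λ s → f (addAt zero 1ℤ s)) ⟨
    sumOver (wordsOf (suc k)) (λ s → f (addAt zero 1ℤ s)) ∎
  where
  open ≡-Reasoning
  byHead : ℤ → ℕ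
  byHead x = sumOver (wordsOf k) (λ r → f (x ∷ r))
sumOver-wordsOf-translate (suc k) zero c (inj₂ refl) f h = begin
    sumOver (wordsOf (suc k)) f
  ≡⟨ sumOver-wordsOf k f ⟩
    byHead -1ℤ + (byHead 0ℤ + (byHead 1ℤ + 0))
  ≡⟨ cong (λ z → byHead -1ℤ + (byHead 0ℤ + z)) (trans (+-identityʳ _) (sumOver-wordsOf-head-vanishes k 1ℤ -1ℤ f refl h)) ⟩
    byHead -1ℤ + (byHead 0ℤ + 0)
  ≡⟨ cong (_+ (byHead -1ℤ + (byHead 0ℤ + 0))) (sumOver-wordsOf-head-vanishes k (ℤ.-[1+ 1 ]) -1ℤ f refl h) ⟨
    byHead (ℤ.-[1+ 1 ]) + (byHead -1ℤ + (byHead 0ℤ + 0))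
  ≡⟨ sumOver-wordsOf k (λ s → f (addAt zero -1ℤ s)) ⟨
    sumOver (wordsOf (suc k)) (λ s → f (addAt zero -1ℤ s)) ∎
  where
  open ≡-Reasoning
  byHead : ℤ → ℕ
  byHead x = sumOver (wordsOf k) (λ r → f (x ∷ r))

-- Row and column conditions

columnOK : List ℤ → Bool
columnOK c = alternates (nonzeros c) ∧ firstPositive (nonzeros c)

soloOK : ℤ → Bool
soloOK x = columnOK (x ∷ []) ∧ isEntry x

pairOK : ℤ → ℤ → Bool
pairOK a b = columnOK (a ∷ b ∷ []) ∧ (isEntry a ∧ isEntry b)

rowOK : List ℤ → Bool
rowOK r = ⌊ sumℤ r ℤ.≟ 1ℤ ⌋ ∧ alternates (nonzeros r)

isPositive : ℤ → Bool
isPositive x = ⌊ 0ℤ ℤ.<? x ⌋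

allBelow : ℕ → (ℕ → Bool) → Bool
allBelow zero g = true
allBelow (suc k) g = g 0 ∧ allBelow k (λ i → g (suc i))

anyBelow : ℕ → (ℕ → Bool) → Bool
anyBelow zero g = false
anyBelow (suc k) g = g 0 ∨ anyBelow k (λ i → g (suc i))

IsBit : ℤ → Set
IsBit x = x ≡ 0ℤ ⊎ x ≡ 1ℤ

∧-elim : ∀ a b → a ∧ b ≡ true → a ≡ true × b ≡ true
∧-elim true true e = refl , refl

∧-intro : ∀ {a b} → a ≡ true → b ≡ true → a ∧ b ≡ true
∧-intro refl refl = refl

∧-falseˡ : ∀ {a} b → a ≡ false → a ∧ b ≡ false
∧-falseˡ b refl = refl

∧-falseʳ : ∀ a {b} → b ≡ false → a ∧ b ≡ false
∧-falseʳ true refl = refl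
∧-falseʳ false refl = refl

allBelow-elim : ∀ k g → allBelow k g ≡ true → ∀ j → j < k → g j ≡ true
allBelow-elim (suc k) g e zero _ = proj₁ (∧-elim _ _ e)
allBelow-elim (suc k) g e (suc j) (s≤s j<k) = allBelow-elim k _ (proj₂ (∧-elim _ _ e)) j j<k

allBelow-intro : ∀ k g → (∀ j → j < k → g j ≡ true) → allBelow k g ≡ true
allBelow-intro zero g h = refl
allBelow-intro (suc k) g h = ∧-intro (h 0 (s≤s z≤n)) (allBelow-intro k _ (λ j j<k → h (suc j) (s≤s j<k)))

allBelow-false : ∀ k g j → j < k → g j ≡ false → allBelow k g ≡ false
allBelow-false (suc k) g zero _ e = ∧-falseˡ _ e
allBelow-false (suc k) g (suc j) (s≤s j<k) e = ∧-falseʳ (g 0) (allBelow-false k _ j j<k e)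

allBelow-cong : ∀ k {f g} → (∀ j → j < k → f j ≡ g j) → allBelow k f ≡ allBelow k g
allBelow-cong zero h = refl
allBelow-cong (suc k) h = cong₂ _∧_ (h 0 (s≤s z≤n)) (allBelow-cong k (λ j j<k → h (suc j) (s≤s j<k)))

anyBelow-cong : ∀ k {f g} → (∀ j → j < k → f j ≡ g j) → anyBelow k f ≡ anyBelow k g
anyBelow-cong zero h = refl
anyBelow-cong (suc k) h = cong₂ _∨_ (h 0 (s≤s z≤n)) (anyBelow-cong k (λ j j<k → h (suc j) (s≤s j<k)))

soloOK⇒IsBit : ∀ x → soloOK x ≡ true → IsBit x
soloOK⇒IsBit (ℤ.+ 0) e = inj₁ refl
soloOK⇒IsBit (ℤ.+ 1) e = inj₂ refl
soloOK⇒IsBit (ℤ.+ suc (suc n)) ()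
soloOK⇒IsBit ℤ.-[1+ 0 ] ()
soloOK⇒IsBit ℤ.-[1+ suc n ] ()

pairOK⇒IsBit : ∀ a b → pairOK a b ≡ true → IsBit a × IsBit (a ℤ.+ b) × isEntry b ≡ true
pairOK⇒IsBit (ℤ.+ 0) (ℤ.+ 0) e = inj₁ refl , inj₁ refl , refl
pairOK⇒IsBit (ℤ.+ 0) (ℤ.+ 1) e = inj₁ refl , inj₂ refl , refl
pairOK⇒IsBit (ℤ.+ 0) (ℤ.+ suc (suc n)) ()
pairOK⇒IsBit (ℤ.+ 0) ℤ.-[1+ 0 ] ()
pairOK⇒IsBit (ℤ.+ 0) ℤ.-[1+ suc n ] ()
pairOK⇒IsBit (ℤ.+ 1) (ℤ.+ 0) e = inj₂ refl , inj₂ refl , refl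
pairOK⇒IsBit (ℤ.+ 1) (ℤ.+ 1) ()
pairOK⇒IsBit (ℤ.+ 1) (ℤ.+ suc (suc n)) ()
pairOK⇒IsBit (ℤ.+ 1) ℤ.-[1+ 0 ] e = inj₂ refl , inj₁ refl , refl
pairOK⇒IsBit (ℤ.+ 1) ℤ.-[1+ suc n ] ()
pairOK⇒IsBit (ℤ.+ suc (suc m)) (ℤ.+ 0) ()
pairOK⇒IsBit (ℤ.+ suc (suc m)) (ℤ.+ suc n) ()
pairOK⇒IsBit (ℤ.+ suc (suc m)) ℤ.-[1+ n ] ()
pairOK⇒IsBit ℤ.-[1+ m ] (ℤ.+ 0) ()
pairOK⇒IsBit ℤ.-[1+ m ] (ℤ.+ suc n) ()
pairOK⇒IsBit ℤ.-[1+ m ] ℤ.-[1+ n ] ()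

pairOK-1 : ∀ b → pairOK 1ℤ b ≡ true → isEntry b ∧ isEntry (b ℤ.- -1ℤ) ≡ true
pairOK-1 (ℤ.+ 0) e = refl
pairOK-1 (ℤ.+ 1) ()
pairOK-1 (ℤ.+ suc (suc n)) ()
pairOK-1 ℤ.-[1+ 0 ] e = refl
pairOK-1 ℤ.-[1+ suc n ] ()

∧⁵-elim : ∀ a b c d e → a ∧ (b ∧ (c ∧ (d ∧ e))) ≡ true → a ≡ true × b ≡ true × c ≡ true × d ≡ true × e ≡ true
∧⁵-elim true true true true true _ = refl , refl , refl , refl , refl

∧⁵-false₃ : ∀ a b c d e → c ≡ false → a ∧ (b ∧ (c ∧ (d ∧ e))) ≡ false
∧⁵-false₃ false b c d e p = refl
∧⁵-false₃ true false c d e p = refl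
∧⁵-false₃ true true .false d e refl = refl

∧⁵-false₄ : ∀ a b c d e → d ≡ false → a ∧ (b ∧ (c ∧ (d ∧ e))) ≡ false
∧⁵-false₄ false b c d e p = refl
∧⁵-false₄ true false c d e p = refl
∧⁵-false₄ true true false d e p = refl
∧⁵-false₄ true true true .false e refl = refl

∧⁵-false₅ : ∀ a b c d e → e ≡ false → a ∧ (b ∧ (c ∧ (d ∧ e))) ≡ false
∧⁵-false₅ false b c d e p = refl
∧⁵-false₅ true false c d e p = refl
∧⁵-false₅ true true false d e p = refl
∧⁵-false₅ true true true false e p = refl
∧⁵-false₅ true true true true .false refl = refl

isBitᵇ : ℤ → Bool
isBitᵇ y = ⌊ y ℤ.≟ 0ℤ ⌋ ∨ ⌊ y ℤ.≟ 1ℤ ⌋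

-- A row with entries in {-1, 0, 1} has sum 1 and alternating nonzero entries iff all
-- its partial sums are 0 or 1 and the last one is 1 (rowOK-prefixSumsOK); this turns
-- the row conditions on explicit candidate rows into arithmetic on prefix sums.
prefixSumsOK : ℤ → List ℤ → Bool
prefixSumsOK σ [] = ⌊ σ ℤ.≟ 1ℤ ⌋
prefixSumsOK σ (x ∷ xs) = isBitᵇ (σ ℤ.+ x) ∧ prefixSumsOK (σ ℤ.+ x) xs

IsSign : ℤ → Set
IsSign x = x ≡ 1ℤ ⊎ x ≡ -1ℤ

nonzeros-IsSign : ∀ {r} → All (λ x → isEntry x ≡ true) r → All IsSign (nonzeros r)
nonzeros-IsSign [] = []
nonzeros-IsSign {ℤ.+ 0 ∷ xs} (_ ∷ a) = nonzeros-IsSign a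
nonzeros-IsSign {ℤ.+ 1 ∷ xs} (_ ∷ a) = inj₁ refl ∷ nonzeros-IsSign a
nonzeros-IsSign {ℤ.-[1+ 0 ] ∷ xs} (_ ∷ a) = inj₂ refl ∷ nonzeros-IsSign a
nonzeros-IsSign {ℤ.+ suc (suc n) ∷ xs} (() ∷ a)
nonzeros-IsSign {ℤ.-[1+ suc n ] ∷ xs} (() ∷ a)

sum-nonzeros : ∀ r → sumℤ (nonzeros r) ≡ sumℤ r
sum-nonzeros [] = refl
sum-nonzeros (x ∷ xs) with x ℤ.≟ 0ℤ
... | yes refl = trans (sum-nonzeros xs) (sym (ℤP.+-identityˡ _))
... | no _ = cong (λ y → x ℤ.+ y) (sum-nonzeros xs)

prefixSumsOK-nonzeros : ∀ σ r → isBitᵇ σ ≡ true → prefixSumsOK σ r ≡ prefixSumsOK σ (nonzeros r)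
prefixSumsOK-nonzeros σ [] e = refl
prefixSumsOK-nonzeros σ (x ∷ xs) e with x ℤ.≟ 0ℤ
... | yes refl rewrite ℤP.+-identityʳ σ | e = prefixSumsOK-nonzeros σ xs e
... | no _ with isBitᵇ (σ ℤ.+ x) in eq
...   | true = prefixSumsOK-nonzeros (σ ℤ.+ x) xs eq
...   | false = refl

alternating-sum : ∀ a z → IsSign a → All IsSign z → alternates (a ∷ z) ≡ true → sumℤ (a ∷ z) ≡ a ⊎ sumℤ (a ∷ z) ≡ 0ℤ
alternating-sum a [] _ _ _ = inj₁ (ℤP.+-identityʳ a)
alternating-sum .1ℤ (.1ℤ ∷ z) (inj₁ refl) (inj₁ refl ∷ pz) ()
alternating-sum .-1ℤ (.-1ℤ ∷ z) (inj₂ refl) (inj₂ refl ∷ pz) ()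
alternating-sum .1ℤ (.-1ℤ ∷ z) (inj₁ refl) (inj₂ refl ∷ pz) e with alternating-sum -1ℤ z (inj₂ refl) pz e
... | inj₁ s = inj₂ (cong (λ y → 1ℤ ℤ.+ y) s)
... | inj₂ s = inj₁ (cong (λ y → 1ℤ ℤ.+ y) s)
alternating-sum .-1ℤ (.1ℤ ∷ z) (inj₂ refl) (inj₁ refl ∷ pz) e with alternating-sum 1ℤ z (inj₁ refl) pz e
... | inj₁ s = inj₂ (cong (λ y → -1ℤ ℤ.+ y) s)
... | inj₂ s = inj₁ (cong (λ y → -1ℤ ℤ.+ y) s)

1+s≟1 : ∀ s → ⌊ 1ℤ ℤ.+ s ℤ.≟ 1ℤ ⌋ ≡ ⌊ s ℤ.≟ 0ℤ ⌋
1+s≟1 (ℤ.+ 0) = refl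
1+s≟1 (ℤ.+ suc n) = refl
1+s≟1 ℤ.-[1+ 0 ] = refl
1+s≟1 ℤ.-[1+ suc n ] = refl

-1+s≟0 : ∀ s → ⌊ -1ℤ ℤ.+ s ℤ.≟ 0ℤ ⌋ ≡ ⌊ s ℤ.≟ 1ℤ ⌋
-1+s≟0 (ℤ.+ 0) = refl
-1+s≟0 (ℤ.+ 1) = refl
-1+s≟0 (ℤ.+ suc (suc n)) = refl
-1+s≟0 ℤ.-[1+ n ] = refl

¬rowOK-−1∷ : ∀ z → All IsSign z → ⌊ sumℤ (-1ℤ ∷ z) ℤ.≟ 1ℤ ⌋ ∧ alternates (-1ℤ ∷ z) ≡ false
¬rowOK-−1∷ z pz with alternates (-1ℤ ∷ z) in e
... | false = ∧-zeroʳ _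
... | true with alternating-sum -1ℤ z (inj₂ refl) pz e
...   | inj₁ s rewrite s = refl
...   | inj₂ s rewrite s = refl

prefixSumsOK-0 : ∀ z → All IsSign z → prefixSumsOK 0ℤ z ≡ ⌊ sumℤ z ℤ.≟ 1ℤ ⌋ ∧ alternates z
prefixSumsOK-1 : ∀ z → All IsSign z → prefixSumsOK 1ℤ z ≡ ⌊ sumℤ z ℤ.≟ 0ℤ ⌋ ∧ alternates (1ℤ ∷ z)
prefixSumsOK-0 [] _ = refl
prefixSumsOK-0 (.1ℤ ∷ z) (inj₁ refl ∷ pz) = trans (prefixSumsOK-1 z pz) (cong (_∧ alternates (1ℤ ∷ z)) (sym (1+s≟1 (sumℤ z))))
prefixSumsOK-0 (.-1ℤ ∷ z) (inj₂ refl ∷ pz) = sym (¬rowOK-−1∷ z pz)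
prefixSumsOK-1 [] _ = refl
prefixSumsOK-1 (.1ℤ ∷ z) (inj₁ refl ∷ pz) = sym (∧-zeroʳ _)
prefixSumsOK-1 (.-1ℤ ∷ z) (inj₂ refl ∷ pz) = trans (prefixSumsOK-0 z pz) (trans (lem z pz) (cong (_∧ alternates (-1ℤ ∷ z)) (sym (-1+s≟0 (sumℤ z)))))
  where
  lem : ∀ z → All IsSign z → ⌊ sumℤ z ℤ.≟ 1ℤ ⌋ ∧ alternates z ≡ ⌊ sumℤ z ℤ.≟ 1ℤ ⌋ ∧ alternates (-1ℤ ∷ z)
  lem [] _ = refl
  lem (.1ℤ ∷ z) (inj₁ refl ∷ pz) = refl
  lem (.-1ℤ ∷ z) (inj₂ refl ∷ pz) = trans (¬rowOK-−1∷ z pz) (sym (∧-zeroʳ _))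

rowOK-prefixSumsOK : ∀ r → All (λ x → isEntry x ≡ true) r → rowOK r ≡ prefixSumsOK 0ℤ r
rowOK-prefixSumsOK r a = begin
    ⌊ sumℤ r ℤ.≟ 1ℤ ⌋ ∧ alternates (nonzeros r)
  ≡⟨ cong (λ s → ⌊ s ℤ.≟ 1ℤ ⌋ ∧ alternates (nonzeros r)) (sym (sum-nonzeros r)) ⟩
    ⌊ sumℤ (nonzeros r) ℤ.≟ 1ℤ ⌋ ∧ alternates (nonzeros r)
  ≡⟨ sym (prefixSumsOK-0 (nonzeros r) (nonzeros-IsSign a)) ⟩
    prefixSumsOK 0ℤ (nonzeros r)
  ≡⟨ sym (prefixSumsOK-nonzeros 0ℤ r refl) ⟩
    prefixSumsOK 0ℤ r ∎
  where open ≡-Reasoning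

prefixSum : (ℕ → ℤ) → ℕ → ℤ
prefixSum g zero = 0ℤ
prefixSum g (suc i) = g 0 ℤ.+ prefixSum (λ j → g (suc j)) i

prefixSumsOK-tabulateℕ : ∀ k σ g → prefixSumsOK σ (tabulateℕ k g) ≡ allBelow k (λ i → isBitᵇ (σ ℤ.+ prefixSum g (suc i))) ∧ ⌊ σ ℤ.+ prefixSum g k ℤ.≟ 1ℤ ⌋
prefixSumsOK-tabulateℕ zero σ g rewrite ℤP.+-identityʳ σ = refl
prefixSumsOK-tabulateℕ (suc k) σ g = begin
    isBitᵇ (σ ℤ.+ g 0) ∧ prefixSumsOK (σ ℤ.+ g 0) (tabulateℕ k g')
  ≡⟨ cong (isBitᵇ (σ ℤ.+ g 0) ∧_) (prefixSumsOK-tabulateℕ k (σ ℤ.+ g 0) g') ⟩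
    isBitᵇ (σ ℤ.+ g 0) ∧ (allBelow k (λ i → isBitᵇ ((σ ℤ.+ g 0) ℤ.+ prefixSum g' (suc i))) ∧ ⌊ (σ ℤ.+ g 0) ℤ.+ prefixSum g' k ℤ.≟ 1ℤ ⌋)
  ≡⟨ sym (∧-assoc (isBitᵇ (σ ℤ.+ g 0)) _ _) ⟩
    (isBitᵇ (σ ℤ.+ g 0) ∧ allBelow k (λ i → isBitᵇ ((σ ℤ.+ g 0) ℤ.+ prefixSum g' (suc i)))) ∧ ⌊ (σ ℤ.+ g 0) ℤ.+ prefixSum g' k ℤ.≟ 1ℤ ⌋
  ≡⟨ cong₂ _∧_ (cong₂ _∧_ (cong isBitᵇ (trans (sym (ℤP.+-identityʳ (σ ℤ.+ g 0))) (ℤP.+-assoc σ (g 0) 0ℤ)))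
                           (allBelow-cong k (λ i _ → cong isBitᵇ (ℤP.+-assoc σ (g 0) _))))
                (cong (λ b → ⌊ b ℤ.≟ 1ℤ ⌋) (ℤP.+-assoc σ (g 0) _)) ⟩
    (isBitᵇ (σ ℤ.+ (g 0 ℤ.+ 0ℤ)) ∧ allBelow k (λ i → isBitᵇ (σ ℤ.+ (g 0 ℤ.+ prefixSum g' (suc i))))) ∧ ⌊ σ ℤ.+ (g 0 ℤ.+ prefixSum g' k) ℤ.≟ 1ℤ ⌋
  ∎
  where
  open ≡-Reasoning
  g' : ℕ → ℤ
  g' j = g (suc j)

≟-true⇒≡ : ∀ {x y : ℤ} → ⌊ x ℤ.≟ y ⌋ ≡ true → x ≡ y
≟-true⇒≡ {x} {y} e with x ℤ.≟ y
... | yes p = p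

≡ᵇ-refl : ∀ n → (n ℕ.≡ᵇ n) ≡ true
≡ᵇ-refl zero = refl
≡ᵇ-refl (suc n) = ≡ᵇ-refl n

≡ᵇ-< : ∀ {i n} → i < n → (i ℕ.≡ᵇ n) ≡ false
≡ᵇ-< {zero} {suc n} _ = refl
≡ᵇ-< {suc i} {suc n} (s≤s p) = ≡ᵇ-< p

≡ᵇ-> : ∀ {i n} → n < i → (i ℕ.≡ᵇ n) ≡ false
≡ᵇ-> {suc i} {zero} _ = refl
≡ᵇ-> {suc i} {suc n} (s≤s p) = ≡ᵇ-> p

δ-self : ∀ q → δ q q ≡ 1ℤ
δ-self q rewrite ≡ᵇ-refl q = refl

at-tabulateℕ : ∀ k g j → j < k → at (tabulateℕ k g) j ≡ g j
at-tabulateℕ (suc k) g zero _ = refl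
at-tabulateℕ (suc k) g (suc j) (s≤s p) = at-tabulateℕ k (λ i → g (suc i)) j p

at-isEntry : ∀ r j → All (λ x → isEntry x ≡ true) r → isEntry (at r j) ≡ true
at-isEntry [] j _ = refl
at-isEntry (x ∷ r) zero (p ∷ _) = p
at-isEntry (x ∷ r) (suc j) (_ ∷ a) = at-isEntry r j a

AllZero-tabulateℕ-0 : ∀ k → AllZero (tabulateℕ k (λ _ → 0ℤ))
AllZero-tabulateℕ-0 zero = []
AllZero-tabulateℕ-0 (suc k) = refl ∷ AllZero-tabulateℕ-0 k

IsUnitVector-δ : ∀ k q → q < k → IsUnitVector (tabulateℕ k (δ q))
IsUnitVector-δ (suc k) zero _ = unit-here (AllZero-tabulateℕ-0 k)
IsUnitVector-δ (suc k) (suc q) (s≤s p) = unit-there (IsUnitVector-δ k q p)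

nonzeros-AllZero : ∀ {zs} → AllZero zs → nonzeros zs ≡ []
nonzeros-AllZero [] = []-refl
  where []-refl = refl
nonzeros-AllZero (refl ∷ z) = nonzeros-AllZero z

sum-AllZero : ∀ {zs} → AllZero zs → sumℤ zs ≡ 0ℤ
sum-AllZero [] = refl
sum-AllZero (refl ∷ z) = trans (ℤP.+-identityˡ _) (sum-AllZero z)

nonzeros-IsUnitVector : ∀ {r} → IsUnitVector r → nonzeros r ≡ 1ℤ ∷ []
nonzeros-IsUnitVector (unit-here z) = cong (1ℤ ∷_) (nonzeros-AllZero z)
nonzeros-IsUnitVector (unit-there u) = nonzeros-IsUnitVector u

sum-IsUnitVector : ∀ {r} → IsUnitVector r → sumℤ r ≡ 1ℤ
sum-IsUnitVector (unit-here z) = trans (cong (λ y → 1ℤ ℤ.+ y) (sum-AllZero z)) refl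
sum-IsUnitVector (unit-there u) = trans (ℤP.+-identityˡ _) (sum-IsUnitVector u)

rowOK-IsUnitVector : ∀ {r} → IsUnitVector r → rowOK r ≡ true
rowOK-IsUnitVector u rewrite sum-IsUnitVector u | nonzeros-IsUnitVector u = refl

sum-bits-ℕ : ∀ r → (∀ j → j < length r → IsBit (at r j)) → ∃ λ n → sumℤ r ≡ ℤ.+ n
sum-bits-ℕ [] h = 0 , refl
sum-bits-ℕ (x ∷ r) h with h 0 (s≤s z≤n) | sum-bits-ℕ r (λ j p → h (suc j) (s≤s p))
... | inj₁ refl | n , e = n , trans (ℤP.+-identityˡ _) e
... | inj₂ refl | n , e = suc n , cong (λ y → 1ℤ ℤ.+ y) e

bits-sum-0⇒AllZero : ∀ r → (∀ j → j < length r → IsBit (at r j)) → sumℤ r ≡ 0ℤ → AllZero r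
bits-sum-0⇒AllZero [] h e = []
bits-sum-0⇒AllZero (x ∷ r) h e with h 0 (s≤s z≤n) | sum-bits-ℕ r (λ j p → h (suc j) (s≤s p))
... | inj₁ refl | n , e' = refl ∷ bits-sum-0⇒AllZero r (λ j p → h (suc j) (s≤s p)) (trans (sym (ℤP.+-identityˡ _)) e)
... | inj₂ refl | n , e' with trans (sym (cong (λ y → 1ℤ ℤ.+ y) e')) e
...   | ()

bits-sum-1⇒IsUnitVector : ∀ r → (∀ j → j < length r → IsBit (at r j)) → sumℤ r ≡ 1ℤ → IsUnitVector r
bits-sum-1⇒IsUnitVector [] h ()
bits-sum-1⇒IsUnitVector (x ∷ r) h e with h 0 (s≤s z≤n)
... | inj₁ refl = unit-there (bits-sum-1⇒IsUnitVector r (λ j p → h (suc j) (s≤s p)) (trans (sym (ℤP.+-identityˡ _)) e))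
... | inj₂ refl = unit-here (bits-sum-0⇒AllZero r h' (z (sum-bits-ℕ r h')))
  where
  h' : ∀ j → j < length r → IsBit (at r j)
  h' j p = h (suc j) (s≤s p)
  z : (∃ λ n → sumℤ r ≡ ℤ.+ n) → sumℤ r ≡ 0ℤ
  z (zero , e') = e'
  z (suc n , e') with trans (sym (cong (λ y → 1ℤ ℤ.+ y) e')) e
  ... | ()

isEntry⇒IsBit : ∀ x → isEntry x ≡ true → x ≢ -1ℤ → IsBit x
isEntry⇒IsBit (ℤ.+ 0) _ _ = inj₁ refl
isEntry⇒IsBit (ℤ.+ 1) _ _ = inj₂ refl
isEntry⇒IsBit (ℤ.+ suc (suc n)) () _
isEntry⇒IsBit ℤ.-[1+ 0 ] _ ne = ⊥-elim (ne refl)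
isEntry⇒IsBit ℤ.-[1+ suc n ] () _

topRowOK : ℕ → List ℤ → Bool
topRowOK m r = rowOK r ∧ (soloOK (at r 0) ∧ (soloOK (at r (suc m)) ∧ (not (isPositive (at r 0)) ∧ not (isPositive (at r (suc m))))))

-- Counting top rows

-- The lower rows enter the counts only through a predicate on the (folded) top row
-- that looks at its inner entries σ 1, …, σ m.
module OneTopRow (m : ℕ) (fitsBase : (ℕ → ℤ) → Bool)
         (fitsBase-cong : ∀ σ σ' → (∀ i → i < m → σ (suc i) ≡ σ' (suc i)) → fitsBase σ ≡ fitsBase σ')
         (fitsBase-no-1 : ∀ σ → fitsBase σ ≡ true → ∀ i → i < m → σ (suc i) ≢ -1ℤ) where

  private
    k = suc (suc m)

  topRowOK⇒unit : ∀ r → IsWord k r → 𝟙 (topRowOK m r ∧ fitsBase (at r)) ≡ 0 ⊎ IsUnitVector r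
  topRowOK⇒unit r (len , av) with topRowOK m r ∧ fitsBase (at r) in eq
  ... | false = inj₁ refl
  ... | true = inj₂ (bits-sum-1⇒IsUnitVector r bits (≟-true⇒≡ (proj₁ (∧-elim _ (alternates (nonzeros r)) c0))))
    where
    lbι = ∧-elim (topRowOK m r) (fitsBase (at r)) eq
    ι = proj₂ lbι
    cs = ∧⁵-elim (rowOK r) (soloOK (at r 0)) (soloOK (at r (suc m))) (not (isPositive (at r 0))) (not (isPositive (at r (suc m)))) (proj₁ lbι)
    c0 = proj₁ cs
    c1 = proj₁ (proj₂ cs)
    c2 = proj₁ (proj₂ (proj₂ cs))
    bits : ∀ j → j < length r → IsBit (at r j)
    bits zero _ = soloOK⇒IsBit _ c1
    bits (suc j) p with j ℕ.<? m
    ... | yes j<m = isEntry⇒IsBit _ (at-isEntry r (suc j) av) (fitsBase-no-1 (at r) ι j j<m)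
    ... | no j≮m = subst (λ z → IsBit (at r (suc z))) (jm j j≮m (subst (suc j <_) len p)) (soloOK⇒IsBit _ c2)
      where
      jm : ∀ j → ¬ (j < m) → suc j < suc (suc m) → m ≡ j
      jm j n (s≤s q) = ℕP.≤-antisym (ℕP.≮⇒≥ n) (ℕP.≤-pred q)

  topRowOK-left : ∀ r → not (isPositive (at r 0)) ≡ false → topRowOK m r ≡ false
  topRowOK-left r = ∧⁵-false₄ (rowOK r) (soloOK (at r 0)) (soloOK (at r (suc m))) (not (isPositive (at r 0))) (not (isPositive (at r (suc m))))

  topRowOK-right : ∀ r → not (isPositive (at r (suc m))) ≡ false → topRowOK m r ≡ false
  topRowOK-right r = ∧⁵-false₅ (rowOK r) (soloOK (at r 0)) (soloOK (at r (suc m))) (not (isPositive (at r 0))) (not (isPositive (at r (suc m))))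

  count-top-row : sumOver (wordsOf k) (λ r → 𝟙 (topRowOK m r ∧ fitsBase (at r))) ≡ sumBelow m (λ i → 𝟙 (fitsBase (δ (suc i))))
  count-top-row = begin
      sumOver (wordsOf k) F
    ≡⟨ sumOver-wordsOf-atUnits k F topRowOK⇒unit ⟩
      sumBelow k (λ q → F (tabulateℕ k (δ q)))
    ≡⟨ cong (F (tabulateℕ k (δ 0)) +_) (sumBelow-last m (λ i → F (tabulateℕ k (δ (suc i))))) ⟩
      F (tabulateℕ k (δ 0)) + (sumBelow m (λ i → F (tabulateℕ k (δ (suc i)))) + F (tabulateℕ k (δ (suc m))))
    ≡⟨ cong₂ (λ a b → a + (sumBelow m (λ i → F (tabulateℕ k (δ (suc i)))) + b)) e0 eL ⟩
      0 + (sumBelow m (λ i → F (tabulateℕ k (δ (suc i)))) + 0)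
    ≡⟨ trans (ℕP.+-identityʳ _) (sumBelow-cong m mid) ⟩
      sumBelow m (λ i → 𝟙 (fitsBase (δ (suc i)))) ∎
    where
    open ≡-Reasoning
    F : List ℤ → ℕ
    F r = 𝟙 (topRowOK m r ∧ fitsBase (at r))
    e0 : F (tabulateℕ k (δ 0)) ≡ 0
    e0 = cong 𝟙 (∧-falseˡ _ (topRowOK-left (tabulateℕ k (δ 0)) refl))
    eL : F (tabulateℕ k (δ (suc m))) ≡ 0
    eL = cong 𝟙 (∧-falseˡ _ (topRowOK-right (tabulateℕ k (δ (suc m)))
           (trans (cong (λ z → not (isPositive z)) (trans (at-tabulateℕ k (δ (suc m)) (suc m) ℕP.≤-refl) (δ-self (suc m)))) refl)))
    mid : ∀ i → i < m → F (tabulateℕ k (δ (suc i))) ≡ 𝟙 (fitsBase (δ (suc i)))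
    mid i i<m = cong 𝟙 (trans (cong (_∧ fitsBase (at r)) lbt) (fitsBase-cong _ _ (λ j j<m → at-tabulateℕ k (δ (suc i)) (suc j) (s≤s (s≤s (ℕP.<⇒≤ j<m))))))
      where
      r = tabulateℕ k (δ (suc i))
      atL : at r (suc m) ≡ 0ℤ
      atL = trans (at-tabulateℕ k (δ (suc i)) (suc m) ℕP.≤-refl) (cong (λ b → if b then 1ℤ else 0ℤ) (≡ᵇ-< i<m))
      lbt : topRowOK m r ≡ true
      lbt rewrite atL = ∧-intro (rowOK-IsUnitVector (IsUnitVector-δ k (suc i) (s≤s (s≤s (ℕP.<⇒≤ i<m))))) refl

whenℤ : Bool → ℤ → ℤ
whenℤ b c = if b then c else 0ℤ

tabulateℕ-cong : ∀ k {f g} → (∀ j → j < k → f j ≡ g j) → tabulateℕ k f ≡ tabulateℕ k g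
tabulateℕ-cong zero h = refl
tabulateℕ-cong (suc k) h = cong₂ _∷_ (h 0 (s≤s z≤n)) (tabulateℕ-cong k (λ j p → h (suc j) (s≤s p)))

All-tabulateℕ : ∀ {P : ℤ → Set} k g → (∀ j → j < k → P (g j)) → All P (tabulateℕ k g)
All-tabulateℕ zero g h = []
All-tabulateℕ (suc k) g h = h 0 (s≤s z≤n) ∷ All-tabulateℕ k _ (λ j p → h (suc j) (s≤s p))

length-addAt : ∀ t c s → length (addAt t c s) ≡ length s
length-addAt t c [] = refl
length-addAt zero c (x ∷ s) = refl
length-addAt (suc t) c (x ∷ s) = cong suc (length-addAt t c s)

at-addAt : ∀ t c s → t < length s → ∀ j → at (addAt t c s) j ≡ at s j ℤ.+ spike t c j
at-addAt zero c (x ∷ s) _ zero = refl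
at-addAt zero c (x ∷ s) _ (suc j) = sym (ℤP.+-identityʳ _)
at-addAt (suc t) c (x ∷ s) _ zero = sym (ℤP.+-identityʳ _)
at-addAt (suc t) c (x ∷ s) (s≤s p) (suc j) = at-addAt t c s p j

sum-addAt : ∀ t c s → t < length s → sumℤ (addAt t c s) ≡ sumℤ s ℤ.+ c
sum-addAt zero c (x ∷ s) _ = trans (ℤP.+-assoc x c _) (trans (cong (λ y → x ℤ.+ y) (ℤP.+-comm c _)) (sym (ℤP.+-assoc x _ c)))
sum-addAt (suc t) c (x ∷ s) (s≤s p) = trans (cong (λ y → x ℤ.+ y) (sum-addAt t c s p)) (sym (ℤP.+-assoc x _ c))

addAt-tabulateℕ : ∀ k t c g → t < k → addAt t c (tabulateℕ k g) ≡ tabulateℕ k (λ j → g j ℤ.+ spike t c j)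
addAt-tabulateℕ (suc k) zero c g _ = cong (g 0 ℤ.+ c ∷_) (tabulateℕ-cong k (λ j _ → sym (ℤP.+-identityʳ _)))
addAt-tabulateℕ (suc k) (suc t) c g (s≤s p) = cong₂ _∷_ (sym (ℤP.+-identityʳ _)) (addAt-tabulateℕ k t c (λ j → g (suc j)) p)

prefixSum-+ : ∀ f g i → prefixSum (λ j → f j ℤ.+ g j) i ≡ prefixSum f i ℤ.+ prefixSum g i
prefixSum-+ f g zero = refl
prefixSum-+ f g (suc i) rewrite prefixSum-+ (λ j → f (suc j)) (λ j → g (suc j)) i =
  ℤ+-interchange (f 0) (g 0) (prefixSum (λ j → f (suc j)) i) (prefixSum (λ j → g (suc j)) i)

prefixSum-spike : ∀ t c i → prefixSum (spike t c) i ≡ whenℤ (t ℕ.<ᵇ i) c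
prefixSum-spike t c zero = refl
prefixSum-spike zero c (suc i) = trans (cong (λ y → c ℤ.+ y) (zeros i)) (ℤP.+-identityʳ c)
  where
  zeros : ∀ i → prefixSum (λ j → spike zero c (suc j)) i ≡ 0ℤ
  zeros zero = refl
  zeros (suc i) = trans (ℤP.+-identityˡ _) (zeros i)
prefixSum-spike (suc t) c (suc i) = trans (ℤP.+-identityˡ _) (prefixSum-spike t c i)

<ᵇ-true : ∀ {a b} → a < b → (a ℕ.<ᵇ b) ≡ true
<ᵇ-true {zero} {suc b} _ = refl
<ᵇ-true {suc a} {suc b} (s≤s p) = <ᵇ-true p

<ᵇ-false : ∀ {a b} → b ≤ a → (a ℕ.<ᵇ b) ≡ false
<ᵇ-false {a} {zero} _ = refl
<ᵇ-false {suc a} {suc b} (s≤s p) = <ᵇ-false p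

<ᵇ-sound : ∀ {a b} → (a ℕ.<ᵇ b) ≡ true → a < b
<ᵇ-sound {zero} {suc b} _ = s≤s z≤n
<ᵇ-sound {suc a} {suc b} e = s≤s (<ᵇ-sound e)

≡ᵇ-sound : ∀ {a b} → (a ℕ.≡ᵇ b) ≡ true → a ≡ b
≡ᵇ-sound {zero} {zero} _ = refl
≡ᵇ-sound {suc a} {suc b} e = cong suc (≡ᵇ-sound e)

sumBelow-[t<n] : ∀ k n → n ≤ k → sumBelow k (λ t → 𝟙 (t ℕ.<ᵇ n)) ≡ n
sumBelow-[t<n] zero zero _ = refl
sumBelow-[t<n] (suc k) zero _ = sumBelow-zero k (λ _ _ → refl)
sumBelow-[t<n] (suc k) (suc n) (s≤s p) = cong suc (sumBelow-[t<n] k n p)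

sumBelow-[q≤t] : ∀ k q → q ≤ k → sumBelow k (λ t → 𝟙 (q ℕ.<ᵇ suc t)) ≡ k ∸ q
sumBelow-[q≤t] zero zero _ = refl
sumBelow-[q≤t] (suc k) zero _ = cong suc (trans (sumBelow-cong k (λ _ _ → refl)) (ones k))
  where
  ones : ∀ k → sumBelow k (λ _ → 1) ≡ k
  ones zero = refl
  ones (suc k) = cong suc (ones k)
sumBelow-[q≤t] (suc k) (suc q) (s≤s p) = sumBelow-[q≤t] k q p

sumBelow-[t≤q]+[q≤t] : ∀ k q → q < k → sumBelow k (λ t → 𝟙 (t ℕ.<ᵇ suc q) + 𝟙 (q ℕ.<ᵇ suc t)) ≡ suc k
sumBelow-[t≤q]+[q≤t] k q q<k = trans (sumBelow-+ k _ _) (trans (cong₂ _+_ (sumBelow-[t<n] k (suc q) q<k) (sumBelow-[q≤t] k q (ℕP.<⇒≤ q<k)))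
                       (cong suc (ℕP.m+[n∸m]≡n (ℕP.<⇒≤ q<k))))

-- Column j + 1 of the two top rows stands over column j of the lower rows, and merging
-- the two top entries of a column into their sum preserves the column conditions
-- (columnOK-merge); so the pair r₁, r₂ acts on the lower rows as the single row foldTop r₁ r₂.
foldTop : List ℤ → List ℤ → ℕ → ℤ
foldTop r1 r2 j = at r1 (suc j) ℤ.+ at r2 j

firstRowOK : ℕ → List ℤ → Bool
firstRowOK m = topRowOK (suc (suc m))

secondRowOK : ℕ → List ℤ → List ℤ → Bool
secondRowOK m r1 r2 = rowOK r2 ∧ (allBelow (suc (suc m)) (λ j → pairOK (at r1 (suc j)) (at r2 j)) ∧ (soloOK (foldTop r1 r2 0) ∧ (soloOK (foldTop r1 r2 (suc m)) ∧ (isPositive (foldTop r1 r2 0) xor isPositive (foldTop r1 r2 (suc m))))))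

topRowsOK : ℕ → List ℤ → List ℤ → Bool
topRowsOK m r1 r2 = firstRowOK m r1 ∧ secondRowOK m r1 r2

x+1≡1 : ∀ x → x ℤ.+ 1ℤ ≡ 1ℤ → x ≡ 0ℤ
x+1≡1 x e = trans (sym (ℤP.+-identityʳ x)) (trans (sym (ℤP.+-assoc x 1ℤ -1ℤ)) (cong (ℤ._+ -1ℤ) e))

isPositive-bit : ∀ x → IsBit x → isPositive x ≡ true → x ≡ 1ℤ
isPositive-bit .1ℤ (inj₂ refl) _ = refl
isPositive-bit .0ℤ (inj₁ refl) ()

spike-cancel : ∀ t j x → spike t 1ℤ j ℤ.+ (x ℤ.+ spike t -1ℤ j) ≡ x
spike-cancel t j x with t ℕ.≡ᵇ j
... | true = trans (sym (ℤP.+-assoc 1ℤ x -1ℤ)) (trans (cong (ℤ._+ -1ℤ) (ℤP.+-comm 1ℤ x)) (trans (ℤP.+-assoc x 1ℤ -1ℤ) (ℤP.+-identityʳ x)))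
... | false = trans (ℤP.+-identityˡ _) (ℤP.+-identityʳ x)

prefixOK : Bool → Bool → Bool → Bool
prefixOK A D C = not ((A ∧ (D ∧ not C)) ∨ (not A ∧ (not D ∧ C)))

isBitᵇ-prefix : ∀ A D C → isBitᵇ (0ℤ ℤ.+ ((whenℤ A 1ℤ ℤ.+ whenℤ D 1ℤ) ℤ.+ whenℤ C -1ℤ)) ≡ prefixOK A D C
isBitᵇ-prefix true true true = refl
isBitᵇ-prefix true true false = refl
isBitᵇ-prefix true false true = refl
isBitᵇ-prefix true false false = refl
isBitᵇ-prefix false true true = refl
isBitᵇ-prefix false true false = refl
isBitᵇ-prefix false false true = refl
isBitᵇ-prefix false false false = refl

pairOK-prefix : ∀ a b c → (b ∧ c) ≡ false → pairOK (whenℤ a 1ℤ) ((whenℤ b 1ℤ ℤ.+ whenℤ c 1ℤ) ℤ.+ whenℤ a -1ℤ) ≡ true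
pairOK-prefix true true false _ = refl
pairOK-prefix true false true _ = refl
pairOK-prefix true false false _ = refl
pairOK-prefix false true false _ = refl
pairOK-prefix false false true _ = refl
pairOK-prefix false false false _ = refl

isEntry-prefix : ∀ a b c → (b ∧ c) ≡ false → isEntry ((whenℤ b 1ℤ ℤ.+ whenℤ c 1ℤ) ℤ.+ whenℤ a -1ℤ) ≡ true
isEntry-prefix true true false _ = refl
isEntry-prefix true false true _ = refl
isEntry-prefix true false false _ = refl
isEntry-prefix false true false _ = refl
isEntry-prefix false false true _ = refl
isEntry-prefix false false false _ = refl

δ∧δ-false : ∀ q p j → q ≢ p → ((q ℕ.≡ᵇ j) ∧ (p ℕ.≡ᵇ j)) ≡ false
δ∧δ-false q p j ne with q ℕ.≡ᵇ j in e1 | p ℕ.≡ᵇ j in e2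
... | true | true = ⊥-elim (ne (trans (≡ᵇ-sound e1) (sym (≡ᵇ-sound e2))))
... | true | false = refl
... | false | _ = refl

secondRow : ℕ → ℕ → ℕ → ℕ → ℤ
secondRow q p t j = (δ q j ℤ.+ spike p 1ℤ j) ℤ.+ spike t -1ℤ j

rowOK-secondRow : ∀ k q p t → q ≢ p → q < k → p < k → t < k →
  rowOK (tabulateℕ k (secondRow q p t)) ≡ allBelow k (λ i → prefixOK (q ℕ.<ᵇ suc i) (p ℕ.<ᵇ suc i) (t ℕ.<ᵇ suc i))
rowOK-secondRow k q p t ne q<k p<k t<k = begin
    rowOK (tabulateℕ k G)
  ≡⟨ rowOK-prefixSumsOK (tabulateℕ k G) (All-tabulateℕ k G (λ j _ → isEntry-prefix (t ℕ.≡ᵇ j) (q ℕ.≡ᵇ j) (p ℕ.≡ᵇ j) (δ∧δ-false q p j ne))) ⟩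
    prefixSumsOK 0ℤ (tabulateℕ k G)
  ≡⟨ prefixSumsOK-tabulateℕ k 0ℤ G ⟩
    allBelow k (λ i → isBitᵇ (0ℤ ℤ.+ prefixSum G (suc i))) ∧ ⌊ 0ℤ ℤ.+ prefixSum G k ℤ.≟ 1ℤ ⌋
  ≡⟨ cong₂ _∧_ (allBelow-cong k (λ i _ → trans (cong (λ z → isBitᵇ (0ℤ ℤ.+ z)) (PsG (suc i))) (isBitᵇ-prefix (q ℕ.<ᵇ suc i) (p ℕ.<ᵇ suc i) (t ℕ.<ᵇ suc i))))
               (cong (λ z → ⌊ 0ℤ ℤ.+ z ℤ.≟ 1ℤ ⌋) (trans (PsG k) (cong₂ (λ a b → (whenℤ a 1ℤ ℤ.+ whenℤ b 1ℤ) ℤ.+ whenℤ (t ℕ.<ᵇ k) -1ℤ) (<ᵇ-true q<k) (<ᵇ-true p<k)))) ⟩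
    allBelow k (λ i → prefixOK (q ℕ.<ᵇ suc i) (p ℕ.<ᵇ suc i) (t ℕ.<ᵇ suc i)) ∧ ⌊ 0ℤ ℤ.+ ((1ℤ ℤ.+ 1ℤ) ℤ.+ whenℤ (t ℕ.<ᵇ k) -1ℤ) ℤ.≟ 1ℤ ⌋
  ≡⟨ cong (λ b → allBelow k (λ i → prefixOK (q ℕ.<ᵇ suc i) (p ℕ.<ᵇ suc i) (t ℕ.<ᵇ suc i)) ∧ ⌊ 0ℤ ℤ.+ ((1ℤ ℤ.+ 1ℤ) ℤ.+ whenℤ b -1ℤ) ℤ.≟ 1ℤ ⌋) (<ᵇ-true t<k) ⟩
    allBelow k (λ i → prefixOK (q ℕ.<ᵇ suc i) (p ℕ.<ᵇ suc i) (t ℕ.<ᵇ suc i)) ∧ true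
  ≡⟨ ∧-identityʳ _ ⟩
    allBelow k (λ i → prefixOK (q ℕ.<ᵇ suc i) (p ℕ.<ᵇ suc i) (t ℕ.<ᵇ suc i)) ∎
  where
  open ≡-Reasoning
  G = secondRow q p t
  PsG : ∀ i → prefixSum G i ≡ (whenℤ (q ℕ.<ᵇ i) 1ℤ ℤ.+ whenℤ (p ℕ.<ᵇ i) 1ℤ) ℤ.+ whenℤ (t ℕ.<ᵇ i) -1ℤ
  PsG i = trans (prefixSum-+ (λ j → δ q j ℤ.+ spike p 1ℤ j) (spike t -1ℤ) i)
            (cong₂ ℤ._+_ (trans (prefixSum-+ (δ q) (spike p 1ℤ) i) (cong₂ ℤ._+_ (prefixSum-spike q 1ℤ i) (prefixSum-spike p 1ℤ i))) (prefixSum-spike t -1ℤ i))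

allBelow-prefixOK-left : ∀ k q t → q < k → allBelow k (λ i → prefixOK (q ℕ.<ᵇ suc i) (0 ℕ.<ᵇ suc i) (t ℕ.<ᵇ suc i)) ≡ (t ℕ.<ᵇ suc q)
allBelow-prefixOK-left k q t q<k with t ℕ.≤? q
... | yes t≤q = trans (allBelow-intro k (λ i → prefixOK (q ℕ.<ᵇ suc i) true (t ℕ.<ᵇ suc i)) pw) (sym (<ᵇ-true (s≤s t≤q)))
  where
  pw : ∀ i → i < k → prefixOK (q ℕ.<ᵇ suc i) true (t ℕ.<ᵇ suc i) ≡ true
  pw i _ with q ℕ.<ᵇ suc i in eA
  ... | false = refl
  ... | true rewrite <ᵇ-true {t} {suc i} (ℕP.≤-<-trans t≤q (<ᵇ-sound eA)) = refl
... | no t≰q = trans (allBelow-false k (λ i → prefixOK (q ℕ.<ᵇ suc i) true (t ℕ.<ᵇ suc i)) q q<k ev) (sym (<ᵇ-false (ℕP.≰⇒> t≰q)))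
  where
  ev : prefixOK (q ℕ.<ᵇ suc q) true (t ℕ.<ᵇ suc q) ≡ false
  ev rewrite <ᵇ-true {q} {suc q} ℕP.≤-refl | <ᵇ-false {t} {suc q} (ℕP.≰⇒> t≰q) = refl

allBelow-prefixOK-right : ∀ m q t → q < suc m → t < suc (suc m) →
  allBelow (suc (suc m)) (λ i → prefixOK (q ℕ.<ᵇ suc i) (suc m ℕ.<ᵇ suc i) (t ℕ.<ᵇ suc i)) ≡ (q ℕ.<ᵇ suc t)
allBelow-prefixOK-right m q t q<L t<k with q ℕ.≤? t
... | yes q≤t = trans (allBelow-intro (suc (suc m)) (λ i → prefixOK (q ℕ.<ᵇ suc i) (suc m ℕ.<ᵇ suc i) (t ℕ.<ᵇ suc i)) pw) (sym (<ᵇ-true (s≤s q≤t)))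
  where
  pw : ∀ i → i < suc (suc m) → prefixOK (q ℕ.<ᵇ suc i) (suc m ℕ.<ᵇ suc i) (t ℕ.<ᵇ suc i) ≡ true
  pw i _ with suc m ℕ.<ᵇ suc i in eD
  ... | true rewrite <ᵇ-true {q} {suc i} (ℕP.<-≤-trans q<L (ℕP.<⇒≤ (<ᵇ-sound eD)))
                   | <ᵇ-true {t} {suc i} (ℕP.≤-<-trans (ℕP.≤-pred t<k) (<ᵇ-sound eD)) = refl
  ... | false with q ℕ.<ᵇ suc i in eA
  ...   | true = refl
  ...   | false with t ℕ.<ᵇ suc i in eC
  ...     | false = refl
  ...     | true = ⊥-elim (ℕP.<-irrefl refl (ℕP.<-≤-trans (ℕP.≤-<-trans q≤t (<ᵇ-sound {t} {suc i} eC)) (ℕP.≮⇒≥ (λ h → f≢t (trans (sym eA) (<ᵇ-true h))))))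
    where
    f≢t : false ≡ true → ⊥
    f≢t ()
... | no q≰t = trans (allBelow-false (suc (suc m)) (λ i → prefixOK (q ℕ.<ᵇ suc i) (suc m ℕ.<ᵇ suc i) (t ℕ.<ᵇ suc i)) t t<k ev)
                   (sym (<ᵇ-false {q} {suc t} (ℕP.≰⇒> q≰t)))
  where
  ev : prefixOK (q ℕ.<ᵇ suc t) (suc m ℕ.<ᵇ suc t) (t ℕ.<ᵇ suc t) ≡ false
  ev rewrite <ᵇ-false {q} {suc t} (ℕP.≰⇒> q≰t) | <ᵇ-false {suc m} {suc t} (s≤s (ℕP.<⇒≤ (ℕP.<-≤-trans (ℕP.≰⇒> q≰t) (ℕP.≤-pred q<L)))) | <ᵇ-true {t} {suc t} ℕP.≤-refl = refl

record TopRowsOK (m : ℕ) (r1 r2 : List ℤ) : Set where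
  field
    row₁ : rowOK r1 ≡ true
    first₁ : soloOK (at r1 0) ≡ true
    last₁ : soloOK (at r1 (suc (suc (suc m)))) ≡ true
    row₂ : rowOK r2 ≡ true
    pairs : allBelow (suc (suc m)) (λ j → pairOK (at r1 (suc j)) (at r2 j)) ≡ true
    foldFirst : soloOK (foldTop r1 r2 0) ≡ true
    foldLast : soloOK (foldTop r1 r2 (suc m)) ≡ true
    foldOuter : (isPositive (foldTop r1 r2 0) xor isPositive (foldTop r1 r2 (suc m))) ≡ true

topRowsOK-elim : ∀ m r1 r2 (b : Bool) → topRowsOK m r1 r2 ∧ b ≡ true → TopRowsOK m r1 r2
topRowsOK-elim m r1 r2 b e = record { row₁ = proj₁ c1 ; first₁ = proj₁ (proj₂ c1) ; last₁ = proj₁ (proj₂ (proj₂ c1))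
  ; row₂ = proj₁ c2 ; pairs = proj₁ (proj₂ c2) ; foldFirst = proj₁ (proj₂ (proj₂ c2)) ; foldLast = proj₁ (proj₂ (proj₂ (proj₂ c2)))
  ; foldOuter = proj₂ (proj₂ (proj₂ (proj₂ c2))) }
  where
  k = suc (suc m)
  a = ∧-elim (topRowsOK m r1 r2) b e
  b12 = ∧-elim (firstRowOK m r1) (secondRowOK m r1 r2) (proj₁ a)
  c1 = ∧⁵-elim (rowOK r1) (soloOK (at r1 0)) (soloOK (at r1 (suc k))) (not (isPositive (at r1 0))) (not (isPositive (at r1 (suc k)))) (proj₁ b12)
  c2 = ∧⁵-elim (rowOK r2) (allBelow k (λ j → pairOK (at r1 (suc j)) (at r2 j))) (soloOK (foldTop r1 r2 0)) (soloOK (foldTop r1 r2 (suc m))) (isPositive (foldTop r1 r2 0) xor isPositive (foldTop r1 r2 (suc m))) (proj₂ b12)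

rowOK⇒sum : ∀ r → rowOK r ≡ true → sumℤ r ≡ 1ℤ
rowOK⇒sum r e = ≟-true⇒≡ (proj₁ (∧-elim ⌊ sumℤ r ℤ.≟ 1ℤ ⌋ (alternates (nonzeros r)) e))

record SecondRowOK (m : ℕ) (r1 r2 : List ℤ) : Set where
  field
    row₂ : rowOK r2 ≡ true
    pairs : allBelow (suc (suc m)) (λ j → pairOK (at r1 (suc j)) (at r2 j)) ≡ true
    foldFirst : soloOK (foldTop r1 r2 0) ≡ true
    foldLast : soloOK (foldTop r1 r2 (suc m)) ≡ true
    foldOuter : (isPositive (foldTop r1 r2 0) xor isPositive (foldTop r1 r2 (suc m))) ≡ true

secondRowOK-elim : ∀ m r1 r2 → secondRowOK m r1 r2 ≡ true → SecondRowOK m r1 r2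
secondRowOK-elim m r1 r2 e = record { row₂ = proj₁ c2 ; pairs = proj₁ (proj₂ c2) ; foldFirst = proj₁ (proj₂ (proj₂ c2)) ; foldLast = proj₁ (proj₂ (proj₂ (proj₂ c2)))
  ; foldOuter = proj₂ (proj₂ (proj₂ (proj₂ c2))) }
  where
  c2 = ∧⁵-elim (rowOK r2) (allBelow (suc (suc m)) (λ j → pairOK (at r1 (suc j)) (at r2 j))) (soloOK (foldTop r1 r2 0)) (soloOK (foldTop r1 r2 (suc m))) (isPositive (foldTop r1 r2 0) xor isPositive (foldTop r1 r2 (suc m))) e

module TwoTopRows (m : ℕ) (fitsBase : (ℕ → ℤ) → Bool)
         (fitsBase-cong : ∀ σ σ' → (∀ i → i < m → σ (suc i) ≡ σ' (suc i)) → fitsBase σ ≡ fitsBase σ') where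

  k = suc (suc m)
  L = suc m

  topPairCount : List ℤ → List ℤ → ℕ
  topPairCount r1 r2 = 𝟙 (topRowsOK m r1 r2 ∧ fitsBase (foldTop r1 r2))

  firstRow-unit : ∀ r2 r1 → IsWord (suc (suc k)) r1 → topPairCount r1 r2 ≡ 0 ⊎ IsUnitVector r1
  firstRow-unit r2 r1 (len , av) with topRowsOK m r1 r2 ∧ fitsBase (foldTop r1 r2) in eq
  ... | false = inj₁ refl
  ... | true = inj₂ (bits-sum-1⇒IsUnitVector r1 bits (rowOK⇒sum r1 (TopRowsOK.row₁ P)))
    where
    P = topRowsOK-elim m r1 r2 (fitsBase (foldTop r1 r2)) eq
    bits : ∀ j → j < length r1 → IsBit (at r1 j)
    bits zero _ = soloOK⇒IsBit _ (TopRowsOK.first₁ P)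
    bits (suc j) p with j ℕ.<? k
    ... | yes j<k = proj₁ (pairOK⇒IsBit (at r1 (suc j)) (at r2 j) (allBelow-elim k (λ j → pairOK (at r1 (suc j)) (at r2 j)) (TopRowsOK.pairs P) j j<k))
    ... | no j≮k = subst (λ z → IsBit (at r1 (suc z))) (ℕP.≤-antisym (ℕP.≮⇒≥ j≮k) (ℕP.≤-pred (ℕP.≤-pred (subst (suc j <_) len p)))) (soloOK⇒IsBit _ (TopRowsOK.last₁ P))

  firstRow : ℕ → List ℤ
  firstRow p = tabulateℕ (suc (suc k)) (δ p)

  countSecondRows : ℕ → ℕ
  countSecondRows p = sumOver (wordsOf k) (λ r2 → topPairCount (firstRow p) r2)

  countSecondRows-left : countSecondRows 0 ≡ 0
  countSecondRows-left = sumOver-zero (wordsOf k) (λ r2 → cong 𝟙 (∧-falseˡ (fitsBase (foldTop (firstRow 0) r2)) (∧-falseˡ (secondRowOK m (firstRow 0) r2)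
          (∧⁵-false₄ (rowOK (firstRow 0)) (soloOK (at (firstRow 0) 0)) (soloOK (at (firstRow 0) (suc k))) (not (isPositive (at (firstRow 0) 0))) (not (isPositive (at (firstRow 0) (suc k)))) refl))))

  countSecondRows-right : countSecondRows (suc k) ≡ 0
  countSecondRows-right = sumOver-zero (wordsOf k) (λ r2 → cong 𝟙 (∧-falseˡ (fitsBase (foldTop r1 r2)) (∧-falseˡ (secondRowOK m r1 r2)
          (∧⁵-false₅ (rowOK r1) (soloOK (at r1 0)) (soloOK (at r1 (suc k))) (not (isPositive (at r1 0))) (not (isPositive (at r1 (suc k))))
             (cong (λ z → not (isPositive z)) (trans (at-tabulateℕ (suc (suc k)) (δ (suc k)) (suc k) ℕP.≤-refl) (δ-self (suc k))))))))
    where r1 = firstRow (suc k)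

  module FirstRowAt (t : ℕ) (t<k : t < k) where
    r1 = firstRow (suc t)

    t<K : suc t < suc (suc k)
    t<K = s≤s (ℕP.m<n⇒m<1+n t<k)

    at-firstRow : ∀ j → j < suc k → at r1 (suc j) ≡ δ t j
    at-firstRow j p = at-tabulateℕ (suc (suc k)) (δ (suc t)) (suc j) (s≤s p)

    firstRowOK-δ : firstRowOK m r1 ≡ true
    firstRowOK-δ rewrite rowOK-IsUnitVector (IsUnitVector-δ (suc (suc k)) (suc t) t<K)
             | at-tabulateℕ (suc (suc k)) (δ (suc t)) (suc k) ℕP.≤-refl
             | ≡ᵇ-< t<k = refl

    secondRowFits : List ℤ → Bool
    secondRowFits r2 = secondRowOK m r1 r2 ∧ fitsBase (foldTop r1 r2)

    topPairCount-firstRowAt : ∀ r2 → topPairCount r1 r2 ≡ 𝟙 (secondRowFits r2)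
    topPairCount-firstRowAt r2 rewrite firstRowOK-δ = refl

    secondRow-translatable : ∀ r → length r ≡ k → 𝟙 (secondRowFits r) ≡ 0 ⊎ (isEntry (at r t) ∧ isEntry (at r t ℤ.- -1ℤ)) ≡ true
    secondRow-translatable r len with secondRowFits r in eq
    ... | false = inj₁ refl
    ... | true = inj₂ (pairOK-1 (at r t) (subst (λ a → pairOK a (at r t) ≡ true) (trans (at-firstRow t (ℕP.m<n⇒m<1+n t<k)) (δ-self t))
                        (allBelow-elim k (λ j → pairOK (at r1 (suc j)) (at r j)) (SecondRowOK.pairs Q) t t<k)))
      where
      Q = secondRowOK-elim m r1 r (proj₁ (∧-elim (secondRowOK m r1 r) (fitsBase (foldTop r1 r)) eq))

    foldTop-translate : ∀ s → length s ≡ k → ∀ j → j < k → foldTop r1 (addAt t -1ℤ s) j ≡ at s j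
    foldTop-translate s len j j<k = trans (cong₂ ℤ._+_ (at-firstRow j (ℕP.m<n⇒m<1+n j<k)) (at-addAt t -1ℤ s (subst (t <_) (sym len) t<k) j)) (spike-cancel t j (at s j))

    -- With r₂ = s - δ_t the folded row is s; its outer unit sits on the left iff s 0 is positive.
    leftCase : List ℤ → ℕ
    leftCase s = 𝟙 (secondRowFits (addAt t -1ℤ s) ∧ isPositive (at s 0))

    rightCase : List ℤ → ℕ
    rightCase s = 𝟙 (secondRowFits (addAt t -1ℤ s) ∧ not (isPositive (at s 0)))

    len-pos : ∀ (s : List ℤ) → length s ≡ k → 0 < length s
    len-pos s len = subst (0 <_) (sym len) (s≤s z≤n)

    t<len : ∀ (s : List ℤ) → length s ≡ k → t < length s
    t<len s len = subst (t <_) (sym len) t<k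

    leftCase-translatable : ∀ s → length s ≡ k → leftCase s ≡ 0 ⊎ (isEntry (at s 0) ∧ isEntry (at s 0 ℤ.- 1ℤ)) ≡ true
    leftCase-translatable s len with secondRowFits (addAt t -1ℤ s) ∧ isPositive (at s 0) in eq
    ... | false = inj₁ refl
    ... | true = inj₂ (subst (λ z → (isEntry z ∧ isEntry (z ℤ.- 1ℤ)) ≡ true) (sym (isPositive-bit (at s 0) i01 (proj₂ e))) refl)
      where
      r2 = addAt t -1ℤ s
      e = ∧-elim (secondRowFits r2) (isPositive (at s 0)) eq
      Q = secondRowOK-elim m r1 r2 (proj₁ (∧-elim (secondRowOK m r1 r2) (fitsBase (foldTop r1 r2)) (proj₁ e)))
      i01 : IsBit (at s 0)
      i01 = subst IsBit (foldTop-translate s len 0 (s≤s z≤n)) (soloOK⇒IsBit _ (SecondRowOK.foldFirst Q))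

    leftCase-unit : ∀ s' → IsWord k s' → leftCase (addAt 0 1ℤ s') ≡ 0 ⊎ IsUnitVector s'
    leftCase-unit s' (len , av) with secondRowFits (addAt t -1ℤ (addAt 0 1ℤ s')) ∧ isPositive (at (addAt 0 1ℤ s') 0) in eq
    ... | false = inj₁ refl
    ... | true = inj₂ (bits-sum-1⇒IsUnitVector s' bits sm)
      where
      s = addAt 0 1ℤ s'
      r2 = addAt t -1ℤ s
      lenS : length s ≡ k
      lenS = trans (length-addAt 0 1ℤ s') len
      e = ∧-elim (secondRowFits r2) (isPositive (at s 0)) eq
      Q = secondRowOK-elim m r1 r2 (proj₁ (∧-elim (secondRowOK m r1 r2) (fitsBase (foldTop r1 r2)) (proj₁ e)))
      atS : ∀ j → at s j ≡ at s' j ℤ.+ spike 0 1ℤ j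
      atS = at-addAt 0 1ℤ s' (len-pos s' len)
      s0 : at s 0 ≡ 1ℤ
      s0 = isPositive-bit (at s 0) (subst IsBit (foldTop-translate s lenS 0 (s≤s z≤n)) (soloOK⇒IsBit _ (SecondRowOK.foldFirst Q))) (proj₂ e)
      bits : ∀ j → j < length s' → IsBit (at s' j)
      bits zero _ = inj₁ (x+1≡1 (at s' 0) (trans (sym (atS 0)) s0))
      bits (suc j) p = subst IsBit (trans (foldTop-translate s lenS (suc j) p') (trans (atS (suc j)) (ℤP.+-identityʳ _)))
                        (proj₁ (proj₂ (pairOK⇒IsBit (at r1 (suc (suc j))) (at r2 (suc j)) (allBelow-elim k (λ j → pairOK (at r1 (suc j)) (at r2 j)) (SecondRowOK.pairs Q) (suc j) p'))))
        where p' = subst (suc j <_) len p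
      sm : sumℤ s' ≡ 1ℤ
      sm = trans (sym (trans (cong (ℤ._+ -1ℤ) (sum-addAt 0 1ℤ s' (len-pos s' len))) (trans (ℤP.+-assoc (sumℤ s') 1ℤ -1ℤ) (ℤP.+-identityʳ _))))
                 (trans (sym (sum-addAt t -1ℤ s (t<len s lenS))) (rowOK⇒sum r2 (SecondRowOK.row₂ Q)))

    foldTop-secondRow : ∀ q p j → j < k → foldTop r1 (tabulateℕ k (secondRow q p t)) j ≡ δ q j ℤ.+ spike p 1ℤ j
    foldTop-secondRow q p j j<k = trans (cong₂ ℤ._+_ (at-firstRow j (ℕP.m<n⇒m<1+n j<k)) (at-tabulateℕ k (secondRow q p t) j j<k)) (spike-cancel t j _)

    secondRowOK-intro : ∀ r2 b → rowOK r2 ≡ b → allBelow k (λ j → pairOK (at r1 (suc j)) (at r2 j)) ≡ true →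
      soloOK (foldTop r1 r2 0) ≡ true → soloOK (foldTop r1 r2 L) ≡ true → (isPositive (foldTop r1 r2 0) xor isPositive (foldTop r1 r2 L)) ≡ true →
      (rowOK r2 ∧ (allBelow k (λ j → pairOK (at r1 (suc j)) (at r2 j)) ∧ (soloOK (foldTop r1 r2 0) ∧ (soloOK (foldTop r1 r2 L) ∧ (isPositive (foldTop r1 r2 0) xor isPositive (foldTop r1 r2 L)))))) ≡ b ∧ true
    secondRowOK-intro r2 b e1 e2 e3 e4 e5 rewrite e1 | e2 | e3 | e4 | e5 = refl

    pairOK-secondRow : ∀ q p → q ≢ p → allBelow k (λ j → pairOK (at r1 (suc j)) (at (tabulateℕ k (secondRow q p t)) j)) ≡ true
    pairOK-secondRow q p ne = allBelow-intro k _ (λ j j<k → subst₂ (λ a b → pairOK a b ≡ true) (sym (at-firstRow j (ℕP.m<n⇒m<1+n j<k))) (sym (at-tabulateℕ k (secondRow q p t) j j<k))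
                                        (pairOK-prefix (t ℕ.≡ᵇ j) (q ℕ.≡ᵇ j) (p ℕ.≡ᵇ j) (δ∧δ-false q p j ne)))

    secondRowOK-false₃ : ∀ r2 → soloOK (foldTop r1 r2 0) ≡ false → secondRowOK m r1 r2 ≡ false
    secondRowOK-false₃ r2 e = ∧⁵-false₃ (rowOK r2) (allBelow k (λ j → pairOK (at r1 (suc j)) (at r2 j))) (soloOK (foldTop r1 r2 0)) (soloOK (foldTop r1 r2 L)) (isPositive (foldTop r1 r2 0) xor isPositive (foldTop r1 r2 L)) e

    secondRowOK-false₄ : ∀ r2 → soloOK (foldTop r1 r2 L) ≡ false → secondRowOK m r1 r2 ≡ false
    secondRowOK-false₄ r2 e = ∧⁵-false₄ (rowOK r2) (allBelow k (λ j → pairOK (at r1 (suc j)) (at r2 j))) (soloOK (foldTop r1 r2 0)) (soloOK (foldTop r1 r2 L)) (isPositive (foldTop r1 r2 0) xor isPositive (foldTop r1 r2 L)) e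

    secondRowOK-false₅ : ∀ r2 → (isPositive (foldTop r1 r2 0) xor isPositive (foldTop r1 r2 L)) ≡ false → secondRowOK m r1 r2 ≡ false
    secondRowOK-false₅ r2 e = ∧⁵-false₅ (rowOK r2) (allBelow k (λ j → pairOK (at r1 (suc j)) (at r2 j))) (soloOK (foldTop r1 r2 0)) (soloOK (foldTop r1 r2 L)) (isPositive (foldTop r1 r2 0) xor isPositive (foldTop r1 r2 L)) e

    0<k : 0 < k
    0<k = s≤s z≤n
    L<k : L < k
    L<k = ℕP.≤-refl

    leftCase-δ : ∀ q → leftCase (addAt 0 1ℤ (tabulateℕ k (δ q))) ≡ 𝟙 (secondRowFits (tabulateℕ k (secondRow q 0 t)) ∧ isPositive (δ q 0 ℤ.+ 1ℤ))
    leftCase-δ q = trans (cong leftCase (addAt-tabulateℕ k 0 1ℤ (δ q) 0<k))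
                     (cong (λ z → 𝟙 (secondRowFits z ∧ isPositive (δ q 0 ℤ.+ 1ℤ))) (addAt-tabulateℕ k t -1ℤ (λ j → δ q j ℤ.+ spike 0 1ℤ j) t<k))

    leftCase-first : leftCase (addAt 0 1ℤ (tabulateℕ k (δ 0))) ≡ 0
    leftCase-first = trans (leftCase-δ 0) (cong 𝟙 (∧-falseˡ (isPositive (δ 0 0 ℤ.+ 1ℤ)) (∧-falseˡ (fitsBase (foldTop r1 r2)) (secondRowOK-false₃ r2 (cong soloOK (foldTop-secondRow 0 0 0 0<k))))))
      where r2 = tabulateℕ k (secondRow 0 0 t)

    leftCase-last : leftCase (addAt 0 1ℤ (tabulateℕ k (δ L))) ≡ 0
    leftCase-last = trans (leftCase-δ L) (cong 𝟙 (∧-falseˡ (isPositive (δ L 0 ℤ.+ 1ℤ)) (∧-falseˡ (fitsBase (foldTop r1 r2)) (secondRowOK-false₅ r2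
             (cong₂ (λ a b → (isPositive a xor isPositive b)) (foldTop-secondRow L 0 0 0<k) (trans (foldTop-secondRow L 0 L L<k) (cong (ℤ._+ 0ℤ) (δ-self L))))))))
      where r2 = tabulateℕ k (secondRow L 0 t)

    ∧tt : ∀ a b → ((a ∧ true) ∧ b) ∧ true ≡ a ∧ b
    ∧tt true b = ∧-identityʳ b
    ∧tt false b = refl

    leftCase-inner : ∀ i → i < m → leftCase (addAt 0 1ℤ (tabulateℕ k (δ (suc i)))) ≡ 𝟙 ((t ℕ.<ᵇ suc (suc i)) ∧ fitsBase (δ (suc i)))
    leftCase-inner i i<m = trans (leftCase-δ q) (cong 𝟙 (trans (cong₂ (λ a b → (a ∧ b) ∧ true) la ιe) (∧tt (t ℕ.<ᵇ suc q) (fitsBase (δ q)))))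
      where
      q = suc i
      q<k : q < k
      q<k = s≤s (s≤s (ℕP.<⇒≤ i<m))
      r2 = tabulateℕ k (secondRow q 0 t)
      gL : soloOK (foldTop r1 r2 L) ≡ true
      gL rewrite foldTop-secondRow q 0 L L<k | ≡ᵇ-< {i} {m} i<m = refl
      la : secondRowOK m r1 r2 ≡ (t ℕ.<ᵇ suc q) ∧ true
      la = secondRowOK-intro r2 (t ℕ.<ᵇ suc q) (trans (rowOK-secondRow k q 0 t (λ ()) q<k 0<k t<k) (allBelow-prefixOK-left k q t q<k)) (pairOK-secondRow q 0 (λ ()))
             (cong soloOK (foldTop-secondRow q 0 0 0<k)) gL (cong₂ (λ a b → (isPositive a xor isPositive b)) (foldTop-secondRow q 0 0 0<k) (trans (foldTop-secondRow q 0 L L<k) (cong (λ b → whenℤ b 1ℤ ℤ.+ 0ℤ) (≡ᵇ-< {i} {m} i<m))))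
      ιe : fitsBase (foldTop r1 r2) ≡ fitsBase (δ q)
      ιe = fitsBase-cong _ _ (λ j j<m → trans (foldTop-secondRow q 0 (suc j) (s≤s (s≤s (ℕP.<⇒≤ j<m)))) (ℤP.+-identityʳ _))

    not-t : ∀ {b} → not b ≡ true → b ≡ false
    not-t {false} _ = refl

    rightCase-translatable : ∀ s → length s ≡ k → rightCase s ≡ 0 ⊎ (isEntry (at s L) ∧ isEntry (at s L ℤ.- 1ℤ)) ≡ true
    rightCase-translatable s len with secondRowFits (addAt t -1ℤ s) ∧ not (isPositive (at s 0)) in eq
    ... | false = inj₁ refl
    ... | true = inj₂ (subst (λ z → (isEntry z ∧ isEntry (z ℤ.- 1ℤ)) ≡ true) (sym sL) refl)
      where
      r2 = addAt t -1ℤ s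
      e = ∧-elim (secondRowFits r2) (not (isPositive (at s 0))) eq
      Q = secondRowOK-elim m r1 r2 (proj₁ (∧-elim (secondRowOK m r1 r2) (fitsBase (foldTop r1 r2)) (proj₁ e)))
      p0 : isPositive (foldTop r1 r2 0) ≡ false
      p0 = trans (cong isPositive (foldTop-translate s len 0 0<k)) (not-t (proj₂ e))
      pL : isPositive (foldTop r1 r2 L) ≡ true
      pL = subst (λ b → (b xor (isPositive (foldTop r1 r2 L))) ≡ true) p0 (SecondRowOK.foldOuter Q)
      sL : at s L ≡ 1ℤ
      sL = trans (sym (foldTop-translate s len L L<k)) (isPositive-bit _ (soloOK⇒IsBit _ (SecondRowOK.foldLast Q)) pL)

    rightCase-unit : ∀ s' → IsWord k s' → rightCase (addAt L 1ℤ s') ≡ 0 ⊎ IsUnitVector s'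
    rightCase-unit s' (len , av) with secondRowFits (addAt t -1ℤ (addAt L 1ℤ s')) ∧ not (isPositive (at (addAt L 1ℤ s') 0)) in eq
    ... | false = inj₁ refl
    ... | true = inj₂ (bits-sum-1⇒IsUnitVector s' bits sm)
      where
      s = addAt L 1ℤ s'
      r2 = addAt t -1ℤ s
      lenS : length s ≡ k
      lenS = trans (length-addAt L 1ℤ s') len
      L<len : L < length s'
      L<len = subst (L <_) (sym len) L<k
      e = ∧-elim (secondRowFits r2) (not (isPositive (at s 0))) eq
      Q = secondRowOK-elim m r1 r2 (proj₁ (∧-elim (secondRowOK m r1 r2) (fitsBase (foldTop r1 r2)) (proj₁ e)))
      atS : ∀ j → at s j ≡ at s' j ℤ.+ spike L 1ℤ j
      atS = at-addAt L 1ℤ s' L<len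
      p0 : isPositive (foldTop r1 r2 0) ≡ false
      p0 = trans (cong isPositive (foldTop-translate s lenS 0 0<k)) (not-t (proj₂ e))
      pL : isPositive (foldTop r1 r2 L) ≡ true
      pL = subst (λ b → (b xor (isPositive (foldTop r1 r2 L))) ≡ true) p0 (SecondRowOK.foldOuter Q)
      sL : at s L ≡ 1ℤ
      sL = trans (sym (foldTop-translate s lenS L L<k)) (isPositive-bit _ (soloOK⇒IsBit _ (SecondRowOK.foldLast Q)) pL)
      bits : ∀ j → j < length s' → IsBit (at s' j)
      bits j p with L ℕ.≡ᵇ j in ej
      ... | true = subst (λ z → IsBit (at s' z)) (≡ᵇ-sound ej)
                     (inj₁ (x+1≡1 (at s' L) (trans (sym (trans (atS L) (cong (λ b → at s' L ℤ.+ whenℤ b 1ℤ) (≡ᵇ-refl L)))) sL)))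
      ... | false = subst IsBit (trans (foldTop-translate s lenS j p') (trans (atS j) (trans (cong (λ b → at s' j ℤ.+ whenℤ b 1ℤ) ej) (ℤP.+-identityʳ _))))
                        (proj₁ (proj₂ (pairOK⇒IsBit (at r1 (suc j)) (at r2 j) (allBelow-elim k (λ j → pairOK (at r1 (suc j)) (at r2 j)) (SecondRowOK.pairs Q) j p'))))
        where p' = subst (j <_) len p
      sm : sumℤ s' ≡ 1ℤ
      sm = trans (sym (trans (cong (ℤ._+ -1ℤ) (sum-addAt L 1ℤ s' L<len)) (trans (ℤP.+-assoc (sumℤ s') 1ℤ -1ℤ) (ℤP.+-identityʳ _))))
                 (trans (sym (sum-addAt t -1ℤ s (t<len s lenS))) (rowOK⇒sum r2 (SecondRowOK.row₂ Q)))

    rightCase-δ : ∀ q → rightCase (addAt L 1ℤ (tabulateℕ k (δ q))) ≡ 𝟙 (secondRowFits (tabulateℕ k (secondRow q L t)) ∧ not (isPositive (δ q 0 ℤ.+ spike L 1ℤ 0)))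
    rightCase-δ q = trans (cong rightCase (addAt-tabulateℕ k L 1ℤ (δ q) L<k))
                     (cong (λ z → 𝟙 (secondRowFits z ∧ not (isPositive (δ q 0 ℤ.+ spike L 1ℤ 0)))) (addAt-tabulateℕ k t -1ℤ (λ j → δ q j ℤ.+ spike L 1ℤ j) t<k))

    rightCase-first : rightCase (addAt L 1ℤ (tabulateℕ k (δ 0))) ≡ 0
    rightCase-first = trans (rightCase-δ 0) (cong 𝟙 (∧-falseʳ (secondRowFits (tabulateℕ k (secondRow 0 L t))) refl))

    rightCase-last : rightCase (addAt L 1ℤ (tabulateℕ k (δ L))) ≡ 0
    rightCase-last = trans (rightCase-δ L) (cong 𝟙 (∧-falseˡ (not (isPositive (δ L 0 ℤ.+ spike L 1ℤ 0))) (∧-falseˡ (fitsBase (foldTop r1 r2)) (secondRowOK-false₄ r2 gL))))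
      where
      r2 = tabulateℕ k (secondRow L L t)
      gL : soloOK (foldTop r1 r2 L) ≡ false
      gL rewrite foldTop-secondRow L L L L<k | ≡ᵇ-refl m = refl

    rightCase-inner : ∀ i → i < m → rightCase (addAt L 1ℤ (tabulateℕ k (δ (suc i)))) ≡ 𝟙 ((suc i ℕ.<ᵇ suc t) ∧ fitsBase (δ (suc i)))
    rightCase-inner i i<m = trans (rightCase-δ q) (cong 𝟙 (trans (cong₂ (λ a b → (a ∧ b) ∧ true) la ιe) (∧tt (q ℕ.<ᵇ suc t) (fitsBase (δ q)))))
      where
      q = suc i
      q<k : q < k
      q<k = s≤s (s≤s (ℕP.<⇒≤ i<m))
      q≢L : q ≢ L
      q≢L e = ℕP.<-irrefl (ℕP.suc-injective e) i<m
      r2 = tabulateℕ k (secondRow q L t)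
      gL : soloOK (foldTop r1 r2 L) ≡ true
      gL rewrite foldTop-secondRow q L L L<k | ≡ᵇ-< {i} {m} i<m | ≡ᵇ-refl m = refl
      xr : (isPositive (foldTop r1 r2 0) xor isPositive (foldTop r1 r2 L)) ≡ true
      xr rewrite foldTop-secondRow q L 0 0<k | foldTop-secondRow q L L L<k | ≡ᵇ-< {i} {m} i<m | ≡ᵇ-refl m = refl
      la : secondRowOK m r1 r2 ≡ (q ℕ.<ᵇ suc t) ∧ true
      la = secondRowOK-intro r2 (q ℕ.<ᵇ suc t) (trans (rowOK-secondRow k q L t q≢L q<k L<k t<k) (allBelow-prefixOK-right m q t (s≤s i<m) t<k)) (pairOK-secondRow q L q≢L)
             (cong soloOK (foldTop-secondRow q L 0 0<k)) gL xr
      ιe : fitsBase (foldTop r1 r2) ≡ fitsBase (δ q)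
      ιe = fitsBase-cong _ _ (λ j j<m → trans (foldTop-secondRow q L (suc j) (s≤s (s≤s (ℕP.<⇒≤ j<m)))) (trans (cong (λ b → δ q (suc j) ℤ.+ whenℤ b 1ℤ) (≡ᵇ-> j<m)) (ℤP.+-identityʳ _)))

    sumBelow-ends : ∀ f → sumBelow k f ≡ f 0 + (sumBelow m (λ i → f (suc i)) + f (suc m))
    sumBelow-ends f = cong (f 0 +_) (sumBelow-last m (λ i → f (suc i)))

    countSecondRows-inner : countSecondRows (suc t) ≡ sumBelow m (λ i → 𝟙 ((t ℕ.<ᵇ suc (suc i)) ∧ fitsBase (δ (suc i)))) + sumBelow m (λ i → 𝟙 ((suc i ℕ.<ᵇ suc t) ∧ fitsBase (δ (suc i))))
    countSecondRows-inner = begin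
        sumOver (wordsOf k) (λ r2 → topPairCount r1 r2)
      ≡⟨ sumOver-cong (wordsOf k) topPairCount-firstRowAt ⟩
        sumOver (wordsOf k) (λ r2 → 𝟙 (secondRowFits r2))
      ≡⟨ sumOver-wordsOf-translate k t -1ℤ (inj₂ refl) (λ r → 𝟙 (secondRowFits r)) secondRow-translatable ⟩
        sumOver (wordsOf k) (λ s → 𝟙 (secondRowFits (addAt t -1ℤ s)))
      ≡⟨ trans (sumOver-cong (wordsOf k) (λ s → 𝟙-split (secondRowFits (addAt t -1ℤ s)) (isPositive (at s 0)))) (sumOver-+ (wordsOf k) leftCase rightCase) ⟩
        sumOver (wordsOf k) leftCase + sumOver (wordsOf k) rightCase
      ≡⟨ cong₂ _+_ (trans (sumOver-wordsOf-translate k 0 1ℤ (inj₁ refl) leftCase leftCase-translatable) (sumOver-wordsOf-atUnits k _ leftCase-unit)) (trans (sumOver-wordsOf-translate k L 1ℤ (inj₁ refl) rightCase rightCase-translatable) (sumOver-wordsOf-atUnits k _ rightCase-unit)) ⟩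
        sumBelow k (λ q → leftCase (addAt 0 1ℤ (tabulateℕ k (δ q)))) + sumBelow k (λ q → rightCase (addAt L 1ℤ (tabulateℕ k (δ q))))
      ≡⟨ cong₂ _+_ (trans (sumBelow-ends (λ q → leftCase (addAt 0 1ℤ (tabulateℕ k (δ q))))) (trans (cong₂ (λ a b → a + (sumBelow m (λ i → leftCase (addAt 0 1ℤ (tabulateℕ k (δ (suc i))))) + b)) leftCase-first leftCase-last)
                      (trans (ℕP.+-identityʳ _) (sumBelow-cong m leftCase-inner))))
                   (trans (sumBelow-ends (λ q → rightCase (addAt L 1ℤ (tabulateℕ k (δ q))))) (trans (cong₂ (λ a b → a + (sumBelow m (λ i → rightCase (addAt L 1ℤ (tabulateℕ k (δ (suc i))))) + b)) rightCase-first rightCase-last)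
                      (trans (ℕP.+-identityʳ _) (sumBelow-cong m rightCase-inner)))) ⟩
        sumBelow m (λ i → 𝟙 ((t ℕ.<ᵇ suc (suc i)) ∧ fitsBase (δ (suc i)))) + sumBelow m (λ i → 𝟙 ((suc i ℕ.<ᵇ suc t) ∧ fitsBase (δ (suc i)))) ∎
      where open ≡-Reasoning

  count-two-top-rows : sumOver (wordsOf k) (λ r2 → sumOver (wordsOf (suc (suc k))) (λ r1 → topPairCount r1 r2)) ≡ suc k * sumBelow m (λ i → 𝟙 (fitsBase (δ (suc i))))
  count-two-top-rows = begin
      sumOver (wordsOf k) (λ r2 → sumOver (wordsOf (suc (suc k))) (λ r1 → topPairCount r1 r2))
    ≡⟨ sumOver-cong (wordsOf k) (λ r2 → sumOver-wordsOf-atUnits (suc (suc k)) (λ r1 → topPairCount r1 r2) (firstRow-unit r2)) ⟩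
      sumOver (wordsOf k) (λ r2 → sumBelow (suc (suc k)) (λ p → topPairCount (firstRow p) r2))
    ≡⟨ sumOver-sumBelow-swap (wordsOf k) (suc (suc k)) (λ r2 p → topPairCount (firstRow p) r2) ⟩
      sumBelow (suc (suc k)) countSecondRows
    ≡⟨ cong (countSecondRows 0 +_) (sumBelow-last k (λ p → countSecondRows (suc p))) ⟩
      countSecondRows 0 + (sumBelow k (λ t → countSecondRows (suc t)) + countSecondRows (suc k))
    ≡⟨ cong₂ (λ a b → a + (sumBelow k (λ t → countSecondRows (suc t)) + b)) countSecondRows-left countSecondRows-right ⟩
      0 + (sumBelow k (λ t → countSecondRows (suc t)) + 0)
    ≡⟨ ℕP.+-identityʳ _ ⟩
      sumBelow k (λ t → countSecondRows (suc t))
    ≡⟨ sumBelow-cong k (λ t t<k → trans (FirstRowAt.countSecondRows-inner t t<k) (trans (sym (sumBelow-+ m _ _)) (sumBelow-cong m (λ i _ → comb t i)))) ⟩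
      sumBelow k (λ t → sumBelow m (λ i → (𝟙 (t ℕ.<ᵇ suc (suc i)) + 𝟙 (suc i ℕ.<ᵇ suc t)) * ι i))
    ≡⟨ sumBelow-swap k m (λ t i → (𝟙 (t ℕ.<ᵇ suc (suc i)) + 𝟙 (suc i ℕ.<ᵇ suc t)) * ι i) ⟩
      sumBelow m (λ i → sumBelow k (λ t → (𝟙 (t ℕ.<ᵇ suc (suc i)) + 𝟙 (suc i ℕ.<ᵇ suc t)) * ι i))
    ≡⟨ sumBelow-cong m (λ i i<m → trans (sumBelow-*ʳ k (ι i) (λ t → 𝟙 (t ℕ.<ᵇ suc (suc i)) + 𝟙 (suc i ℕ.<ᵇ suc t)))
                                   (cong (_* ι i) (sumBelow-[t≤q]+[q≤t] k (suc i) (s≤s (s≤s (ℕP.<⇒≤ i<m)))))) ⟩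
      sumBelow m (λ i → suc k * ι i)
    ≡⟨ sumBelow-* m (suc k) ι ⟩
      suc k * sumBelow m ι ∎
    where
    open ≡-Reasoning
    ι : ℕ → ℕ
    ι i = 𝟙 (fitsBase (δ (suc i)))
    comb : ∀ t i → 𝟙 ((t ℕ.<ᵇ suc (suc i)) ∧ fitsBase (δ (suc i))) + 𝟙 ((suc i ℕ.<ᵇ suc t) ∧ fitsBase (δ (suc i)))
                   ≡ (𝟙 (t ℕ.<ᵇ suc (suc i)) + 𝟙 (suc i ℕ.<ᵇ suc t)) * ι i
    comb t i = trans (cong₂ _+_ (𝟙-∧ (t ℕ.<ᵇ suc (suc i)) (fitsBase (δ (suc i)))) (𝟙-∧ (suc i ℕ.<ᵇ suc t) (fitsBase (δ (suc i)))))
                     (sym (ℕP.*-distribʳ-+ (ι i) (𝟙 (t ℕ.<ᵇ suc (suc i))) (𝟙 (suc i ℕ.<ᵇ suc t))))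

-- Columns of the centred grid

length-filter-sumOver : ∀ {A : Set} {P : A → Set} (P? : Decidable P) xs → length (filter P? xs) ≡ sumOver xs (λ x → 𝟙 (does (P? x)))
length-filter-sumOver P? [] = refl
length-filter-sumOver P? (x ∷ xs) with does (P? x)
... | true = cong suc (length-filter-sumOver P? xs)
... | false = length-filter-sumOver P? xs

module _ {A : Set} where
  all-++ : ∀ (p : A → Bool) xs ys → all p (xs ++ ys) ≡ all p xs ∧ all p ys
  all-++ p [] ys = refl
  all-++ p (x ∷ xs) ys = trans (cong (p x ∧_) (all-++ p xs ys)) (sym (BP.∧-assoc (p x) _ _))

  any-filter : ∀ {P : A → Set} (d : Decidable P) (p : A → Bool) xs → any p (filter d xs) ≡ any (λ y → does (d y) ∧ p y) xs
  any-filter d p [] = refl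
  any-filter d p (x ∷ xs) with does (d x)
  ... | true = cong (p x ∨_) (any-filter d p xs)
  ... | false = any-filter d p xs

module _ {A B : Set} where
  all-map : ∀ (p : B → Bool) (f : A → B) xs → all p (map f xs) ≡ all (p ∘ f) xs
  all-map p f [] = refl
  all-map p f (x ∷ xs) = cong (p (f x) ∧_) (all-map p f xs)

  any-map : ∀ (p : B → Bool) (f : A → B) xs → any p (map f xs) ≡ any (p ∘ f) xs
  any-map p f [] = refl
  any-map p f (x ∷ xs) = cong (p (f x) ∨_) (any-map p f xs)

all-applyUpTo : ∀ (h : ℕ → Bool) f n → all h (applyUpTo f n) ≡ allBelow n (h ∘ f)
all-applyUpTo h f zero = refl
all-applyUpTo h f (suc n) = cong (h (f 0) ∧_) (all-applyUpTo h (f ∘ suc) n)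

any-applyUpTo : ∀ (h : ℕ → Bool) f n → any h (applyUpTo f n) ≡ anyBelow n (h ∘ f)
any-applyUpTo h f zero = refl
any-applyUpTo h f (suc n) = cong (h (f 0) ∨_) (any-applyUpTo h (f ∘ suc) n)

allBelow-last : ∀ n g → allBelow (suc n) g ≡ allBelow n g ∧ g n
allBelow-last zero g = trans (BP.∧-identityʳ (g 0)) refl
allBelow-last (suc n) g = trans (cong (g 0 ∧_) (allBelow-last n (λ i → g (suc i)))) (sym (BP.∧-assoc (g 0) _ _))

anyBelow-last : ∀ n g → anyBelow (suc n) g ≡ anyBelow n g ∨ g n
anyBelow-last zero g = BP.∨-identityʳ (g 0)
anyBelow-last (suc n) g = trans (cong (g 0 ∨_) (anyBelow-last n (λ i → g (suc i)))) (sym (BP.∨-assoc (g 0) _ _))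

allBelow-∧ : ∀ n f g → allBelow n (λ j → f j ∧ g j) ≡ allBelow n f ∧ allBelow n g
allBelow-∧ zero f g = refl
allBelow-∧ (suc n) f g = trans (cong ((f 0 ∧ g 0) ∧_) (allBelow-∧ n (λ i → f (suc i)) (λ i → g (suc i)))) (∧-interchange (f 0) (g 0) _ _)

at-++[] : ∀ xs j → at (xs ++ []) j ≡ at xs j
at-++[] xs j = cong (λ z → at z j) (LP.++-identityʳ xs)

at-rep : ∀ xs a j → at (xs ++ replicate a 0ℤ) j ≡ at xs j
at-rep [] zero j = refl
at-rep [] (suc a) zero = refl
at-rep [] (suc a) (suc j) = at-rep [] a j
at-rep (x ∷ xs) a zero = refl
at-rep (x ∷ xs) a (suc j) = at-rep xs a j

at-++0 : ∀ xs j → at (xs ++ 0ℤ ∷ []) j ≡ at xs j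
at-++0 xs j = at-rep xs 1 j

at-beyond : ∀ xs j → length xs ≤ j → at xs j ≡ 0ℤ
at-beyond [] j _ = refl
at-beyond (x ∷ xs) (suc j) (s≤s p) = at-beyond xs j p

colOf : List (List ℤ) → ℕ → List ℤ
colOf rows j = map (λ row → at row j) rows

padShift : ∀ a rs j → colOf (padTop (suc a) rs) (suc j) ≡ colOf (padTop a rs) j
padShift a [] j = refl
padShift a (r ∷ rs) j = cong₂ _∷_ e (padShift (suc a) rs j)
  where
  e : at (replicate a 0ℤ ++ r ++ replicate (suc a) 0ℤ) j ≡ at (replicate a 0ℤ ++ r ++ replicate a 0ℤ) j
  e = trans (cong (λ z → at z j) (sym (LP.++-assoc (replicate a 0ℤ) r _)))
        (trans (at-rep (replicate a 0ℤ ++ r) (suc a) j)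
          (trans (sym (at-rep (replicate a 0ℤ ++ r) a j)) (cong (λ z → at z j) (LP.++-assoc (replicate a 0ℤ) r _))))

pad0 : ∀ a rs → AllZero (colOf (padTop (suc a) rs) 0)
pad0 a [] = []
pad0 a (r ∷ rs) = refl ∷ pad0 (suc a) rs

rev-snoc : ∀ (C : List (List ℤ)) r → reverse (C ++ r ∷ []) ≡ r ∷ reverse C
rev-snoc C r = LP.reverse-++ C (r ∷ [])

grid-snoc : ∀ C r → grid (C ++ r ∷ []) ≡ (r ++ []) ∷ padTop 1 (reverse C)
grid-snoc C r = cong (padTop 0) (rev-snoc C r)

grid-snoc² : ∀ C r2 r1 → grid ((C ++ r2 ∷ []) ++ r1 ∷ []) ≡ (r1 ++ []) ∷ ((0ℤ ∷ (r2 ++ 0ℤ ∷ [])) ∷ padTop 2 (reverse C))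
grid-snoc² C r2 r1 = cong (padTop 0) (trans (rev-snoc (C ++ r2 ∷ []) r1) (cong (r1 ∷_) (rev-snoc C r2)))

baseColumn : List (List ℤ) → ℕ → List ℤ
baseColumn C j = colOf (padTop 1 (reverse C)) j

column-snoc : ∀ C r j → column (C ++ r ∷ []) j ≡ at r j ∷ baseColumn C j
column-snoc C r j = trans (cong (λ g → colOf g j) (grid-snoc C r)) (cong (_∷ baseColumn C j) (at-++[] r j))

column-snoc² : ∀ C r2 r1 j → column ((C ++ r2 ∷ []) ++ r1 ∷ []) (suc j) ≡ at r1 (suc j) ∷ at r2 j ∷ baseColumn C j
column-snoc² C r2 r1 j = trans (cong (λ g → colOf g (suc j)) (grid-snoc² C r2 r1))
   (cong₂ _∷_ (at-++[] r1 (suc j)) (cong₂ _∷_ (at-++0 r2 j) (padShift 1 (reverse C) j)))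

column-snoc²-0 : ∀ C r2 r1 → column ((C ++ r2 ∷ []) ++ r1 ∷ []) 0 ≡ at r1 0 ∷ 0ℤ ∷ colOf (padTop 2 (reverse C)) 0
column-snoc²-0 C r2 r1 = trans (cong (λ g → colOf g 0) (grid-snoc² C r2 r1)) (cong (_∷ _) (at-++[] r1 0))

columnOK-AllZero : ∀ x {zs} → AllZero zs → columnOK (x ∷ zs) ≡ columnOK (x ∷ [])
columnOK-AllZero x {zs} z with x ℤ.≟ 0ℤ
... | yes refl rewrite nonzeros-AllZero z = refl
... | no _ rewrite nonzeros-AllZero z = refl

isEntry-cases : ∀ x → isEntry x ≡ true → x ≡ 0ℤ ⊎ x ≡ 1ℤ ⊎ x ≡ -1ℤ
isEntry-cases (ℤ.+ 0) _ = inj₁ refl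
isEntry-cases (ℤ.+ 1) _ = inj₂ (inj₁ refl)
isEntry-cases ℤ.-[1+ 0 ] _ = inj₂ (inj₂ refl)
isEntry-cases (ℤ.+ suc (suc n)) ()
isEntry-cases ℤ.-[1+ suc n ] ()

alternates-−1∷ : ∀ zs → alternates (-1ℤ ∷ zs) ≡ alternates zs ∧ firstPositive zs
alternates-−1∷ [] = refl
alternates-−1∷ (y ∷ ys) = trans (cong (_∧ alternates (y ∷ ys)) (e y)) (BP.∧-comm (⌊ 0ℤ ℤ.<? y ⌋) _)
  where
  e : ∀ y → ⌊ -1ℤ ℤ.* y ℤ.<? 0ℤ ⌋ ≡ ⌊ 0ℤ ℤ.<? y ⌋
  e (ℤ.+ 0) = refl
  e (ℤ.+ suc n) = refl
  e ℤ.-[1+ n ] = refl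

columnOK-merge : ∀ a b rest → isEntry a ≡ true → isEntry b ≡ true → columnOK (a ∷ b ∷ rest) ≡ columnOK (a ∷ b ∷ []) ∧ columnOK ((a ℤ.+ b) ∷ rest)
columnOK-merge a b rest va vb with isEntry-cases a va | isEntry-cases b vb
... | inj₁ refl | inj₁ refl = refl
... | inj₁ refl | inj₂ (inj₁ refl) = refl
... | inj₁ refl | inj₂ (inj₂ refl) = BP.∧-zeroʳ _
... | inj₂ (inj₁ refl) | inj₁ refl = refl
... | inj₂ (inj₁ refl) | inj₂ (inj₁ refl) = refl
... | inj₂ (inj₁ refl) | inj₂ (inj₂ refl) = trans (BP.∧-identityʳ _) (alternates-−1∷ (nonzeros rest))
... | inj₂ (inj₂ refl) | _ = trans (BP.∧-zeroʳ _) (sym (fz b))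
  where
  fz : ∀ b → columnOK (-1ℤ ∷ b ∷ []) ∧ columnOK ((-1ℤ ℤ.+ b) ∷ rest) ≡ false
  fz b with alternates (nonzeros (-1ℤ ∷ b ∷ []))
  ... | false = refl
  ... | true = refl

-- Column labels and Motzkin paths

label : ℕ → ℕ → ℤ
label n j = ((ℤ.+ j) ℤ.- (ℤ.+ n)) ℤ.+ 1ℤ

label-⊖ : ∀ N j → label (suc N) j ≡ j ⊖ N
label-⊖ N j = trans (cancel-1 (ℤ.+ j) (ℤ.+ N)) (ℤP.m-n≡m⊖n j N)
  where
  cancel-1 : ∀ (a b : ℤ) → (a ℤ.- (1ℤ ℤ.+ b)) ℤ.+ 1ℤ ≡ a ℤ.- b
  cancel-1 = solve-∀

label-suc : ∀ N j → label (suc (suc N)) (suc j) ≡ label (suc N) j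
label-suc N j = trans (label-⊖ (suc N) (suc j)) (trans (ℤP.[1+m]⊖[1+n]≡m⊖n j N) (sym (label-⊖ N j)))

isYes-T : ∀ b → ⌊ Relation.Nullary.Decidable.T? b ⌋ ≡ b
isYes-T true = refl
isYes-T false = refl

module ColumnShift (l' : ℕ) where
  l = suc l'

  isCentral-neg : ∀ a → isCentral l (ℤ.- ℤ.+ a) ≡ false
  isCentral-neg zero = refl
  isCentral-neg (suc a) = refl

  shiftCol-neg : ∀ a → shiftCol l (ℤ.- ℤ.+ a) ≡ ℤ.-[1+ a ]
  shiftCol-neg zero = refl
  shiftCol-neg (suc a) = cong (λ z → ℤ.-[1+ suc z ]) (ℕP.+-identityʳ a)

  isCentral-pos : ∀ b → isCentral l (ℤ.+ suc b) ≡ (b ℕ.<ᵇ l')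
  isCentral-pos b = trans (cong (λ z → ⌊ ℤ.+ suc b ℤ.≤? z ⌋) e) e2
    where
    e2 : ⌊ ℤ.+ suc b ℤ.≤? ℤ.+ l' ⌋ ≡ (b ℕ.<ᵇ l')
    e2 = trans (⌊⌋-map′ _ _ _) (trans (⌊⌋-map′ _ _ _) (isYes-T (b ℕ.<ᵇ l')))
    e : ℤ.+ suc l' ℤ.- 1ℤ ≡ ℤ.+ l'
    e = refl

  shiftCol-pos : ∀ b → l' ≤ suc b → shiftCol l (ℤ.+ suc b) ≡ ℤ.+ (suc b ∸ l')
  shiftCol-pos b p = trans (ℤP.m-n≡m⊖n (suc b) l') (ℤP.⊖-≥ p)

sub-lt : ∀ a b c → b ≤ a → a < b + c → a ∸ b < c
sub-lt a b c b≤a lt = ℕP.+-cancelˡ-< b (a ∸ b) c (subst (_< b + c) (sym (ℕP.m+[n∸m]≡n b≤a)) lt)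

≢⇒≟-false : ∀ {x y : ℤ} → x ≢ y → ⌊ x ℤ.≟ y ⌋ ≡ false
≢⇒≟-false {x} {y} ne with x ℤ.≟ y
... | yes p = ⊥-elim (ne p)
... | no _ = refl

WithinRadius : ℕ → ℤ → Set
WithinRadius N z = (∃ λ a → a < N × z ≡ ℤ.-[1+ a ]) ⊎ (∃ λ a → a < N × z ≡ ℤ.+ suc a)

WithinRadius-≟ : ∀ {N z} x → WithinRadius N z → (∀ a → a < N → x ≢ ℤ.-[1+ a ]) → (∀ a → a < N → x ≢ ℤ.+ suc a) → ⌊ z ℤ.≟ x ⌋ ≡ false
WithinRadius-≟ x (inj₁ (a , p , refl)) h1 h2 = ≢⇒≟-false (λ e → h1 a p (sym e))
WithinRadius-≟ x (inj₂ (a , p , refl)) h1 h2 = ≢⇒≟-false (λ e → h2 a p (sym e))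

private
  l+2N-split₁ : ∀ l' N → suc (l' + 2 * N) ≡ suc (l' + N) + N
  l+2N-split₁ = solveℕ
  l+2N-split₂ : ∀ l' N → suc (suc (l' + 2 * N)) ≡ suc (suc (l' + N)) + N
  l+2N-split₂ = solveℕ
  l+2N-split₀ : ∀ l' N → l' + 2 * N ≡ (N + l') + N
  l+2N-split₀ = solveℕ

module Layout (l' N : ℕ) where
  open ColumnShift l' public
  m = l' + 2 * N
  k = suc (suc m)

  label₁ : ℕ → ℤ
  label₁ = label (suc N)
  label₂ : ℕ → ℤ
  label₂ = label (suc (suc N))

  label₁-first : label₁ 0 ≡ ℤ.- ℤ.+ N
  label₁-first = trans (label-⊖ N 0) (ℤP.⊖-≤ z≤n)

  label₂-first : label₂ 0 ≡ ℤ.- ℤ.+ suc N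
  label₂-first = trans (label-⊖ (suc N) 0) (ℤP.⊖-≤ z≤n)

  label₁-last : label₁ (suc m) ≡ ℤ.+ suc (l' + N)
  label₁-last = trans (label-⊖ N (suc m)) (trans (ℤP.⊖-≥ (subst (N ≤_) (sym (l+2N-split₁ l' N)) (ℕP.m≤n+m N _)))
            (cong ℤ.+_ (trans (cong (_∸ N) (l+2N-split₁ l' N)) (ℕP.m+n∸n≡m (suc (l' + N)) N))))

  label₁-outer : label₁ k ≡ ℤ.+ suc (suc (l' + N))
  label₁-outer = trans (label-⊖ N k) (trans (ℤP.⊖-≥ (subst (N ≤_) (sym (l+2N-split₂ l' N)) (ℕP.m≤n+m N _)))
            (cong ℤ.+_ (trans (cong (_∸ N) (l+2N-split₂ l' N)) (ℕP.m+n∸n≡m (suc (suc (l' + N))) N))))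

  ¬central₁-first : isCentral l (label₁ 0) ≡ false
  ¬central₁-first = trans (cong (isCentral l) label₁-first) (isCentral-neg N)
  ¬central₂-first : isCentral l (label₂ 0) ≡ false
  ¬central₂-first = trans (cong (isCentral l) label₂-first) (isCentral-neg (suc N))
  ¬central₁-last : isCentral l (label₁ (suc m)) ≡ false
  ¬central₁-last = trans (cong (isCentral l) label₁-last) (trans (isCentral-pos (l' + N)) (<ᵇ-false (ℕP.m≤m+n l' N)))
  ¬central₁-outer : isCentral l (label₁ k) ≡ false
  ¬central₁-outer = trans (cong (isCentral l) label₁-outer) (trans (isCentral-pos (suc (l' + N))) (<ᵇ-false (ℕP.≤-trans (ℕP.m≤m+n l' N) (ℕP.n≤1+n _))))

  shift₁-first : shiftCol l (label₁ 0) ≡ ℤ.-[1+ N ]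
  shift₁-first = trans (cong (shiftCol l) label₁-first) (shiftCol-neg N)
  shift₂-first : shiftCol l (label₂ 0) ≡ ℤ.-[1+ suc N ]
  shift₂-first = trans (cong (shiftCol l) label₂-first) (shiftCol-neg (suc N))
  shift₁-last : shiftCol l (label₁ (suc m)) ≡ ℤ.+ suc N
  shift₁-last = trans (cong (shiftCol l) label₁-last) (trans (shiftCol-pos (l' + N) (ℕP.≤-trans (ℕP.m≤m+n l' N) (ℕP.n≤1+n _)))
            (cong ℤ.+_ (trans (cong (_∸ l') (sym (ℕP.+-suc l' N))) (ℕP.m+n∸m≡n l' (suc N)))))
  shift₁-outer : shiftCol l (label₁ k) ≡ ℤ.+ suc (suc N)
  shift₁-outer = trans (cong (shiftCol l) label₁-outer) (trans (shiftCol-pos (suc (l' + N)) (ℕP.≤-trans (ℕP.m≤m+n l' N) (ℕP.≤-trans (ℕP.n≤1+n _) (ℕP.n≤1+n _))))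
            (cong ℤ.+_ (trans (cong (_∸ l') (trans (cong suc (sym (ℕP.+-suc l' N))) (sym (ℕP.+-suc l' (suc N))))) (ℕP.m+n∸m≡n l' (suc (suc N))))))

  inner-WithinRadius : ∀ i → i < m → isCentral l (label₁ (suc i)) ≡ false → WithinRadius N (shiftCol l (label₁ (suc i)))
  inner-WithinRadius i i<m nc with suc i ℕ.≤? N
  ... | yes p = inj₁ (N ∸ suc i , ℕP.∸-monoʳ-< {N} {suc i} {0} (s≤s z≤n) p ,
                      trans (cong (shiftCol l) (trans (label-⊖ N (suc i)) (ℤP.⊖-≤ p))) (shiftCol-neg (N ∸ suc i)))
  ... | no ¬p = inj₂ ((i ∸ N) ∸ l' , a<N , trans (cong (shiftCol l) lb) (trans (shiftCol-pos (i ∸ N) (ℕP.≤-trans l'≤ (ℕP.n≤1+n _)))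
                       (cong ℤ.+_ (ℕP.+-∸-assoc 1 l'≤))))
    where
    N≤i : N ≤ i
    N≤i = ℕP.≤-pred (ℕP.≰⇒> ¬p)
    lb : label₁ (suc i) ≡ ℤ.+ suc (i ∸ N)
    lb = trans (label-⊖ N (suc i)) (trans (ℤP.⊖-≥ (ℕP.≤-trans N≤i (ℕP.n≤1+n i))) (cong ℤ.+_ (ℕP.+-∸-assoc 1 N≤i)))
    l'≤ : l' ≤ i ∸ N
    l'≤ = ℕP.≮⇒≥ (λ h → contra (trans (sym (trans (cong (isCentral l) lb) (isCentral-pos (i ∸ N)))) nc) (<ᵇ-true h))
      where
      contra : ∀ {b : Bool} → b ≡ false → b ≡ true → ⊥
      contra refl ()
    a<N : (i ∸ N) ∸ l' < N
    a<N = subst (_< N) (sym (ℕP.∸-+-assoc i N l'))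
            (sub-lt i (N + l') N (subst (_≤ i) (ℕP.+-comm l' N) (subst (l' + N ≤_) (ℕP.m+[n∸m]≡n N≤i)
                 (subst (_≤ N + (i ∸ N)) (ℕP.+-comm N l') (ℕP.+-monoʳ-≤ N l'≤))))
               (subst (i <_) (l+2N-split₀ l' N) i<m))

motzkinStep : ℕ → (ℤ → Bool) → ℤ
motzkinStep i μ = (indicator (μ (ℤ.- (ℤ.+ i))) ℤ.+ indicator (μ (ℤ.+ i))) ℤ.- 1ℤ

motzkinOf : ℕ → (ℤ → Bool) → List ℤ
motzkinOf n μ = map (λ i → motzkinStep i μ) (map suc (upTo n))

motzkinOf-snoc : ∀ n μ → motzkinOf (suc n) μ ≡ motzkinOf n μ ∷ʳ motzkinStep (suc n) μ
motzkinOf-snoc n μ = trans (cong (λ z → map (λ i → motzkinStep i μ) (map suc z)) (sym (LP.upTo-∷ʳ n)))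
                 (trans (cong (map (λ i → motzkinStep i μ)) (LP.map-++ suc (upTo n) (n ∷ []))) (LP.map-++ (λ i → motzkinStep i μ) (map suc (upTo n)) (suc n ∷ [])))

motzkinOf-cong : ∀ n μ μ' → (∀ i → 1 ≤ i → i ≤ n → (μ (ℤ.- ℤ.+ i) ≡ μ' (ℤ.- ℤ.+ i)) × (μ (ℤ.+ i) ≡ μ' (ℤ.+ i))) → motzkinOf n μ ≡ motzkinOf n μ'
motzkinOf-cong zero μ μ' h = refl
motzkinOf-cong (suc n) μ μ' h = trans (motzkinOf-snoc n μ) (trans (cong₂ _∷ʳ_ (motzkinOf-cong n μ μ' (λ i p q → h i p (ℕP.m≤n⇒m≤1+n q)))
   (cong₂ (λ a b → (indicator a ℤ.+ indicator b) ℤ.- 1ℤ) (proj₁ (h (suc n) (s≤s z≤n) ℕP.≤-refl)) (proj₂ (h (suc n) (s≤s z≤n) ℕP.≤-refl))))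
   (sym (motzkinOf-snoc n μ')))

infix 7 _≡ᴸ_

_≡ᴸ_ : List ℤ → List ℤ → Bool
xs ≡ᴸ ys = does (LP.≡-dec ℤ._≟_ xs ys)

≡ᴸ-snoc : ∀ xs ys a b → (xs ∷ʳ a) ≡ᴸ (ys ∷ʳ b) ≡ xs ≡ᴸ ys ∧ ⌊ a ℤ.≟ b ⌋
≡ᴸ-snoc xs ys a b with LP.≡-dec ℤ._≟_ (xs ∷ʳ a) (ys ∷ʳ b) | LP.≡-dec ℤ._≟_ xs ys | a ℤ.≟ b
... | yes p | yes _ | yes _ = refl
... | yes p | no q | _ = ⊥-elim (q (proj₁ (LP.∷ʳ-injective xs ys p)))
... | yes p | yes _ | no q = ⊥-elim (q (proj₂ (LP.∷ʳ-injective xs ys p)))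
... | no p | yes refl | yes refl = ⊥-elim (p refl)
... | no p | yes _ | no _ = refl
... | no p | no _ | _ = refl

motzkinStep≟-1 : ∀ a b → ⌊ (indicator a ℤ.+ indicator b) ℤ.- 1ℤ ℤ.≟ -1ℤ ⌋ ≡ not a ∧ not b
motzkinStep≟-1 true true = refl
motzkinStep≟-1 true false = refl
motzkinStep≟-1 false true = refl
motzkinStep≟-1 false false = refl

motzkinStep≟0 : ∀ a b → ⌊ (indicator a ℤ.+ indicator b) ℤ.- 1ℤ ℤ.≟ 0ℤ ⌋ ≡ (a xor b)
motzkinStep≟0 true true = refl
motzkinStep≟0 true false = refl
motzkinStep≟0 false true = refl
motzkinStep≟0 false false = refl

memb-S-of : ∀ n l A x → memb x (S-of n l A) ≡ ⌊ 0ℤ ℤ.≟ x ⌋ ∨ anyBelow (l ℕ.+ 2 ℕ.* n ∸ 1) (λ j → isPositive (sumℤ (column A j)) ∧ ⌊ shiftCol l (label n j) ℤ.≟ x ⌋)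
memb-S-of n l A x = cong (⌊ 0ℤ ℤ.≟ x ⌋ ∨_)
  (trans (any-map (λ s → ⌊ s ℤ.≟ x ⌋) _ (filter _ (colIndices n l)))
  (trans (any-filter _ _ (colIndices n l))
  (trans (any-map _ (λ j → j , label n j) (upTo (l ℕ.+ 2 ℕ.* n ∸ 1)))
  (trans (any-applyUpTo _ id (l ℕ.+ 2 ℕ.* n ∸ 1))
    (anyBelow-cong (l ℕ.+ 2 ℕ.* n ∸ 1) (λ j _ → cong (_∧ ⌊ shiftCol l (label n j) ℤ.≟ x ⌋) (sym (isYes≗does (0ℤ ℤ.<? sumℤ (column A j))))))))))

columnCondition : ℕ → ℕ → List (List ℤ) → ℕ → Bool
columnCondition n l A j = (if isCentral l (label n j) then ⌊ sumℤ (column A j) ℤ.≟ 0ℤ ⌋ else true) ∧ columnOK (column A j)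

isASTrapezoid-unfold : ∀ n l A → isASTrapezoid n l A ≡ all rowOK A ∧ allBelow (l ℕ.+ 2 ℕ.* n ∸ 1) (columnCondition n l A)
isASTrapezoid-unfold n l A = cong (all rowOK A ∧_) (trans (all-map _ (λ j → j , label n j) (upTo (l ℕ.+ 2 ℕ.* n ∸ 1))) (all-applyUpTo _ id (l ℕ.+ 2 ℕ.* n ∸ 1)))

anyBelow-false : ∀ n g → (∀ j → j < n → g j ≡ false) → anyBelow n g ≡ false
anyBelow-false zero g h = refl
anyBelow-false (suc n) g h rewrite h 0 (s≤s z≤n) = anyBelow-false n _ (λ j p → h (suc j) (s≤s p))

columnOK-−1∷ : ∀ col → columnOK (-1ℤ ∷ col) ≡ false
columnOK-−1∷ col = BP.∧-zeroʳ _

private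
  l+2[1+N] : ∀ l' N → l' + 2 * suc N ≡ suc (suc (l' + 2 * N))
  l+2[1+N] = solveℕ
  l+2[2+N] : ∀ l' N → l' + 2 * suc (suc N) ≡ suc (suc (suc (suc (l' + 2 * N))))
  l+2[2+N] = solveℕ

-- Arrays over a fixed base

ZeroBeyond : ℕ → ℕ → List (List ℤ) → Set
ZeroBeyond l' N C = ∀ j → l' + 2 * N ≤ j → AllZero (colOf (grid C) j)

module OverBase (l' N : ℕ) (P : List ℤ) (C : List (List ℤ)) (zeroBeyond : ZeroBeyond l' N C) where
  open Layout l' N public

  baseSum : ℕ → ℤ
  baseSum j = sumℤ (baseColumn C j)

  stackOK : ℤ → ℤ → List ℤ → Bool
  stackOK c x col = (if isCentral l c then ⌊ x ℤ.+ sumℤ col ℤ.≟ 0ℤ ⌋ else true) ∧ columnOK (x ∷ col)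

  innerColumnsOK : (ℕ → ℤ) → Bool
  innerColumnsOK σ = allBelow m (λ i → stackOK (label₁ (suc i)) (σ (suc i)) (baseColumn C (suc i)))

  innerHits : (ℕ → ℤ) → ℤ → Bool
  innerHits σ x = anyBelow m (λ i → isPositive (σ (suc i) ℤ.+ baseSum (suc i)) ∧ ⌊ shiftCol l (label₁ (suc i)) ℤ.≟ x ⌋)

  fitsBase : (ℕ → ℤ) → Bool
  fitsBase σ = innerColumnsOK σ ∧ motzkinOf N (innerHits σ) ≡ᴸ P

  fitsBase-cong : ∀ σ σ' → (∀ i → i < m → σ (suc i) ≡ σ' (suc i)) → fitsBase σ ≡ fitsBase σ'
  fitsBase-cong σ σ' h = cong₂ _∧_ (allBelow-cong m (λ i p → cong (λ z → stackOK (label₁ (suc i)) z (baseColumn C (suc i))) (h i p)))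
    (cong (λ z → z ≡ᴸ P) (motzkinOf-cong N (innerHits σ) (innerHits σ') (λ i _ _ → hc _ , hc _)))
    where
    hc : ∀ x → innerHits σ x ≡ innerHits σ' x
    hc x = anyBelow-cong m (λ j p → cong (λ z → isPositive (z ℤ.+ baseSum (suc j)) ∧ ⌊ shiftCol l (label₁ (suc j)) ℤ.≟ x ⌋) (h j p))

  fitsBase-no-1 : ∀ σ → fitsBase σ ≡ true → ∀ i → i < m → σ (suc i) ≢ -1ℤ
  fitsBase-no-1 σ e i p eq = f (trans (sym (proj₂ (∧-elim (if isCentral l (label₁ (suc i)) then ⌊ σ (suc i) ℤ.+ baseSum (suc i) ℤ.≟ 0ℤ ⌋ else true) _ d))) (subst (λ z → columnOK (z ∷ baseColumn C (suc i)) ≡ false) (sym eq) (columnOK-−1∷ (baseColumn C (suc i)))))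
    where
    d = allBelow-elim m _ (proj₁ (∧-elim (innerColumnsOK σ) _ e)) i p
    f : true ≡ false → ⊥
    f ()

  innerHits-far : ∀ σ → innerColumnsOK σ ≡ true → ∀ x → (∀ a → a < N → x ≢ ℤ.-[1+ a ]) → (∀ a → a < N → x ≢ ℤ.+ suc a) → innerHits σ x ≡ false
  innerHits-far σ dI x h1 h2 = anyBelow-false m _ pw
    where
    pw : ∀ i → i < m → (isPositive (σ (suc i) ℤ.+ baseSum (suc i)) ∧ ⌊ shiftCol l (label₁ (suc i)) ℤ.≟ x ⌋) ≡ false
    pw i p with isCentral l (label₁ (suc i)) in ec
    ... | false = trans (cong (isPositive (σ (suc i) ℤ.+ baseSum (suc i)) ∧_) (WithinRadius-≟ x (inner-WithinRadius i p ec) h1 h2)) (BP.∧-zeroʳ _)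
    ... | true = ∧-falseˡ _ (cong isPositive z)
      where
      d = allBelow-elim m _ dI i p
      d' : ⌊ σ (suc i) ℤ.+ baseSum (suc i) ℤ.≟ 0ℤ ⌋ ≡ true
      d' = proj₁ (∧-elim _ (columnOK (σ (suc i) ∷ baseColumn C (suc i))) (subst (λ b → ((if b then ⌊ σ (suc i) ℤ.+ baseSum (suc i) ℤ.≟ 0ℤ ⌋ else true) ∧ columnOK (σ (suc i) ∷ baseColumn C (suc i))) ≡ true) ec d))
      z : σ (suc i) ℤ.+ baseSum (suc i) ≡ 0ℤ
      z = ≟-true⇒≡ d'

  base-first-zero : AllZero (baseColumn C 0)
  base-first-zero = pad0 0 (reverse C)
  base-last-zero : AllZero (baseColumn C (suc m))
  base-last-zero = subst AllZero (sym (padShift 0 (reverse C) m)) (zeroBeyond m ℕP.≤-refl)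
  base-outer-zero : AllZero (baseColumn C k)
  base-outer-zero = subst AllZero (sym (padShift 0 (reverse C) (suc m))) (zeroBeyond (suc m) (ℕP.n≤1+n m))

  width₁≡k : l ℕ.+ 2 ℕ.* suc N ∸ 1 ≡ k
  width₁≡k = l+2[1+N] l' N
  width₂≡2+k : l ℕ.+ 2 ℕ.* suc (suc N) ∸ 1 ≡ suc (suc k)
  width₂≡2+k = l+2[2+N] l' N

  oneRow : List ℤ → List (List ℤ)
  oneRow r = C ++ r ∷ []

  stackOK-outer : ∀ c x col → isCentral l c ≡ false → AllZero col → isEntry x ≡ true → stackOK c x col ≡ soloOK x
  stackOK-outer c x col nc z v rewrite nc | v = trans (columnOK-AllZero x z) (sym (BP.∧-identityʳ _))

  columnCondition-oneRow : ∀ r j → columnCondition (suc N) l (oneRow r) j ≡ stackOK (label₁ j) (at r j) (baseColumn C j)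
  columnCondition-oneRow r j = cong (λ col → (if isCentral l (label₁ j) then ⌊ sumℤ col ℤ.≟ 0ℤ ⌋ else true) ∧ columnOK col) (column-snoc C r j)

  columns-oneRow : ∀ r → All (λ x → isEntry x ≡ true) r → allBelow (l ℕ.+ 2 ℕ.* suc N ∸ 1) (columnCondition (suc N) l (oneRow r)) ≡ soloOK (at r 0) ∧ (innerColumnsOK (at r) ∧ soloOK (at r (suc m)))
  columns-oneRow r av = trans (cong (λ w → allBelow w (columnCondition (suc N) l (oneRow r))) width₁≡k)
    (cong₂ _∧_ (trans (columnCondition-oneRow r 0) (stackOK-outer (label₁ 0) (at r 0) (baseColumn C 0) ¬central₁-first base-first-zero (at-isEntry r 0 av)))
      (trans (allBelow-last m (λ i → columnCondition (suc N) l (oneRow r) (suc i)))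
        (cong₂ _∧_ (allBelow-cong m (λ i _ → columnCondition-oneRow r (suc i))) (trans (columnCondition-oneRow r (suc m)) (stackOK-outer (label₁ (suc m)) (at r (suc m)) (baseColumn C (suc m)) ¬central₁-last base-last-zero (at-isEntry r (suc m) av))))))

  memb-oneRow : ∀ r x → memb x (S-of (suc N) l (oneRow r)) ≡ ⌊ 0ℤ ℤ.≟ x ⌋ ∨ ((isPositive (at r 0 ℤ.+ baseSum 0) ∧ ⌊ shiftCol l (label₁ 0) ℤ.≟ x ⌋) ∨ (innerHits (at r) x ∨ (isPositive (at r (suc m) ℤ.+ baseSum (suc m)) ∧ ⌊ shiftCol l (label₁ (suc m)) ℤ.≟ x ⌋)))
  memb-oneRow r x = trans (memb-S-of (suc N) l (oneRow r) x) (cong (⌊ 0ℤ ℤ.≟ x ⌋ ∨_)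
    (trans (cong (λ w → anyBelow w h) width₁≡k)
      (cong₂ _∨_ (hc 0) (trans (anyBelow-last m (λ i → h (suc i))) (cong₂ _∨_ (anyBelow-cong m (λ i _ → hc (suc i))) (hc (suc m)))))))
    where
    h : ℕ → Bool
    h j = isPositive (sumℤ (column (oneRow r) j)) ∧ ⌊ shiftCol l (label (suc N) j) ℤ.≟ x ⌋
    hc : ∀ j → h j ≡ (isPositive (at r j ℤ.+ baseSum j) ∧ ⌊ shiftCol l (label₁ j) ℤ.≟ x ⌋)
    hc j = cong (λ col → isPositive (sumℤ col) ∧ ⌊ shiftCol l (label₁ j) ℤ.≟ x ⌋) (column-snoc C r j)

  ≟-refl : ∀ x → ⌊ x ℤ.≟ x ⌋ ≡ true
  ≟-refl x with x ℤ.≟ x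
  ... | yes _ = refl
  ... | no ¬p = ⊥-elim (¬p refl)

  pick-inner₃ : ∀ a h b → false ∨ ((a ∧ false) ∨ (h ∨ (b ∧ false))) ≡ h
  pick-inner₃ a h b rewrite BP.∧-zeroʳ a | BP.∧-zeroʳ b = BP.∨-identityʳ h

  memb-oneRow-inner : ∀ r i → 1 ≤ i → i ≤ N → (memb (ℤ.- ℤ.+ i) (S-of (suc N) l (oneRow r)) ≡ innerHits (at r) (ℤ.- ℤ.+ i)) × (memb (ℤ.+ i) (S-of (suc N) l (oneRow r)) ≡ innerHits (at r) (ℤ.+ i))
  memb-oneRow-inner r (suc i) (s≤s _) i≤N = trans (memb-oneRow r ℤ.-[1+ i ]) (trans (cong₂ (λ a b → false ∨ ((isPositive (at r 0 ℤ.+ baseSum 0) ∧ a) ∨ (innerHits (at r) ℤ.-[1+ i ] ∨ (isPositive (at r (suc m) ℤ.+ baseSum (suc m)) ∧ b))))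
                                         (trans (cong (λ z → ⌊ z ℤ.≟ ℤ.-[1+ i ] ⌋) shift₁-first) (≢⇒≟-false (λ e → ℕP.<-irrefl (sym (ℤP.-[1+-injective e)) i≤N)))
                                         (cong (λ z → ⌊ z ℤ.≟ ℤ.-[1+ i ] ⌋) shift₁-last))
                                (pick-inner₃ (isPositive (at r 0 ℤ.+ baseSum 0)) _ (isPositive (at r (suc m) ℤ.+ baseSum (suc m)))))
                            , trans (memb-oneRow r (ℤ.+ suc i)) (trans (cong₂ (λ a b → false ∨ ((isPositive (at r 0 ℤ.+ baseSum 0) ∧ a) ∨ (innerHits (at r) (ℤ.+ suc i) ∨ (isPositive (at r (suc m) ℤ.+ baseSum (suc m)) ∧ b))))
                                         (cong (λ z → ⌊ z ℤ.≟ ℤ.+ suc i ⌋) shift₁-first)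
                                         (trans (cong (λ z → ⌊ z ℤ.≟ ℤ.+ suc i ⌋) shift₁-last) (≢⇒≟-false (λ e → ℕP.<-irrefl (sym (ℕP.suc-injective (ℤP.+-injective e))) i≤N))))
                                (pick-inner₃ (isPositive (at r 0 ℤ.+ baseSum 0)) _ (isPositive (at r (suc m) ℤ.+ baseSum (suc m)))))

  baseSum-first : baseSum 0 ≡ 0ℤ
  baseSum-first = sum-AllZero base-first-zero
  baseSum-last : baseSum (suc m) ≡ 0ℤ
  baseSum-last = sum-AllZero base-last-zero

  -[1+N]-far : ∀ a → a < N → ℤ.-[1+ N ] ≢ ℤ.-[1+ a ]
  -[1+N]-far a p e = ℕP.<-irrefl (sym (ℤP.-[1+-injective e)) p
  +[1+N]-far : ∀ a → a < N → ℤ.+ suc N ≢ ℤ.+ suc a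
  +[1+N]-far a p e = ℕP.<-irrefl (sym (ℕP.suc-injective (ℤP.+-injective e))) p

  pick-left₃ : ∀ a b → false ∨ ((a ∧ true) ∨ (false ∨ (b ∧ false))) ≡ a
  pick-left₃ a b rewrite BP.∧-identityʳ a | BP.∧-zeroʳ b = BP.∨-identityʳ a
  pick-right₃ : ∀ a b → false ∨ ((a ∧ false) ∨ (false ∨ (b ∧ true))) ≡ b
  pick-right₃ a b rewrite BP.∧-identityʳ b | BP.∧-zeroʳ a = refl

  memb-oneRow-left : ∀ r → innerColumnsOK (at r) ≡ true → memb ℤ.-[1+ N ] (S-of (suc N) l (oneRow r)) ≡ isPositive (at r 0)
  memb-oneRow-left r dI = trans (memb-oneRow r ℤ.-[1+ N ])
    (trans (cong₃ (λ a b c → false ∨ ((isPositive (at r 0 ℤ.+ baseSum 0) ∧ a) ∨ (b ∨ (isPositive (at r (suc m) ℤ.+ baseSum (suc m)) ∧ c))))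
              (trans (cong (λ z → ⌊ z ℤ.≟ ℤ.-[1+ N ] ⌋) shift₁-first) (≟-refl _))
              (innerHits-far (at r) dI ℤ.-[1+ N ] -[1+N]-far (λ a p ()))
              (cong (λ z → ⌊ z ℤ.≟ ℤ.-[1+ N ] ⌋) shift₁-last))
    (trans (pick-left₃ _ _) (cong isPositive (trans (cong (λ y → at r 0 ℤ.+ y) baseSum-first) (ℤP.+-identityʳ _)))))

  memb-oneRow-right : ∀ r → innerColumnsOK (at r) ≡ true → memb (ℤ.+ suc N) (S-of (suc N) l (oneRow r)) ≡ isPositive (at r (suc m))
  memb-oneRow-right r dI = trans (memb-oneRow r (ℤ.+ suc N))
    (trans (cong₃ (λ a b c → false ∨ ((isPositive (at r 0 ℤ.+ baseSum 0) ∧ a) ∨ (b ∨ (isPositive (at r (suc m) ℤ.+ baseSum (suc m)) ∧ c))))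
              (cong (λ z → ⌊ z ℤ.≟ ℤ.+ suc N ⌋) shift₁-first)
              (innerHits-far (at r) dI (ℤ.+ suc N) (λ a p ()) +[1+N]-far)
              (trans (cong (λ z → ⌊ z ℤ.≟ ℤ.+ suc N ⌋) shift₁-last) (≟-refl _)))
    (trans (pick-right₃ _ _) (cong isPositive (trans (cong (λ y → at r (suc m) ℤ.+ y) baseSum-last) (ℤP.+-identityʳ _)))))

  reassoc-oneRow : ∀ rc ro d0 dL mp n0 nL → ((rc ∧ (ro ∧ true)) ∧ (d0 ∧ (true ∧ dL))) ∧ (mp ∧ (n0 ∧ nL)) ≡ rc ∧ ((ro ∧ (d0 ∧ (dL ∧ (n0 ∧ nL)))) ∧ (true ∧ mp))
  reassoc-oneRow = solve 7 (λ rc ro d0 dL mp n0 nL →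
    ((rc ⊕ (ro ⊕ ∧-Solver.id)) ⊕ (d0 ⊕ (∧-Solver.id ⊕ dL))) ⊕ (mp ⊕ (n0 ⊕ nL))
    ⊜ rc ⊕ ((ro ⊕ (d0 ⊕ (dL ⊕ (n0 ⊕ nL)))) ⊕ (∧-Solver.id ⊕ mp))) refl

  oneRow-falseˡ : ∀ a c d x → (a ∧ (c ∧ (false ∧ d))) ∧ x ≡ false
  oneRow-falseˡ false c d x = refl
  oneRow-falseˡ true false d x = refl
  oneRow-falseˡ true true d x = refl

  oneRow-falseʳ : ∀ y z w → y ∧ (z ∧ (false ∧ w)) ≡ false
  oneRow-falseʳ false z w = refl
  oneRow-falseʳ true false w = refl
  oneRow-falseʳ true true w = refl

  reduce-oneRow : ∀ r → IsWord k r → isASTrapezoid (suc N) l (oneRow r) ∧ M-of (suc N) l (oneRow r) ≡ᴸ (P ∷ʳ -1ℤ) ≡ all rowOK C ∧ (topRowOK m r ∧ fitsBase (at r))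
  reduce-oneRow r (len , av) = trans (cong₂ _∧_ e1 e2) (fin (innerColumnsOK (at r)) refl)
    where
    μB : ℤ → Bool
    μB x = memb x (S-of (suc N) l (oneRow r))
    e1 : isASTrapezoid (suc N) l (oneRow r) ≡ (all rowOK C ∧ (rowOK r ∧ true)) ∧ (soloOK (at r 0) ∧ (innerColumnsOK (at r) ∧ soloOK (at r (suc m))))
    e1 = trans (isASTrapezoid-unfold (suc N) l (oneRow r)) (cong₂ _∧_ (all-++ rowOK C (r ∷ [])) (columns-oneRow r av))
    e2 : M-of (suc N) l (oneRow r) ≡ᴸ (P ∷ʳ -1ℤ) ≡ motzkinOf N μB ≡ᴸ P ∧ ⌊ motzkinStep (suc N) μB ℤ.≟ -1ℤ ⌋
    e2 = trans (cong (λ z → z ≡ᴸ (P ∷ʳ -1ℤ)) (motzkinOf-snoc N μB)) (≡ᴸ-snoc (motzkinOf N μB) P _ -1ℤ)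
    fin : ∀ d → innerColumnsOK (at r) ≡ d → ((all rowOK C ∧ (rowOK r ∧ true)) ∧ (soloOK (at r 0) ∧ (d ∧ soloOK (at r (suc m))))) ∧ (motzkinOf N μB ≡ᴸ P ∧ ⌊ motzkinStep (suc N) μB ℤ.≟ -1ℤ ⌋)
                    ≡ all rowOK C ∧ (topRowOK m r ∧ (d ∧ motzkinOf N (innerHits (at r)) ≡ᴸ P))
    fin false _ = trans (oneRow-falseˡ (all rowOK C ∧ (rowOK r ∧ true)) (soloOK (at r 0)) (soloOK (at r (suc m))) (motzkinOf N μB ≡ᴸ P ∧ ⌊ motzkinStep (suc N) μB ℤ.≟ -1ℤ ⌋)) (sym (oneRow-falseʳ (all rowOK C) (topRowOK m r) (motzkinOf N (innerHits (at r)) ≡ᴸ P)))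
    fin true dI = trans (cong₂ (λ a b → ((all rowOK C ∧ (rowOK r ∧ true)) ∧ (soloOK (at r 0) ∧ (true ∧ soloOK (at r (suc m))))) ∧ (a ≡ᴸ P ∧ b))
                           (motzkinOf-cong N μB (innerHits (at r)) (memb-oneRow-inner r))
                           (trans (cong₂ (λ a b → ⌊ (indicator a ℤ.+ indicator b) ℤ.- 1ℤ ℤ.≟ -1ℤ ⌋) (memb-oneRow-left r dI) (memb-oneRow-right r dI)) (motzkinStep≟-1 (isPositive (at r 0)) (isPositive (at r (suc m))))))
                     (reassoc-oneRow (all rowOK C) (rowOK r) (soloOK (at r 0)) (soloOK (at r (suc m))) (motzkinOf N (innerHits (at r)) ≡ᴸ P) (not (isPositive (at r 0))) (not (isPositive (at r (suc m)))))

  twoRows : List ℤ → List ℤ → List (List ℤ)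
  twoRows r2 r1 = (C ++ r2 ∷ []) ++ r1 ∷ []

  stackOK-outer′ : ∀ c x col → isCentral l c ≡ false → AllZero col → stackOK c x col ≡ columnOK (x ∷ [])
  stackOK-outer′ c x col nc z rewrite nc = columnOK-AllZero x z

  padTop²-first-zero : AllZero (colOf (padTop 2 (reverse C)) 0)
  padTop²-first-zero = pad0 1 (reverse C)

  columnCondition-twoRows-first : ∀ r2 r1 → isEntry (at r1 0) ≡ true → columnCondition (suc (suc N)) l (twoRows r2 r1) 0 ≡ soloOK (at r1 0)
  columnCondition-twoRows-first r2 r1 v = trans (cong (λ col → (if isCentral l (label₂ 0) then ⌊ sumℤ col ℤ.≟ 0ℤ ⌋ else true) ∧ columnOK col) (column-snoc²-0 C r2 r1))
                  (stackOK-outer (label₂ 0) (at r1 0) (0ℤ ∷ _) ¬central₂-first (refl ∷ padTop²-first-zero) v)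

  columnCondition-twoRows-last : ∀ r2 r1 → length r2 ≡ k → isEntry (at r1 (suc k)) ≡ true → columnCondition (suc (suc N)) l (twoRows r2 r1) (suc k) ≡ soloOK (at r1 (suc k))
  columnCondition-twoRows-last r2 r1 len v = trans (cong₂ (λ c col → (if isCentral l c then ⌊ sumℤ col ℤ.≟ 0ℤ ⌋ else true) ∧ columnOK col) (label-suc N k)
                               (trans (column-snoc² C r2 r1 k) (cong (λ z → at r1 (suc k) ∷ z ∷ baseColumn C k) (at-beyond r2 k (ℕP.≤-reflexive len)))))
                      (stackOK-outer (label₁ k) (at r1 (suc k)) (0ℤ ∷ baseColumn C k) ¬central₁-outer (refl ∷ base-outer-zero) v)

  columnCondition-twoRows-inner : ∀ r2 r1 j → isEntry (at r1 (suc j)) ≡ true → isEntry (at r2 j) ≡ true →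
         columnCondition (suc (suc N)) l (twoRows r2 r1) (suc j) ≡ pairOK (at r1 (suc j)) (at r2 j) ∧ stackOK (label₁ j) (foldTop r1 r2 j) (baseColumn C j)
  columnCondition-twoRows-inner r2 r1 j va vb = trans (cong₂ (λ c col → (if isCentral l c then ⌊ sumℤ col ℤ.≟ 0ℤ ⌋ else true) ∧ columnOK col) (label-suc N j) (column-snoc² C r2 r1 j))
     (trans (cong₂ (λ s g → (if isCentral l (label₁ j) then ⌊ s ℤ.≟ 0ℤ ⌋ else true) ∧ g)
                   (sym (ℤP.+-assoc (at r1 (suc j)) (at r2 j) (baseSum j)))
                   (columnOK-merge (at r1 (suc j)) (at r2 j) (baseColumn C j) va vb))
     (trans (∧-left-swap (if isCentral l (label₁ j) then ⌊ foldTop r1 r2 j ℤ.+ baseSum j ℤ.≟ 0ℤ ⌋ else true) (columnOK (at r1 (suc j) ∷ at r2 j ∷ [])) (columnOK (foldTop r1 r2 j ∷ baseColumn C j)))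
       (cong (_∧ stackOK (label₁ j) (foldTop r1 r2 j) (baseColumn C j)) (sym (trans (cong (columnOK (at r1 (suc j) ∷ at r2 j ∷ []) ∧_) (cong₂ _∧_ va vb)) (BP.∧-identityʳ _))))))

  columns-twoRows : ∀ r2 r1 → IsWord k r2 → IsWord (suc (suc k)) r1 → allBelow (l ℕ.+ 2 ℕ.* suc (suc N) ∸ 1) (columnCondition (suc (suc N)) l (twoRows r2 r1))
          ≡ soloOK (at r1 0) ∧ ((allBelow k (λ j → pairOK (at r1 (suc j)) (at r2 j)) ∧
             (stackOK (label₁ 0) (foldTop r1 r2 0) (baseColumn C 0) ∧ (innerColumnsOK (foldTop r1 r2) ∧ stackOK (label₁ (suc m)) (foldTop r1 r2 (suc m)) (baseColumn C (suc m))))) ∧ soloOK (at r1 (suc k)))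
  columns-twoRows r2 r1 (len2 , av2) (len1 , av1) = trans (cong (λ w → allBelow w (columnCondition (suc (suc N)) l (twoRows r2 r1))) width₂≡2+k)
    (cong₂ _∧_ (columnCondition-twoRows-first r2 r1 (at-isEntry r1 0 av1))
      (trans (allBelow-last k (λ i → columnCondition (suc (suc N)) l (twoRows r2 r1) (suc i)))
        (cong₂ _∧_ (trans (allBelow-cong k (λ j _ → columnCondition-twoRows-inner r2 r1 j (at-isEntry r1 (suc j) av1) (at-isEntry r2 j av2)))
                     (trans (allBelow-∧ k (λ j → pairOK (at r1 (suc j)) (at r2 j)) (λ j → stackOK (label₁ j) (foldTop r1 r2 j) (baseColumn C j))) (cong (allBelow k (λ j → pairOK (at r1 (suc j)) (at r2 j)) ∧_)
                        (cong (stackOK (label₁ 0) (foldTop r1 r2 0) (baseColumn C 0) ∧_) (allBelow-last m (λ i → stackOK (label₁ (suc i)) (foldTop r1 r2 (suc i)) (baseColumn C (suc i))))))))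
                   (columnCondition-twoRows-last r2 r1 len2 (at-isEntry r1 (suc k) av1)))))

  memb-twoRows : ∀ r2 r1 → length r2 ≡ k → ∀ x → memb x (S-of (suc (suc N)) l (twoRows r2 r1)) ≡
     ⌊ 0ℤ ℤ.≟ x ⌋ ∨ ((isPositive (at r1 0) ∧ ⌊ shiftCol l (label₂ 0) ℤ.≟ x ⌋) ∨
        (((isPositive (foldTop r1 r2 0 ℤ.+ baseSum 0) ∧ ⌊ shiftCol l (label₁ 0) ℤ.≟ x ⌋) ∨ (innerHits (foldTop r1 r2) x ∨ (isPositive (foldTop r1 r2 (suc m) ℤ.+ baseSum (suc m)) ∧ ⌊ shiftCol l (label₁ (suc m)) ℤ.≟ x ⌋)))
         ∨ (isPositive (at r1 (suc k)) ∧ ⌊ shiftCol l (label₁ k) ℤ.≟ x ⌋)))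
  memb-twoRows r2 r1 len x = trans (memb-S-of (suc (suc N)) l (twoRows r2 r1) x) (cong (⌊ 0ℤ ℤ.≟ x ⌋ ∨_)
    (trans (cong (λ w → anyBelow w h) width₂≡2+k)
      (cong₂ _∨_ h0
        (trans (anyBelow-last k (λ i → h (suc i)))
          (cong₂ _∨_ (cong₂ _∨_ (hs 0) (trans (anyBelow-last m (λ i → h (suc (suc i)))) (cong₂ _∨_ (anyBelow-cong m (λ i _ → hs (suc i))) (hs (suc m)))))
                     hK)))))
    where
    h : ℕ → Bool
    h j = isPositive (sumℤ (column (twoRows r2 r1) j)) ∧ ⌊ shiftCol l (label (suc (suc N)) j) ℤ.≟ x ⌋
    hs : ∀ j → h (suc j) ≡ (isPositive (foldTop r1 r2 j ℤ.+ baseSum j) ∧ ⌊ shiftCol l (label₁ j) ℤ.≟ x ⌋)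
    hs j = trans (cong₂ (λ col c → isPositive (sumℤ col) ∧ ⌊ shiftCol l c ℤ.≟ x ⌋)
             (column-snoc² C r2 r1 j) (label-suc N j))
           (cong (λ s → isPositive s ∧ ⌊ shiftCol l (label₁ j) ℤ.≟ x ⌋) (sym (ℤP.+-assoc (at r1 (suc j)) (at r2 j) (baseSum j))))
    h0 : h 0 ≡ (isPositive (at r1 0) ∧ ⌊ shiftCol l (label₂ 0) ℤ.≟ x ⌋)
    h0 = trans (cong (λ col → isPositive (sumℤ col) ∧ ⌊ shiftCol l (label₂ 0) ℤ.≟ x ⌋) (column-snoc²-0 C r2 r1))
         (cong (λ s → isPositive s ∧ ⌊ shiftCol l (label₂ 0) ℤ.≟ x ⌋) (trans (cong (λ y → at r1 0 ℤ.+ y) (trans (ℤP.+-identityˡ _) (sum-AllZero padTop²-first-zero))) (ℤP.+-identityʳ _)))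
    hK : h (suc k) ≡ (isPositive (at r1 (suc k)) ∧ ⌊ shiftCol l (label₁ k) ℤ.≟ x ⌋)
    hK = trans (cong₂ (λ col c → isPositive (sumℤ col) ∧ ⌊ shiftCol l c ℤ.≟ x ⌋)
             (trans (column-snoc² C r2 r1 k) (cong (λ z → at r1 (suc k) ∷ z ∷ baseColumn C k) (at-beyond r2 k (ℕP.≤-reflexive len)))) (label-suc N k))
         (cong (λ s → isPositive s ∧ ⌊ shiftCol l (label₁ k) ℤ.≟ x ⌋) (trans (cong (λ y → at r1 (suc k) ℤ.+ y) (trans (ℤP.+-identityˡ _) (sum-AllZero base-outer-zero))) (ℤP.+-identityʳ _)))

  pick-inner₅ : ∀ a b h c d → false ∨ ((a ∧ false) ∨ (((b ∧ false) ∨ (h ∨ (c ∧ false))) ∨ (d ∧ false))) ≡ h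
  pick-inner₅ a b h c d rewrite BP.∧-zeroʳ a | BP.∧-zeroʳ b | BP.∧-zeroʳ c | BP.∧-zeroʳ d | BP.∨-identityʳ h = BP.∨-identityʳ h
  pick-left₅ : ∀ a b c d → false ∨ ((a ∧ false) ∨ (((b ∧ true) ∨ (false ∨ (c ∧ false))) ∨ (d ∧ false))) ≡ b
  pick-left₅ a b c d rewrite BP.∧-zeroʳ a | BP.∧-identityʳ b | BP.∧-zeroʳ c | BP.∧-zeroʳ d | BP.∨-identityʳ b = BP.∨-identityʳ b
  pick-right₅ : ∀ a b c d → false ∨ ((a ∧ false) ∨ (((b ∧ false) ∨ (false ∨ (c ∧ true))) ∨ (d ∧ false))) ≡ c
  pick-right₅ a b c d rewrite BP.∧-zeroʳ a | BP.∧-zeroʳ b | BP.∧-identityʳ c | BP.∧-zeroʳ d = BP.∨-identityʳ c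
  pick-leftmost₅ : ∀ a b c d → false ∨ ((a ∧ true) ∨ (((b ∧ false) ∨ (false ∨ (c ∧ false))) ∨ (d ∧ false))) ≡ a
  pick-leftmost₅ a b c d rewrite BP.∧-identityʳ a | BP.∧-zeroʳ b | BP.∧-zeroʳ c | BP.∧-zeroʳ d = BP.∨-identityʳ a
  pick-rightmost₅ : ∀ a b c d → false ∨ ((a ∧ false) ∨ (((b ∧ false) ∨ (false ∨ (c ∧ false))) ∨ (d ∧ true))) ≡ d
  pick-rightmost₅ a b c d rewrite BP.∧-zeroʳ a | BP.∧-zeroʳ b | BP.∧-zeroʳ c | BP.∧-identityʳ d = refl

  module _ (r2 r1 : List ℤ) (len : length r2 ≡ k) where
    s = foldTop r1 r2
    membShape : ℤ → Bool → Bool → Bool → Bool → Bool → Bool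
    membShape x a b h c d = ⌊ 0ℤ ℤ.≟ x ⌋ ∨ ((isPositive (at r1 0) ∧ a) ∨ (((isPositive (s 0 ℤ.+ baseSum 0) ∧ b) ∨ (h ∨ (isPositive (s (suc m) ℤ.+ baseSum (suc m)) ∧ c))) ∨ (isPositive (at r1 (suc k)) ∧ d)))

    memb-twoRows-inner : ∀ i → 1 ≤ i → i ≤ N → (memb (ℤ.- ℤ.+ i) (S-of (suc (suc N)) l (twoRows r2 r1)) ≡ innerHits s (ℤ.- ℤ.+ i)) × (memb (ℤ.+ i) (S-of (suc (suc N)) l (twoRows r2 r1)) ≡ innerHits s (ℤ.+ i))
    memb-twoRows-inner (suc i) (s≤s _) i≤N =
      trans (memb-twoRows r2 r1 len ℤ.-[1+ i ]) (trans (cong₅ (membShape ℤ.-[1+ i ])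
          (trans (cong (λ z → ⌊ z ℤ.≟ ℤ.-[1+ i ] ⌋) shift₂-first) (≢⇒≟-false (λ e → ℕP.<-irrefl (sym (ℤP.-[1+-injective e)) (ℕP.m<n⇒m<1+n i≤N))))
          (trans (cong (λ z → ⌊ z ℤ.≟ ℤ.-[1+ i ] ⌋) shift₁-first) (≢⇒≟-false (λ e → ℕP.<-irrefl (sym (ℤP.-[1+-injective e)) i≤N)))
          refl (cong (λ z → ⌊ z ℤ.≟ ℤ.-[1+ i ] ⌋) shift₁-last) (cong (λ z → ⌊ z ℤ.≟ ℤ.-[1+ i ] ⌋) shift₁-outer))
        (pick-inner₅ (isPositive (at r1 0)) (isPositive (s 0 ℤ.+ baseSum 0)) (innerHits s ℤ.-[1+ i ]) (isPositive (s (suc m) ℤ.+ baseSum (suc m))) (isPositive (at r1 (suc k)))))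
      , trans (memb-twoRows r2 r1 len (ℤ.+ suc i)) (trans (cong₅ (membShape (ℤ.+ suc i))
          (cong (λ z → ⌊ z ℤ.≟ ℤ.+ suc i ⌋) shift₂-first)
          (cong (λ z → ⌊ z ℤ.≟ ℤ.+ suc i ⌋) shift₁-first)
          refl
          (trans (cong (λ z → ⌊ z ℤ.≟ ℤ.+ suc i ⌋) shift₁-last) (≢⇒≟-false (λ e → ℕP.<-irrefl (sym (ℕP.suc-injective (ℤP.+-injective e))) i≤N)))
          (trans (cong (λ z → ⌊ z ℤ.≟ ℤ.+ suc i ⌋) shift₁-outer) (≢⇒≟-false (λ e → ℕP.<-irrefl (sym (ℕP.suc-injective (ℤP.+-injective e))) (ℕP.m<n⇒m<1+n i≤N)))))
        (pick-inner₅ (isPositive (at r1 0)) (isPositive (s 0 ℤ.+ baseSum 0)) (innerHits s (ℤ.+ suc i)) (isPositive (s (suc m) ℤ.+ baseSum (suc m))) (isPositive (at r1 (suc k)))))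

    memb-twoRows-left : innerColumnsOK s ≡ true → memb ℤ.-[1+ N ] (S-of (suc (suc N)) l (twoRows r2 r1)) ≡ isPositive (s 0)
    memb-twoRows-left dI = trans (memb-twoRows r2 r1 len ℤ.-[1+ N ]) (trans (cong₅ (membShape ℤ.-[1+ N ])
          (trans (cong (λ z → ⌊ z ℤ.≟ ℤ.-[1+ N ] ⌋) shift₂-first) (≢⇒≟-false (λ e → ℕP.<-irrefl (sym (ℤP.-[1+-injective e)) ℕP.≤-refl)))
          (trans (cong (λ z → ⌊ z ℤ.≟ ℤ.-[1+ N ] ⌋) shift₁-first) (≟-refl _))
          (innerHits-far s dI ℤ.-[1+ N ] -[1+N]-far (λ a p ()))
          (cong (λ z → ⌊ z ℤ.≟ ℤ.-[1+ N ] ⌋) shift₁-last) (cong (λ z → ⌊ z ℤ.≟ ℤ.-[1+ N ] ⌋) shift₁-outer))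
        (trans (pick-left₅ (isPositive (at r1 0)) (isPositive (s 0 ℤ.+ baseSum 0)) (isPositive (s (suc m) ℤ.+ baseSum (suc m))) (isPositive (at r1 (suc k)))) (cong isPositive (trans (cong (λ y → s 0 ℤ.+ y) baseSum-first) (ℤP.+-identityʳ _)))))

    memb-twoRows-right : innerColumnsOK s ≡ true → memb (ℤ.+ suc N) (S-of (suc (suc N)) l (twoRows r2 r1)) ≡ isPositive (s (suc m))
    memb-twoRows-right dI = trans (memb-twoRows r2 r1 len (ℤ.+ suc N)) (trans (cong₅ (membShape (ℤ.+ suc N))
          (cong (λ z → ⌊ z ℤ.≟ ℤ.+ suc N ⌋) shift₂-first) (cong (λ z → ⌊ z ℤ.≟ ℤ.+ suc N ⌋) shift₁-first)
          (innerHits-far s dI (ℤ.+ suc N) (λ a p ()) +[1+N]-far)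
          (trans (cong (λ z → ⌊ z ℤ.≟ ℤ.+ suc N ⌋) shift₁-last) (≟-refl _))
          (trans (cong (λ z → ⌊ z ℤ.≟ ℤ.+ suc N ⌋) shift₁-outer) (≢⇒≟-false (λ e → ℕP.<-irrefl (sym (ℕP.suc-injective (ℤP.+-injective e))) ℕP.≤-refl))))
        (trans (pick-right₅ (isPositive (at r1 0)) (isPositive (s 0 ℤ.+ baseSum 0)) (isPositive (s (suc m) ℤ.+ baseSum (suc m))) (isPositive (at r1 (suc k)))) (cong isPositive (trans (cong (λ y → s (suc m) ℤ.+ y) baseSum-last) (ℤP.+-identityʳ _)))))

    memb-twoRows-leftmost : innerColumnsOK s ≡ true → memb ℤ.-[1+ suc N ] (S-of (suc (suc N)) l (twoRows r2 r1)) ≡ isPositive (at r1 0)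
    memb-twoRows-leftmost dI = trans (memb-twoRows r2 r1 len ℤ.-[1+ suc N ]) (trans (cong₅ (membShape ℤ.-[1+ suc N ])
          (trans (cong (λ z → ⌊ z ℤ.≟ ℤ.-[1+ suc N ] ⌋) shift₂-first) (≟-refl _))
          (trans (cong (λ z → ⌊ z ℤ.≟ ℤ.-[1+ suc N ] ⌋) shift₁-first) (≢⇒≟-false (λ e → ℕP.<-irrefl (ℤP.-[1+-injective e) ℕP.≤-refl)))
          (innerHits-far s dI ℤ.-[1+ suc N ] (λ a p e → ℕP.<-irrefl (sym (ℤP.-[1+-injective e)) (ℕP.m<n⇒m<1+n p)) (λ a p ()))
          (cong (λ z → ⌊ z ℤ.≟ ℤ.-[1+ suc N ] ⌋) shift₁-last) (cong (λ z → ⌊ z ℤ.≟ ℤ.-[1+ suc N ] ⌋) shift₁-outer))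
        (pick-leftmost₅ (isPositive (at r1 0)) (isPositive (s 0 ℤ.+ baseSum 0)) (isPositive (s (suc m) ℤ.+ baseSum (suc m))) (isPositive (at r1 (suc k)))))

    memb-twoRows-rightmost : innerColumnsOK s ≡ true → memb (ℤ.+ suc (suc N)) (S-of (suc (suc N)) l (twoRows r2 r1)) ≡ isPositive (at r1 (suc k))
    memb-twoRows-rightmost dI = trans (memb-twoRows r2 r1 len (ℤ.+ suc (suc N))) (trans (cong₅ (membShape (ℤ.+ suc (suc N)))
          (cong (λ z → ⌊ z ℤ.≟ ℤ.+ suc (suc N) ⌋) shift₂-first) (cong (λ z → ⌊ z ℤ.≟ ℤ.+ suc (suc N) ⌋) shift₁-first)
          (innerHits-far s dI (ℤ.+ suc (suc N)) (λ a p ()) (λ a p e → ℕP.<-irrefl (sym (ℕP.suc-injective (ℤP.+-injective e))) (ℕP.m<n⇒m<1+n p)))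
          (trans (cong (λ z → ⌊ z ℤ.≟ ℤ.+ suc (suc N) ⌋) shift₁-last) (≢⇒≟-false (λ e → ℕP.<-irrefl (ℕP.suc-injective (ℤP.+-injective e)) ℕP.≤-refl)))
          (trans (cong (λ z → ⌊ z ℤ.≟ ℤ.+ suc (suc N) ⌋) shift₁-outer) (≟-refl _)))
        (pick-rightmost₅ (isPositive (at r1 0)) (isPositive (s 0 ℤ.+ baseSum 0)) (isPositive (s (suc m) ℤ.+ baseSum (suc m))) (isPositive (at r1 (suc k)))))

  IsBit⇒isEntry : ∀ {x} → IsBit x → isEntry x ≡ true
  IsBit⇒isEntry (inj₁ refl) = refl
  IsBit⇒isEntry (inj₂ refl) = refl

  reassoc-twoRows : ∀ rc ro2 ro1 ga0 gs0 gsL gaK mp xr n0 nK →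
    (((rc ∧ (ro2 ∧ true)) ∧ (ro1 ∧ true)) ∧ (ga0 ∧ ((true ∧ (gs0 ∧ (true ∧ gsL))) ∧ gaK))) ∧ ((mp ∧ xr) ∧ (n0 ∧ nK))
    ≡ rc ∧ (((ro1 ∧ (ga0 ∧ (gaK ∧ (n0 ∧ nK)))) ∧ (ro2 ∧ (true ∧ (gs0 ∧ (gsL ∧ xr))))) ∧ (true ∧ mp))
  reassoc-twoRows = solve 11 (λ rc ro2 ro1 ga0 gs0 gsL gaK mp xr n0 nK →
    (((rc ⊕ (ro2 ⊕ ∧-Solver.id)) ⊕ (ro1 ⊕ ∧-Solver.id)) ⊕ (ga0 ⊕ ((∧-Solver.id ⊕ (gs0 ⊕ (∧-Solver.id ⊕ gsL))) ⊕ gaK))) ⊕ ((mp ⊕ xr) ⊕ (n0 ⊕ nK))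
    ⊜ rc ⊕ (((ro1 ⊕ (ga0 ⊕ (gaK ⊕ (n0 ⊕ nK)))) ⊕ (ro2 ⊕ (∧-Solver.id ⊕ (gs0 ⊕ (gsL ⊕ xr))))) ⊕ (∧-Solver.id ⊕ mp))) refl

  twoRows-falseˡ : ∀ R a x b M → (R ∧ (a ∧ ((false ∧ x) ∧ b))) ∧ M ≡ false
  twoRows-falseˡ false a x b M = refl
  twoRows-falseˡ true false x b M = refl
  twoRows-falseˡ true true x b M = refl

  twoRows-falseˡ′ : ∀ R a d0 dL b M → (R ∧ (a ∧ ((true ∧ (d0 ∧ (false ∧ dL))) ∧ b))) ∧ M ≡ false
  twoRows-falseˡ′ false a d0 dL b M = refl
  twoRows-falseˡ′ true false d0 dL b M = refl
  twoRows-falseˡ′ true true false dL b M = refl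
  twoRows-falseˡ′ true true true dL b M = refl

  twoRows-falseʳ : ∀ rc L1 r2 Y Z → rc ∧ ((L1 ∧ (r2 ∧ (false ∧ Y))) ∧ Z) ≡ false
  twoRows-falseʳ false L1 r2 Y Z = refl
  twoRows-falseʳ true false r2 Y Z = refl
  twoRows-falseʳ true true false Y Z = refl
  twoRows-falseʳ true true true Y Z = refl

  twoRows-falseʳ′ : ∀ rc L mp → rc ∧ (L ∧ (false ∧ mp)) ≡ false
  twoRows-falseʳ′ false L mp = refl
  twoRows-falseʳ′ true false mp = refl
  twoRows-falseʳ′ true true mp = refl

  reduce-twoRows : ∀ r2 r1 → IsWord k r2 → IsWord (suc (suc k)) r1 →
    isASTrapezoid (suc (suc N)) l (twoRows r2 r1) ∧ M-of (suc (suc N)) l (twoRows r2 r1) ≡ᴸ (P ++ 0ℤ ∷ -1ℤ ∷ [])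
    ≡ all rowOK C ∧ (topRowsOK m r1 r2 ∧ fitsBase (foldTop r1 r2))
  reduce-twoRows r2 r1 vw2 vw1 = trans (cong₂ _∧_ (trans (isASTrapezoid-unfold (suc (suc N)) l (twoRows r2 r1)) (cong₂ _∧_ e-rows (columns-twoRows r2 r1 vw2 vw1))) e-M)
                            (fin (allBelow k (λ j → pairOK (at r1 (suc j)) (at r2 j))) (innerColumnsOK σA) refl refl)
    where
    σA = foldTop r1 r2
    μA : ℤ → Bool
    μA x = memb x (S-of (suc (suc N)) l (twoRows r2 r1))
    e-rows : all rowOK (twoRows r2 r1) ≡ (all rowOK C ∧ (rowOK r2 ∧ true)) ∧ (rowOK r1 ∧ true)
    e-rows = trans (all-++ rowOK (C ++ r2 ∷ []) (r1 ∷ [])) (cong (_∧ (rowOK r1 ∧ true)) (all-++ rowOK C (r2 ∷ [])))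
    e-M : M-of (suc (suc N)) l (twoRows r2 r1) ≡ᴸ (P ++ 0ℤ ∷ -1ℤ ∷ []) ≡ (motzkinOf N μA ≡ᴸ P ∧ ⌊ motzkinStep (suc N) μA ℤ.≟ 0ℤ ⌋) ∧ ⌊ motzkinStep (suc (suc N)) μA ℤ.≟ -1ℤ ⌋
    e-M = trans (cong₂ _≡ᴸ_ (trans (motzkinOf-snoc (suc N) μA) (cong (_∷ʳ motzkinStep (suc (suc N)) μA) (motzkinOf-snoc N μA))) (sym (LP.++-assoc P (0ℤ ∷ []) (-1ℤ ∷ []))))
            (trans (≡ᴸ-snoc (motzkinOf N μA ∷ʳ motzkinStep (suc N) μA) (P ∷ʳ 0ℤ) (motzkinStep (suc (suc N)) μA) -1ℤ)
                   (cong (_∧ ⌊ motzkinStep (suc (suc N)) μA ℤ.≟ -1ℤ ⌋) (≡ᴸ-snoc (motzkinOf N μA) P (motzkinStep (suc N) μA) 0ℤ)))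
    R = (all rowOK C ∧ (rowOK r2 ∧ true)) ∧ (rowOK r1 ∧ true)
    D0 = stackOK (label₁ 0) (σA 0) (baseColumn C 0)
    DL = stackOK (label₁ (suc m)) (σA (suc m)) (baseColumn C (suc m))
    Mp = (motzkinOf N μA ≡ᴸ P ∧ ⌊ motzkinStep (suc N) μA ℤ.≟ 0ℤ ⌋) ∧ ⌊ motzkinStep (suc (suc N)) μA ℤ.≟ -1ℤ ⌋
    fin : ∀ o d → allBelow k (λ j → pairOK (at r1 (suc j)) (at r2 j)) ≡ o → innerColumnsOK σA ≡ d →
          (R ∧ (soloOK (at r1 0) ∧ ((o ∧ (D0 ∧ (d ∧ DL))) ∧ soloOK (at r1 (suc k))))) ∧ Mp
          ≡ all rowOK C ∧ ((firstRowOK m r1 ∧ (rowOK r2 ∧ (o ∧ (soloOK (σA 0) ∧ (soloOK (σA (suc m)) ∧ (isPositive (σA 0) xor isPositive (σA (suc m)))))))) ∧ (d ∧ motzkinOf N (innerHits σA) ≡ᴸ P))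
    fin false d _ _ = trans (twoRows-falseˡ R (soloOK (at r1 0)) (D0 ∧ (d ∧ DL)) (soloOK (at r1 (suc k))) Mp) (sym (twoRows-falseʳ (all rowOK C) (firstRowOK m r1) (rowOK r2) (soloOK (σA 0) ∧ (soloOK (σA (suc m)) ∧ (isPositive (σA 0) xor isPositive (σA (suc m))))) (d ∧ motzkinOf N (innerHits σA) ≡ᴸ P)))
    fin true false _ _ = trans (twoRows-falseˡ′ R (soloOK (at r1 0)) D0 DL (soloOK (at r1 (suc k))) Mp) (sym (twoRows-falseʳ′ (all rowOK C) (firstRowOK m r1 ∧ (rowOK r2 ∧ (true ∧ (soloOK (σA 0) ∧ (soloOK (σA (suc m)) ∧ (isPositive (σA 0) xor isPositive (σA (suc m)))))))) (motzkinOf N (innerHits σA) ≡ᴸ P)))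
    fin true true okE dE =
      trans (cong₃ (λ a b c → (R ∧ (soloOK (at r1 0) ∧ ((true ∧ (a ∧ (true ∧ b))) ∧ soloOK (at r1 (suc k))))) ∧ c) d0 dL'
                (cong₃ (λ a b c → (a ≡ᴸ P ∧ b) ∧ c)
                   (motzkinOf-cong N μA (innerHits σA) (memb-twoRows-inner r2 r1 (proj₁ vw2)))
                   (trans (cong₂ (λ a b → ⌊ (indicator a ℤ.+ indicator b) ℤ.- 1ℤ ℤ.≟ 0ℤ ⌋) (memb-twoRows-left r2 r1 (proj₁ vw2) dE) (memb-twoRows-right r2 r1 (proj₁ vw2) dE)) (motzkinStep≟0 (isPositive (σA 0)) (isPositive (σA (suc m)))))
                   (trans (cong₂ (λ a b → ⌊ (indicator a ℤ.+ indicator b) ℤ.- 1ℤ ℤ.≟ -1ℤ ⌋) (memb-twoRows-leftmost r2 r1 (proj₁ vw2) dE) (memb-twoRows-rightmost r2 r1 (proj₁ vw2) dE)) (motzkinStep≟-1 (isPositive (at r1 0)) (isPositive (at r1 (suc k)))))))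
        (reassoc-twoRows (all rowOK C) (rowOK r2) (rowOK r1) (soloOK (at r1 0)) (soloOK (σA 0)) (soloOK (σA (suc m))) (soloOK (at r1 (suc k)))
                  (motzkinOf N (innerHits σA) ≡ᴸ P) (isPositive (σA 0) xor isPositive (σA (suc m))) (not (isPositive (at r1 0))) (not (isPositive (at r1 (suc k)))))
      where
      inVs : ∀ j → j < k → isEntry (σA j) ≡ true
      inVs j p = IsBit⇒isEntry (proj₁ (proj₂ (pairOK⇒IsBit (at r1 (suc j)) (at r2 j) (allBelow-elim k (λ j → pairOK (at r1 (suc j)) (at r2 j)) okE j p))))
      d0 : D0 ≡ soloOK (σA 0)
      d0 = trans (stackOK-outer′ (label₁ 0) (σA 0) (baseColumn C 0) ¬central₁-first base-first-zero) (sym (trans (cong (columnOK (σA 0 ∷ []) ∧_) (inVs 0 (s≤s z≤n))) (BP.∧-identityʳ _)))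
      dL' : DL ≡ soloOK (σA (suc m))
      dL' = trans (stackOK-outer′ (label₁ (suc m)) (σA (suc m)) (baseColumn C (suc m)) ¬central₁-last base-last-zero) (sym (trans (cong (columnOK (σA (suc m) ∷ []) ∧_) (inVs (suc m) ℕP.≤-refl)) (BP.∧-identityʳ _)))

All-concatMap : ∀ {A B : Set} {Q : A → Set} {P : B → Set} (f : A → List B) {xs} → All Q xs → (∀ x → Q x → All P (f x)) → All P (concatMap f xs)
All-concatMap f [] h = []
All-concatMap f (q ∷ qs) h = ++⁺ (h _ q) (All-concatMap f qs h)

All-map : ∀ {A B : Set} {Q : A → Set} {P : B → Set} (g : A → B) {ys} → All Q ys → (∀ y → Q y → P (g y)) → All P (map g ys)
All-map g [] h = []
All-map g (q ∷ qs) h = h _ q ∷ All-map g qs h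

candidates-ZeroBeyond : ∀ l' N → All (ZeroBeyond l' N) (candidates (suc l') N)
candidates-ZeroBeyond l' zero = (λ j _ → []) ∷ []
candidates-ZeroBeyond l' (suc N) = All-concatMap _ (candidates-ZeroBeyond l' N) (λ A sA → All-map _ (wordsOf-IsWord (l' + 2 * suc N)) (λ r vw → snoc-ZeroBeyond A sA r vw))
  where
  snoc-ZeroBeyond : ∀ A → ZeroBeyond l' N A → ∀ r → IsWord (l' + 2 * suc N) r → ZeroBeyond l' (suc N) (A ++ r ∷ [])
  snoc-ZeroBeyond A sA r (len , _) j p = subst AllZero (sym (cong (λ g → colOf g j) (grid-snoc A r))) (go j p)
    where
    go : ∀ j → l' + 2 * suc N ≤ j → AllZero (at (r ++ []) j ∷ colOf (padTop 1 (reverse A)) j)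
    go j p with subst (_≤ j) (l+2[1+N] l' N) p
    ... | s≤s (s≤s q) = trans (at-++[] r _) (at-beyond r _ (subst (_≤ _) (sym len) p))
                        ∷ subst AllZero (sym (padShift 0 (reverse A) _)) (sA _ (ℕP.≤-trans q (ℕP.n≤1+n _)))

-- Summing over bases

counts : ℕ → ℕ → List ℤ → List (List ℤ) → ℕ
counts n l M A = 𝟙 (isASTrapezoid n l A ∧ M-of n l A ≡ᴸ M)

extensions₁ : ℕ → ℕ → List ℤ → List (List ℤ) → ℕ
extensions₁ l N M C = sumOver (wordsOf (l ℕ.+ 2 ℕ.* suc N ∸ 1)) (λ r → counts (suc N) l M (C ++ r ∷ []))

extensions₂ : ℕ → ℕ → List ℤ → List (List ℤ) → ℕ
extensions₂ l N M C =
  sumOver (wordsOf (l ℕ.+ 2 ℕ.* suc N ∸ 1)) (λ r2 →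
    sumOver (wordsOf (l ℕ.+ 2 ℕ.* suc (suc N) ∸ 1)) (λ r1 → counts (suc (suc N)) l M ((C ++ r2 ∷ []) ++ r1 ∷ [])))

w-sumOver-candidates : ∀ l M → w l M ≡ sumOver (candidates l (length M)) (counts (length M) l M)
w-sumOver-candidates l M = length-filter-sumOver _ (candidates l (length M))

sumOver-candidates-suc : ∀ l N M →
  sumOver (candidates l (suc N)) (counts (suc N) l M) ≡ sumOver (candidates l N) (extensions₁ l N M)
sumOver-candidates-suc l N M = begin
    sumOver (concatMap snoc (candidates l N)) (counts (suc N) l M)
  ≡⟨ sumOver-concatMap snoc (candidates l N) _ ⟩
    sumOver (candidates l N) (λ C → sumOver (snoc C) (counts (suc N) l M))
  ≡⟨ sumOver-cong (candidates l N) (λ C → sumOver-map (λ r → C ++ r ∷ []) (wordsOf (l ℕ.+ 2 ℕ.* suc N ∸ 1)) _) ⟩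
    sumOver (candidates l N) (extensions₁ l N M) ∎
  where
  open ≡-Reasoning
  snoc : List (List ℤ) → List (List (List ℤ))
  snoc C = map (λ r → C ++ r ∷ []) (wordsOf (l ℕ.+ 2 ℕ.* suc N ∸ 1))

sumOver-candidates-suc² : ∀ l N M →
  sumOver (candidates l (suc (suc N))) (counts (suc (suc N)) l M) ≡ sumOver (candidates l N) (extensions₂ l N M)
sumOver-candidates-suc² l N M = begin
    sumOver (concatMap snoc₁ (concatMap snoc₂ (candidates l N))) (counts (suc (suc N)) l M)
  ≡⟨ sumOver-concatMap snoc₁ (concatMap snoc₂ (candidates l N)) _ ⟩
    sumOver (concatMap snoc₂ (candidates l N)) (λ B → sumOver (snoc₁ B) (counts (suc (suc N)) l M))
  ≡⟨ sumOver-concatMap snoc₂ (candidates l N) _ ⟩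
    sumOver (candidates l N) (λ C → sumOver (snoc₂ C) (λ B → sumOver (snoc₁ B) (counts (suc (suc N)) l M)))
  ≡⟨ sumOver-cong (candidates l N) (λ C → trans (sumOver-map (λ r2 → C ++ r2 ∷ []) (wordsOf (l ℕ.+ 2 ℕ.* suc N ∸ 1)) _)
       (sumOver-cong (wordsOf (l ℕ.+ 2 ℕ.* suc N ∸ 1)) (λ r2 → sumOver-map (λ r1 → (C ++ r2 ∷ []) ++ r1 ∷ []) (wordsOf (l ℕ.+ 2 ℕ.* suc (suc N) ∸ 1)) _))) ⟩
    sumOver (candidates l N) (extensions₂ l N M) ∎
  where
  open ≡-Reasoning
  snoc₁ : List (List ℤ) → List (List (List ℤ))
  snoc₁ B = map (λ r1 → B ++ r1 ∷ []) (wordsOf (l ℕ.+ 2 ℕ.* suc (suc N) ∸ 1))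
  snoc₂ : List (List ℤ) → List (List (List ℤ))
  snoc₂ C = map (λ r2 → C ++ r2 ∷ []) (wordsOf (l ℕ.+ 2 ℕ.* suc N ∸ 1))

w-by-base₁ : ∀ l N M → length M ≡ suc N → w l M ≡ sumOver (candidates l N) (extensions₁ l N M)
w-by-base₁ l N M eq = begin
    w l M
  ≡⟨ w-sumOver-candidates l M ⟩
    sumOver (candidates l (length M)) (counts (length M) l M)
  ≡⟨ cong (λ n → sumOver (candidates l n) (counts n l M)) eq ⟩
    sumOver (candidates l (suc N)) (counts (suc N) l M)
  ≡⟨ sumOver-candidates-suc l N M ⟩
    sumOver (candidates l N) (extensions₁ l N M) ∎
  where open ≡-Reasoning

w-by-base₂ : ∀ l N M → length M ≡ suc (suc N) → w l M ≡ sumOver (candidates l N) (extensions₂ l N M)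
w-by-base₂ l N M eq = begin
    w l M
  ≡⟨ w-sumOver-candidates l M ⟩
    sumOver (candidates l (length M)) (counts (length M) l M)
  ≡⟨ cong (λ n → sumOver (candidates l n) (counts n l M)) eq ⟩
    sumOver (candidates l (suc (suc N))) (counts (suc (suc N)) l M)
  ≡⟨ sumOver-candidates-suc² l N M ⟩
    sumOver (candidates l N) (extensions₂ l N M) ∎
  where open ≡-Reasoning

module PerBase (l' N : ℕ) (P : List ℤ) (C : List (List ℤ)) (shC : ZeroBeyond l' N C) where
  open OverBase l' N P C shC

  fitCount : ℕ
  fitCount = sumBelow m (λ i → 𝟙 (fitsBase (δ (suc i))))

  extensions₂-fitCount : extensions₂ l N (P ++ 0ℤ ∷ -1ℤ ∷ []) C ≡ 𝟙 (all rowOK C) * (suc k * fitCount)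
  extensions₂-fitCount = begin
      sumOver (wordsOf (l ℕ.+ 2 ℕ.* suc N ∸ 1)) (λ r2 → sumOver (wordsOf (l ℕ.+ 2 ℕ.* suc (suc N) ∸ 1)) (G r2))
    ≡⟨ cong₂ (λ a b → sumOver (wordsOf a) (λ r2 → sumOver (wordsOf b) (G r2))) width₁≡k width₂≡2+k ⟩
      sumOver (wordsOf k) (λ r2 → sumOver (wordsOf (suc (suc k))) (G r2))
    ≡⟨ sumOver-cong-onAll _ _ (wordsOf-IsWord k) (λ r2 vw2 → sumOver-cong-onAll _ _ (wordsOf-IsWord (suc (suc k))) (λ r1 vw1 →
          trans (cong 𝟙 (reduce-twoRows r2 r1 vw2 vw1)) (𝟙-∧ (all rowOK C) _))) ⟩
      sumOver (wordsOf k) (λ r2 → sumOver (wordsOf (suc (suc k))) (λ r1 → 𝟙 (all rowOK C) * TwoTopRows.topPairCount m fitsBase fitsBase-cong r1 r2))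
    ≡⟨ trans (sumOver-cong (wordsOf k) (λ r2 → sumOver-* (wordsOf (suc (suc k))) (𝟙 (all rowOK C)) _)) (sumOver-* (wordsOf k) (𝟙 (all rowOK C)) _) ⟩
      𝟙 (all rowOK C) * sumOver (wordsOf k) (λ r2 → sumOver (wordsOf (suc (suc k))) (λ r1 → TwoTopRows.topPairCount m fitsBase fitsBase-cong r1 r2))
    ≡⟨ cong (𝟙 (all rowOK C) *_) (TwoTopRows.count-two-top-rows m fitsBase fitsBase-cong) ⟩
      𝟙 (all rowOK C) * (suc k * fitCount) ∎
    where
    open ≡-Reasoning
    G : List ℤ → List ℤ → ℕ
    G r2 r1 = counts (suc (suc N)) l (P ++ 0ℤ ∷ -1ℤ ∷ []) ((C ++ r2 ∷ []) ++ r1 ∷ [])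

  extensions₁-fitCount : extensions₁ l N (P ++ -1ℤ ∷ []) C ≡ 𝟙 (all rowOK C) * fitCount
  extensions₁-fitCount = begin
      sumOver (wordsOf (l ℕ.+ 2 ℕ.* suc N ∸ 1)) G
    ≡⟨ cong (λ a → sumOver (wordsOf a) G) width₁≡k ⟩
      sumOver (wordsOf k) G
    ≡⟨ sumOver-cong-onAll _ _ (wordsOf-IsWord k) (λ r vw → trans (cong 𝟙 (reduce-oneRow r vw)) (𝟙-∧ (all rowOK C) _)) ⟩
      sumOver (wordsOf k) (λ r → 𝟙 (all rowOK C) * 𝟙 (topRowOK m r ∧ fitsBase (at r)))
    ≡⟨ sumOver-* (wordsOf k) (𝟙 (all rowOK C)) _ ⟩
      𝟙 (all rowOK C) * sumOver (wordsOf k) (λ r → 𝟙 (topRowOK m r ∧ fitsBase (at r)))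
    ≡⟨ cong (𝟙 (all rowOK C) *_) (OneTopRow.count-top-row m fitsBase fitsBase-cong fitsBase-no-1) ⟩
      𝟙 (all rowOK C) * fitCount ∎
    where
    open ≡-Reasoning
    G : List ℤ → ℕ
    G r = counts (suc N) l (P ++ -1ℤ ∷ []) (C ++ r ∷ [])

extensions₂≡ : ∀ l' N P C → ZeroBeyond l' N C →
  extensions₂ (suc l') N (P ++ 0ℤ ∷ -1ℤ ∷ []) C ≡ (suc l' + 2 * suc N) * extensions₁ (suc l') N (P ++ -1ℤ ∷ []) C
extensions₂≡ l' N P C sh = begin
    extensions₂ (suc l') N (P ++ 0ℤ ∷ -1ℤ ∷ []) C
  ≡⟨ extensions₂-fitCount ⟩
    𝟙 (all rowOK C) * (suc (suc (suc (l' + 2 * N))) * fitCount)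
  ≡⟨ rearrange (𝟙 (all rowOK C)) l' N fitCount ⟩
    (suc l' + 2 * suc N) * (𝟙 (all rowOK C) * fitCount)
  ≡⟨ cong ((suc l' + 2 * suc N) *_) (sym extensions₁-fitCount) ⟩
    (suc l' + 2 * suc N) * extensions₁ (suc l') N (P ++ -1ℤ ∷ []) C ∎
  where
  open ≡-Reasoning
  open PerBase l' N P C sh
  rearrange : ∀ b l' N c → b * (suc (suc (suc (l' + 2 * N))) * c) ≡ (suc l' + 2 * suc N) * (b * c)
  rearrange = solveℕ

length-++-∷ : ∀ (P xs : List ℤ) → length (P ++ xs) ≡ length xs + length P
length-++-∷ P xs = trans (LP.length-++ P) (ℕP.+-comm (length P) (length xs))

proposition6p4 : (P : List ℤ) (l : ℕ) → 1 ≤ l → IsMotzkin (P ++ -1ℤ ∷ [])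
    → w l (P ++ 0ℤ ∷ -1ℤ ∷ []) ≡ (l + 2 * length (P ++ -1ℤ ∷ [])) * w l (P ++ -1ℤ ∷ [])
proposition6p4 P (suc l') (s≤s _) _ = begin
    w l M′
  ≡⟨ w-by-base₂ l N M′ (length-++-∷ P (0ℤ ∷ -1ℤ ∷ [])) ⟩
    sumOver (candidates l N) (extensions₂ l N M′)
  ≡⟨ sumOver-cong-onAll _ _ (candidates-ZeroBeyond l' N) (extensions₂≡ l' N P) ⟩
    sumOver (candidates l N) (λ C → (l + 2 * suc N) * extensions₁ l N M C)
  ≡⟨ sumOver-* (candidates l N) (l + 2 * suc N) _ ⟩
    (l + 2 * suc N) * sumOver (candidates l N) (extensions₁ l N M)
  ≡⟨ cong₂ (λ n c → (l + 2 * n) * c) (sym (length-++-∷ P (-1ℤ ∷ []))) (sym (w-by-base₁ l N M (length-++-∷ P (-1ℤ ∷ [])))) ⟩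
    (l + 2 * length M) * w l M ∎
  where
  open ≡-Reasoning
  l = suc l'
  N = length P
  M′ = P ++ 0ℤ ∷ -1ℤ ∷ []
  M = P ++ -1ℤ ∷ []
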